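{- Let $\Sigma^{(2)}$ be the set of $3$-nonnesting open permutation diagrams. To each $\sigma\in\Sigma^{(2)}$ associate the label $\ell(\sigma)=[h,r,s]$, where $2h$ is the total number of semi-arcs of $\sigma$, $r$ is the number of upper semi-arcs belonging to a future enhanced upper $2$-nesting, and $s$ is the number of lower semi-arcs belonging to a future lower $2$-nesting. Consider the generating tree with root label $[0,0,0]$ and succession rule sending $[h,r,s]$ to the labels: (1) $[h,h,s]$; (2) $[h+1,r,s]$; (3) $[h,i,s]$ for each $i$ with $\max\{0,r-1\}\le i\le h-1$; (4) $[h,r,j]$ for each $j$ with $\max\{0,s-1\}\le j\le h-1$; (5) $[h-1,i,j]$ for each pair $(i,j)$ with $\max\{0,r-1\}\le i\le h-1$ and $\max\{0,s-1\}\le j\le h-1$. Then for every $n\ge0$ the number of diagrams in $\Sigma^{(2)}$ of size $n$ equals the number of nodes at level $n$ of this tree, and the number of $3$-nonnesting permutations of size $n$ equals the number of nodes with label $[0,0,0]$ at level $n$.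
   Context: An open permutation diagram of size $n\ge0$ consists of vertices $1,\dots,n$ in a row together with upper arcs $(a,b)$, $a<b$ (drawn above), upper semi-arcs $(a,*)$ (drawn above, with a left end-point only), lower arcs $(a,b)$, $a<b$ (drawn below) and lower semi-arcs $(a,*)$ (drawn below), such that each vertex is of one of the following types: fixed point (incident to nothing); opener (left end-point of exactly one upper arc or upper semi-arc and exactly one lower arc or lower semi-arc, and nothing else); closer (right end-point of exactly one upper arc and exactly one lower arc, and nothing else); upper transitory (right end-point of one upper arc and left end-point of one upper arc or upper semi-arc, and nothing else); lower transitory (the same with lower in place of upper). The number of upper semi-arcs then equals the number of lower semi-arcs. A permutation $\sigma$ of $\{1,\dots,n\}$ is identified with the diagram without semi-arcs having an upper arc $(i,\sigma(i))$ whenever $i<\sigma(i)$ and a lower arc $(\sigma(i),i)$ whenever $\sigma(i)<i$ (vertices with $\sigma(i)=i$ are fixed points). An upper (resp. lower) $k$-nesting is a set of $k$ upper (resp. lower) arcs $(i_1,j_1),\dots,(i_k,j_k)$ with $i_1<\dots<i_k<j_k<\dots<j_1$. An upper enhanced $k$-nesting is an upper $k$-nesting, or $k-1$ upper arcs $(i_1,j_1),\dots,(i_{k-1},j_{k-1})$ and a fixed point $i_k$ with $i_1<\dots<i_{k-1}<i_k<j_{k-1}<\dots<j_1$. A future enhanced upper $k$-nesting is an upper enhanced $(k-1)$-nesting together with an upper semi-arc whose left end-point is smaller than all its vertices; a future lower $k$-nesting is a lower $(k-1)$-nesting together with a lower semi-arc whose left end-point is smaller than all its vertices. An open permutation diagram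 (or permutation) is $k$-nonnesting if it contains no upper enhanced $k$-nesting, no future enhanced upper $k$-nesting, no lower $k$-nesting and no future lower $k$-nesting. A generating tree with root label $L_0$ and a succession rule (assigning to each label a finite list of labels, with multiplicity) is the rooted tree whose root, at level $0$, has label $L_0$, and in which each node with label $L$ has one child for each entry of the list assigned to $L$, labelled by that entry; level $n$ consists of the nodes at distance $n$ from the root. -}

module Defs where

open import Data.Bool using (Bool; true; false; _∧_; _∨_; not; T)
open import Data.Nat using (ℕ; zero; suc; _+_; _∸_; _<ᵇ_; _≡ᵇ_; _≤ᵇ_)
open import Data.Fin using (Fin; toℕ)
open import Data.Vec using (Vec; lookup)
open import Data.List using (List; []; _∷_; map; concatMap; upTo; allFin; length; filterᵇ)
open import Data.Bool.ListAction using (any; all)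
open import Data.Product using (Σ; _×_; _,_)

record Label : Set where
  constructor [_,_,_]
  field
    h r s : ℕ

range : ℕ → ℕ → List ℕ
range a b = map (a +_) (upTo (b ∸ a))

-- the succession rule; note max{0, r-1} = r ∸ 1 in ℕ, and
-- "i ≤ h - 1" is encoded as i < h (so the ranges are empty if h = 0)
children : Label → List Label
children [ h , r , s ] =
     ([ h , h , s ] ∷ [])
  ++ ([ suc h , r , s ] ∷ [])
  ++ map (λ i → [ h , i , s ]) (range (r ∸ 1) h)
  ++ map (λ j → [ h , r , j ]) (range (s ∸ 1) h)
  ++ concatMap (λ i → map (λ j → [ h ∸ 1 , i , j ]) (range (s ∸ 1) h))
               (range (r ∸ 1) h)
  where open Data.List using (_++_)

root : Label
root = [ 0 , 0 , 0 ]

level : ℕ → List Label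
level zero    = root ∷ []
level (suc n) = concatMap children (level n)

isRoot : Label → Bool
isRoot [ h , r , s ] = (h ≡ᵇ 0) ∧ ((r ≡ᵇ 0) ∧ (s ≡ᵇ 0))

nodesAtLevel : ℕ → ℕ
nodesAtLevel n = length (level n)

rootLabelledAtLevel : ℕ → ℕ
rootLabelledAtLevel n = length (filterᵇ isRoot (level n))

-- Arc data of a (open) diagram on vertices Fin n (vertex k ↔ k+1)

_<F_ : ∀ {n} → Fin n → Fin n → Bool
a <F b = toℕ a <ᵇ toℕ b

_==F_ : ∀ {n} → Fin n → Fin n → Bool
a ==F b = toℕ a ≡ᵇ toℕ b

exF : ∀ {n} → (Fin n → Bool) → Bool
exF {n} p = any p (allFin n)

allF : ∀ {n} → (Fin n → Bool) → Bool
allF {n} p = all p (allFin n)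

-- the incidence structure of a diagram: upper arcs (a,b), upper
-- semi-arcs (a,*), lower arcs, lower semi-arcs, fixed points
record ArcData (n : ℕ) : Set where
  field
    arcU  : Fin n → Fin n → Bool
    semiU : Fin n → Bool
    arcL  : Fin n → Fin n → Bool
    semiL : Fin n → Bool
    fixed : Fin n → Bool

module _ {n : ℕ} (D : ArcData n) where
  open ArcData D

  upperEnh3 : Bool
  upperEnh3 =
      exF (λ i1 → exF (λ j1 → exF (λ i2 → exF (λ j2 → exF (λ i3 → exF (λ j3 →
        arcU i1 j1 ∧ arcU i2 j2 ∧ arcU i3 j3 ∧
        (i1 <F i2) ∧ (i2 <F i3) ∧ (i3 <F j3) ∧ (j3 <F j2) ∧ (j2 <F j1)))))))
    ∨ exF (λ i1 → exF (λ j1 → exF (λ i2 → exF (λ j2 → exF (λ f →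
        arcU i1 j1 ∧ arcU i2 j2 ∧ fixed f ∧
        (i1 <F i2) ∧ (i2 <F f) ∧ (f <F j2) ∧ (j2 <F j1))))))

  futureUpperEnh3 : Bool
  futureUpperEnh3 = exF (λ a → semiU a ∧
     ( exF (λ i1 → exF (λ j1 → exF (λ i2 → exF (λ j2 →
         arcU i1 j1 ∧ arcU i2 j2 ∧
         (a <F i1) ∧ (i1 <F i2) ∧ (i2 <F j2) ∧ (j2 <F j1)))))
     ∨ exF (λ i1 → exF (λ j1 → exF (λ f →
         arcU i1 j1 ∧ fixed f ∧
         (a <F i1) ∧ (i1 <F f) ∧ (f <F j1))))))

  lower3 : Bool
  lower3 =
    exF (λ i1 → exF (λ j1 → exF (λ i2 → exF (λ j2 → exF (λ i3 → exF (λ j3 →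
      arcL i1 j1 ∧ arcL i2 j2 ∧ arcL i3 j3 ∧
      (i1 <F i2) ∧ (i2 <F i3) ∧ (i3 <F j3) ∧ (j3 <F j2) ∧ (j2 <F j1)))))))

  futureLower3 : Bool
  futureLower3 = exF (λ a → semiL a ∧
     exF (λ i1 → exF (λ j1 → exF (λ i2 → exF (λ j2 →
       arcL i1 j1 ∧ arcL i2 j2 ∧
       (a <F i1) ∧ (i1 <F i2) ∧ (i2 <F j2) ∧ (j2 <F j1))))))

  nonnesting3 : Bool
  nonnesting3 = not (upperEnh3 ∨ futureUpperEnh3 ∨ lower3 ∨ futureLower3)

-- what starts at a vertex on one side (upper or lower):
-- nothing, a semi-arc (a,*), or an arc (a,b)
data Out (n : ℕ) : Set where
  none : Out n
  semi : Out n
  arc  : Fin n → Out n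

isArcTo : ∀ {n} → Out n → Fin n → Bool
isArcTo none    b = false
isArcTo semi    b = false
isArcTo (arc c) b = c ==F b

isSemi : ∀ {n} → Out n → Bool
isSemi semi = true
isSemi _    = false

hasOut : ∀ {n} → Out n → Bool
hasOut none = false
hasOut _    = true

RawDiagram : ℕ → Set
RawDiagram n = Vec (Out n) n × Vec (Out n) n

module _ {n : ℕ} (R : RawDiagram n) where
  private
    U = Data.Product.proj₁ R
    L = Data.Product.proj₂ R

  arcUR : Fin n → Fin n → Bool
  arcUR a b = isArcTo (lookup U a) b

  arcLR : Fin n → Fin n → Bool
  arcLR a b = isArcTo (lookup L a) b

  outU outL inU inL : Fin n → Bool
  outU v = hasOut (lookup U v)
  outL v = hasOut (lookup L v)
  inU  v = exF (λ a → arcUR a v)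
  inL  v = exF (λ a → arcLR a v)

  fixedR : Fin n → Bool
  fixedR v = not (outU v) ∧ not (outL v) ∧ not (inU v) ∧ not (inL v)

  vertexOK : Fin n → Bool
  vertexOK v =
       fixedR v
    ∨ (outU v ∧ outL v ∧ not (inU v) ∧ not (inL v))
    ∨ (inU v ∧ inL v ∧ not (outU v) ∧ not (outL v))
    ∨ (inU v ∧ outU v ∧ not (inL v) ∧ not (outL v))
    ∨ (inL v ∧ outL v ∧ not (inU v) ∧ not (outU v))

  arcsOK : Bool
  arcsOK = allF (λ a → allF (λ b →
             not (arcUR a b ∨ arcLR a b) ∨ (a <F b)))

  inOK : Bool
  inOK = allF (λ b →
           (length (filterᵇ (λ a → arcUR a b) (allFin n)) ≤ᵇ 1) ∧
           (length (filterᵇ (λ a → arcLR a b) (allFin n)) ≤ᵇ 1))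

  validDiagram : Bool
  validDiagram = arcsOK ∧ inOK ∧ allF vertexOK

  rawArcData : ArcData n
  rawArcData = record
    { arcU  = arcUR
    ; semiU = λ a → isSemi (lookup U a)
    ; arcL  = arcLR
    ; semiL = λ a → isSemi (lookup L a)
    ; fixed = fixedR
    }

OpenDiagram : ℕ → Set
OpenDiagram n = Σ (RawDiagram n) (λ R → T (validDiagram R))

Sigma2 : ℕ → Set
Sigma2 n = Σ (OpenDiagram n) (λ D → T (nonnesting3 (rawArcData (Data.Product.proj₁ D))))

injectiveᵇ : ∀ {n} → Vec (Fin n) n → Bool
injectiveᵇ σ = allF (λ i → allF (λ j → (i ==F j) ∨ not (lookup σ i ==F lookup σ j)))

Permutation : ℕ → Set
Permutation n = Σ (Vec (Fin n) n) (λ σ → T (injectiveᵇ σ))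

permArcData : ∀ {n} → Vec (Fin n) n → ArcData n
permArcData σ = record
  { arcU  = λ a b → (a <F b) ∧ (lookup σ a ==F b)
  ; semiU = λ _ → false
  ; arcL  = λ a b → (a <F b) ∧ (lookup σ b ==F a)
  ; semiL = λ _ → false
  ; fixed = λ a → lookup σ a ==F a
  }

NonnestingPerm3 : ℕ → Set
NonnestingPerm3 n = Σ (Permutation n) (λ σ → T (nonnesting3 (permArcData (Data.Product.proj₁ σ))))

-- A diagram of size n+1 is determined by its restriction to the first n vertices
-- (arcs ending at the last vertex become semi-arcs) together with what happens at the
-- last vertex: a fixed point, an opener of two new semi-arcs, an upper (lower)
-- transitory closing an upper (lower) semi-arc and opening a new one, or a closer
-- closing one semi-arc on each side.  The extension is 3-nonnesting iff the
-- restriction is and no closed semi-arc is blocked (an upper arc or a fixed point,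
-- resp. a lower arc, starts to its right) while another semi-arc starts to its left.
-- Being blocked is inherited leftwards, so the blocked upper semi-arcs are the first r
-- of the h, and exactly h - max(0, r-1) of them may be closed; likewise on the lower
-- side, where there are also h semi-arcs.  Following h, r, s through the five kinds
-- of last vertex reproduces rules (1)-(5), which gives a label-preserving bijection
-- between level n of the tree and the diagrams of size n in Σ⁽²⁾.  A diagram has
-- label [0,0,0] iff it has no semi-arcs, and these are exactly permutation diagrams.

module Submission where

open import Data.Bool using (Bool; true; false; _∧_; _∨_; not; T; T?; if_then_else_)
open import Data.Bool.Properties using (T-irrelevant; ∨-assoc; ∨-identityʳ; ∨-zeroʳ; ∧-identityʳ; ∧-assoc; ∧-zeroʳ)
open import Data.Bool.ListAction using (or; and)
open import Data.Empty using (⊥; ⊥-elim)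
open import Data.Fin using (Fin; zero; suc; toℕ; inject₁; fromℕ; fromℕ<; punchOut)
open import Data.Fin.Properties using (toℕ-inject₁; toℕ-fromℕ; toℕ<n; toℕ-injective; inject₁-injective; toℕ-fromℕ<; punchOut-injective; injective⇒≤) renaming (_≟_ to _≟F_; <-cmp to <-cmpᶠ)
open import Data.List using (List; []; _∷_; map; length; filterᵇ; allFin; concatMap; _++_; applyUpTo) renaming (lookup to lookupL; tabulate to tabulateL)
open import Data.Maybe using (Maybe; just; nothing; is-just)
open import Data.Nat using (ℕ; zero; suc; _+_; _∸_; _<_; _≤_; _<ᵇ_; _≡ᵇ_; _≤ᵇ_; z≤n; s≤s)
open import Data.Nat.Properties
open import Data.Product using (Σ; _×_; _,_; proj₁; proj₂)
open import Data.Sum using (_⊎_; inj₁; inj₂) renaming ([_,_] to either)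
open import Data.Unit using (⊤; tt)
open import Data.Vec using (Vec; lookup; tabulate; []; _∷_)
open import Data.Vec.Properties using (lookup∘tabulate; tabulate∘lookup; tabulate-cong)
open import Function using (_∘_)
open import Function.Bundles using (_↔_; Inverse; mk↔ₛ′)
open Inverse using (to; from; strictlyInverseˡ; strictlyInverseʳ)
open import Function.Properties.Inverse using (↔-refl; ↔-trans)
open import Data.Sum.Function.Propositional using (_⊎-↔_)
open import Data.Product.Function.NonDependent.Propositional using (_×-↔_)
open import Data.Product.Function.Dependent.Propositional using (Σ-↔)
open import Relation.Binary.Definitions using (tri<; tri≈; tri>)
open import Relation.Binary.PropositionalEquality hiding ([_])
open import Relation.Nullary using (¬_; yes; no)
open import Defs

-- Quantifiers and counting over Fin

b2n : Bool → ℕ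
b2n true = 1
b2n false = 0

orFin : ∀ {n} → (Fin n → Bool) → Bool
orFin {zero} p = false
orFin {suc n} p = p zero ∨ orFin (p ∘ suc)

andFin : ∀ {n} → (Fin n → Bool) → Bool
andFin {zero} p = true
andFin {suc n} p = p zero ∧ andFin (p ∘ suc)

countFin : ∀ {n} → (Fin n → Bool) → ℕ
countFin {zero} p = 0
countFin {suc n} p = b2n (p zero) + countFin (p ∘ suc)

or-tabulate : ∀ {A : Set} {n} (p : A → Bool) (f : Fin n → A) → or (map p (tabulateL f)) ≡ orFin (p ∘ f)
or-tabulate {n = zero} p f = refl
or-tabulate {n = suc n} p f = cong (p (f zero) ∨_) (or-tabulate p (f ∘ suc))

and-tabulate : ∀ {A : Set} {n} (p : A → Bool) (f : Fin n → A) → and (map p (tabulateL f)) ≡ andFin (p ∘ f)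
and-tabulate {n = zero} p f = refl
and-tabulate {n = suc n} p f = cong (p (f zero) ∧_) (and-tabulate p (f ∘ suc))

length-filter-∷ : ∀ {A : Set} (p : A → Bool) x xs → length (filterᵇ p (x ∷ xs)) ≡ b2n (p x) + length (filterᵇ p xs)
length-filter-∷ p x xs with p x
... | true = refl
... | false = refl

count-tabulate : ∀ {A : Set} {n} (p : A → Bool) (f : Fin n → A) → length (filterᵇ p (tabulateL f)) ≡ countFin (p ∘ f)
count-tabulate {n = zero} p f = refl
count-tabulate {n = suc n} p f = trans (length-filter-∷ p (f zero) (tabulateL (f ∘ suc))) (cong (b2n (p (f zero)) +_) (count-tabulate p (f ∘ suc)))

exF≡ : ∀ {n} (p : Fin n → Bool) → exF p ≡ orFin p
exF≡ p = or-tabulate p (λ x → x)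

allF≡ : ∀ {n} (p : Fin n → Bool) → allF p ≡ andFin p
allF≡ p = and-tabulate p (λ x → x)

count≡ : ∀ {n} (p : Fin n → Bool) → length (filterᵇ p (allFin n)) ≡ countFin p
count≡ p = count-tabulate p (λ x → x)

orFin-cong : ∀ {n} {p q : Fin n → Bool} → (∀ i → p i ≡ q i) → orFin p ≡ orFin q
orFin-cong {zero} e = refl
orFin-cong {suc n} e = cong₂ _∨_ (e zero) (orFin-cong (e ∘ suc))

andFin-cong : ∀ {n} {p q : Fin n → Bool} → (∀ i → p i ≡ q i) → andFin p ≡ andFin q
andFin-cong {zero} e = refl
andFin-cong {suc n} e = cong₂ _∧_ (e zero) (andFin-cong (e ∘ suc))

countFin-cong : ∀ {n} {p q : Fin n → Bool} → (∀ i → p i ≡ q i) → countFin p ≡ countFin q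
countFin-cong {zero} e = refl
countFin-cong {suc n} e = cong₂ _+_ (cong b2n (e zero)) (countFin-cong (e ∘ suc))

T∨-intro₁ : ∀ {a b} → T a → T (a ∨ b)
T∨-intro₁ {true} t = tt
T∨-intro₂ : ∀ {a b} → T b → T (a ∨ b)
T∨-intro₂ {true} t = tt
T∨-intro₂ {false} t = t
T∨-elim : ∀ {a b} → T (a ∨ b) → T a ⊎ T b
T∨-elim {true} t = inj₁ tt
T∨-elim {false} t = inj₂ t
T∧-intro : ∀ {a b} → T a → T b → T (a ∧ b)
T∧-intro {true} _ t = t
T∧-l : ∀ {a b} → T (a ∧ b) → T a
T∧-l {true} _ = tt
T∧-r : ∀ {a b} → T (a ∧ b) → T b
T∧-r {true} t = t
Tnot-intro : ∀ {a} → ¬ T a → T (not a)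
Tnot-intro {true} f = f tt
Tnot-intro {false} f = tt
Tnot-elim : ∀ {a} → T (not a) → ¬ T a
Tnot-elim {true} () _
Tnot-elim {false} _ ()

orFin-intro : ∀ {n} (p : Fin n → Bool) i → T (p i) → T (orFin p)
orFin-intro {suc n} p zero t = T∨-intro₁ t
orFin-intro {suc n} p (suc i) t = T∨-intro₂ {p zero} (orFin-intro (p ∘ suc) i t)

orFin-elim : ∀ {n} (p : Fin n → Bool) → T (orFin p) → Σ (Fin n) (λ i → T (p i))
orFin-elim {zero} p ()
orFin-elim {suc n} p t with T∨-elim {p zero} t
... | inj₁ x = zero , x
... | inj₂ y with orFin-elim (p ∘ suc) y
... | i , z = suc i , z

andFin-intro : ∀ {n} (p : Fin n → Bool) → (∀ i → T (p i)) → T (andFin p)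
andFin-intro {zero} p f = tt
andFin-intro {suc n} p f = T∧-intro (f zero) (andFin-intro (p ∘ suc) (f ∘ suc))

andFin-elim : ∀ {n} (p : Fin n → Bool) → T (andFin p) → ∀ i → T (p i)
andFin-elim {suc n} p t zero = T∧-l t
andFin-elim {suc n} p t (suc i) = andFin-elim (p ∘ suc) (T∧-r {p zero} t) i

exF-intro : ∀ {n} (p : Fin n → Bool) i → T (p i) → T (exF p)
exF-intro p i t = subst T (sym (exF≡ p)) (orFin-intro p i t)

exF-elim : ∀ {n} (p : Fin n → Bool) → T (exF p) → Σ (Fin n) (λ i → T (p i))
exF-elim p t = orFin-elim p (subst T (exF≡ p) t)

allF-intro : ∀ {n} (p : Fin n → Bool) → (∀ i → T (p i)) → T (allF p)
allF-intro p f = subst T (sym (allF≡ p)) (andFin-intro p f)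

allF-elim : ∀ {n} (p : Fin n → Bool) → T (allF p) → ∀ i → T (p i)
allF-elim p t = andFin-elim p (subst T (allF≡ p) t)

bool-ext : ∀ {a b} → (T a → T b) → (T b → T a) → a ≡ b
bool-ext {true} {true} f g = refl
bool-ext {true} {false} f g = ⊥-elim (f tt)
bool-ext {false} {true} f g = ⊥-elim (g tt)
bool-ext {false} {false} f g = refl

orFin-last : ∀ {n} (p : Fin (suc n) → Bool) → orFin p ≡ orFin (p ∘ inject₁) ∨ p (fromℕ n)
orFin-last {zero} p = trans (∨-identityʳ (p zero)) refl
orFin-last {suc n} p = trans (cong (p zero ∨_) (orFin-last (p ∘ suc))) (sym (∨-assoc (p zero) _ _))

andFin-last : ∀ {n} (p : Fin (suc n) → Bool) → andFin p ≡ andFin (p ∘ inject₁) ∧ p (fromℕ n)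
andFin-last {zero} p with p zero
... | true = refl
... | false = refl
andFin-last {suc n} p = trans (cong (p zero ∧_) (andFin-last (p ∘ suc))) (sym (Data.Bool.Properties.∧-assoc (p zero) _ _))

countFin-last : ∀ {n} (p : Fin (suc n) → Bool) → countFin p ≡ countFin (p ∘ inject₁) + b2n (p (fromℕ n))
countFin-last {zero} p = +-comm (b2n (p zero)) 0
countFin-last {suc n} p = trans (cong (b2n (p zero) +_) (countFin-last (p ∘ suc))) (sym (+-assoc (b2n (p zero)) _ _))

data LastView {n : ℕ} : Fin (suc n) → Set where
  old : (a : Fin n) → LastView (inject₁ a)
  new : LastView (fromℕ n)

lastView : ∀ {n} (i : Fin (suc n)) → LastView i
lastView {zero} zero = new
lastView {suc n} zero = old zero
lastView {suc n} (suc i) with lastView i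
... | old a = old (suc a)
... | new = new

<F⇒ : ∀ {n} {a b : Fin n} → T (a <F b) → toℕ a < toℕ b
<F⇒ {a = a} {b} t = <ᵇ⇒< (toℕ a) (toℕ b) t

⇒<F : ∀ {n} {a b : Fin n} → toℕ a < toℕ b → T (a <F b)
⇒<F {a = a} {b} t = <⇒<ᵇ t

==F⇒ : ∀ {n} {a b : Fin n} → T (a ==F b) → a ≡ b
==F⇒ {a = a} {b} t = toℕ-injective (≡ᵇ⇒≡ (toℕ a) (toℕ b) t)

⇒==F : ∀ {n} (a : Fin n) → T (a ==F a)
⇒==F a = ≡⇒≡ᵇ (toℕ a) (toℕ a) refl

inject₁<last : ∀ {n} (a : Fin n) → toℕ (inject₁ a) < toℕ (fromℕ n)
inject₁<last {n} a rewrite toℕ-inject₁ a | toℕ-fromℕ n = toℕ<n a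

-- Ranks: the elements satisfying a predicate, in increasing order

rank : ∀ {n} → (Fin n → Bool) → Fin n → ℕ
rank {suc n} p zero = 0
rank {suc n} p (suc a) = b2n (p zero) + rank (p ∘ suc) a

selH : ∀ {m n} (b : Bool) → (Fin m → Fin n) → Fin (b2n b + m) → Fin (suc n)
selH true f zero = zero
selH true f (suc k) = suc (f k)
selH false f k = suc (f k)

sel : ∀ {n} (p : Fin n → Bool) → Fin (countFin p) → Fin n
sel {zero} p ()
sel {suc n} p = selH (p zero) (sel (p ∘ suc))

rank<count : ∀ {n} (p : Fin n → Bool) a → T (p a) → rank p a < countFin p
rank<count {suc n} p zero t with p zero
... | true = s≤s z≤n
rank<count {suc n} p (suc a) t = +-monoʳ-< (b2n (p zero)) (rank<count (p ∘ suc) a t)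

count≡0⇒none : ∀ {n} (p : Fin n → Bool) → countFin p ≡ 0 → ∀ a → ¬ T (p a)
count≡0⇒none p e a t = n≮0 (subst (rank p a <_) e (rank<count p a t))

sel-ok : ∀ {n} (p : Fin n → Bool) k → T (p (sel p k))
sel-ok {suc n} p k = go (p zero) refl k
  where
  go : (b : Bool) → p zero ≡ b → (k : Fin (b2n b + countFin (p ∘ suc))) → T (p (selH b (sel (p ∘ suc)) k))
  go true e zero = subst T (sym e) tt
  go true e (suc k) = sel-ok (p ∘ suc) k
  go false e k = sel-ok (p ∘ suc) k

rank-sel : ∀ {n} (p : Fin n → Bool) k → rank p (sel p k) ≡ toℕ k
rank-sel {suc n} p k = go (p zero) refl k
  where
  go : (b : Bool) → p zero ≡ b → (k : Fin (b2n b + countFin (p ∘ suc))) → rank p (selH b (sel (p ∘ suc)) k) ≡ toℕ k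
  go true e zero = refl
  go true e (suc k) rewrite e = cong suc (rank-sel (p ∘ suc) k)
  go false e k rewrite e = rank-sel (p ∘ suc) k

sel-rank : ∀ {n} (p : Fin n → Bool) a → T (p a) → (k : Fin (countFin p)) → toℕ k ≡ rank p a → sel p k ≡ a
sel-rank {suc n} p a t k e = go (p zero) refl a t k e
  where
  go : (b : Bool) → p zero ≡ b → ∀ a → T (p a) → (k : Fin (b2n b + countFin (p ∘ suc))) → toℕ k ≡ rank p a → selH b (sel (p ∘ suc)) k ≡ a
  go true eb zero t zero e = refl
  go true eb zero t (suc k) ()
  go true eb (suc a) t zero e rewrite eb = ⊥-elim (0≢1+n e)
  go true eb (suc a) t (suc k) e rewrite eb = cong suc (sel-rank (p ∘ suc) a t k (suc-injective e))
  go false eb zero t k e = ⊥-elim (subst T eb t)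
  go false eb (suc a) t k e rewrite eb = cong suc (sel-rank (p ∘ suc) a t k e)

rank-mono : ∀ {n} (p : Fin n → Bool) a b → T (p b) → toℕ b < toℕ a → rank p b < rank p a
rank-mono {suc n} p (suc a) zero t lt with p zero
... | true = s≤s z≤n
rank-mono {suc n} p (suc a) (suc b) t (s≤s lt) = +-monoʳ-< (b2n (p zero)) (rank-mono (p ∘ suc) a b t lt)

rank-mono≤ : ∀ {n} (p : Fin n → Bool) a b → toℕ b ≤ toℕ a → rank p b ≤ rank p a
rank-mono≤ {suc n} p a zero le = z≤n
rank-mono≤ {suc n} p (suc a) (suc b) (s≤s le) = +-monoʳ-≤ (b2n (p zero)) (rank-mono≤ (p ∘ suc) a b le)

rank-refl< : ∀ {n} (p : Fin n → Bool) a b → T (p a) → T (p b) → rank p b < rank p a → toℕ b < toℕ a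
rank-refl< p a b ta tb lt with <-cmp (toℕ b) (toℕ a)
... | tri< x _ _ = x
... | tri≈ _ x _ rewrite toℕ-injective x = ⊥-elim (<-irrefl refl lt)
... | tri> _ _ x = ⊥-elim (<-asym lt (rank-mono p b a ta x))

rank-inj : ∀ {n} (p : Fin n → Bool) a b → T (p a) → T (p b) → rank p b ≡ rank p a → b ≡ a
rank-inj p a b ta tb e with <-cmp (toℕ b) (toℕ a)
... | tri< x _ _ = ⊥-elim (<-irrefl e (rank-mono p a b tb x))
... | tri≈ _ x _ = toℕ-injective x
... | tri> _ _ x = ⊥-elim (<-irrefl (sym e) (rank-mono p b a ta x))

count-sel : ∀ {n} (p q : Fin n → Bool) → countFin (λ a → p a ∧ q a) ≡ countFin (q ∘ sel p)
count-sel {zero} p q = refl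
count-sel {suc n} p q = trans (cong (b2n (p zero ∧ q zero) +_) (count-sel (p ∘ suc) (q ∘ suc))) (go (p zero))
  where
  go : (b : Bool) → b2n (b ∧ q zero) + countFin (q ∘ suc ∘ sel (p ∘ suc)) ≡ countFin {b2n b + countFin (p ∘ suc)} (q ∘ selH b (sel (p ∘ suc)))
  go true = refl
  go false = refl

count-∧≤ : ∀ {n} (p q : Fin n → Bool) → countFin (λ a → p a ∧ q a) ≤ countFin p
count-∧≤ {zero} p q = z≤n
count-∧≤ {suc n} p q = +-mono-≤ (go (p zero) (q zero)) (count-∧≤ (p ∘ suc) (q ∘ suc))
  where
  go : ∀ b c → b2n (b ∧ c) ≤ b2n b
  go true true = s≤s z≤n
  go true false = z≤n
  go false c = z≤n

count-none : ∀ {n} (q : Fin n → Bool) → (∀ i → ¬ T (q i)) → countFin q ≡ 0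
count-none {zero} q f = refl
count-none {suc n} q f with q zero in eq
... | true = ⊥-elim (f zero (subst T (sym eq) tt))
... | false = count-none (q ∘ suc) (f ∘ suc)

DownClosed : ∀ {m} → (Fin m → Bool) → Set
DownClosed q = ∀ j k → toℕ j ≤ toℕ k → T (q k) → T (q j)

down-lt : ∀ {m} (q : Fin m → Bool) → DownClosed q → ∀ k → T (q k) → toℕ k < countFin q
down-lt {suc m} q dc zero t with q zero
... | true = s≤s z≤n
down-lt {suc m} q dc (suc k) t with q zero in eq
... | true = s≤s (down-lt (q ∘ suc) (λ j k' le → dc (suc j) (suc k') (s≤s le)) k t)
... | false = ⊥-elim (subst T eq (dc zero (suc k) z≤n t))

down-gt : ∀ {m} (q : Fin m → Bool) → DownClosed q → ∀ k → toℕ k < countFin q → T (q k)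
down-gt {suc m} q dc k lt with q zero in eq
down-gt {suc m} q dc zero lt | true = subst T (sym eq) tt
down-gt {suc m} q dc (suc k) (s≤s lt) | true = down-gt (q ∘ suc) (λ j k' le → dc (suc j) (suc k') (s≤s le)) k lt
... | false = ⊥-elim (n≮0 (subst (toℕ k <_) (count-none (q ∘ suc) (λ i t → subst T eq (dc zero (suc i) z≤n t))) lt))

count-lt : ∀ c h → c ≤ h → countFin {h} (λ k → toℕ k <ᵇ c) ≡ c
count-lt zero h le = count-none {h} (λ k → toℕ k <ᵇ 0) (λ i ())
count-lt (suc c) (suc h) (s≤s le) = cong suc (count-lt c h le)

count-lt-nz : ∀ c h → c ≤ h → countFin {h} (λ k → not (toℕ k ≡ᵇ 0) ∧ (toℕ k <ᵇ c)) ≡ c ∸ 1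
count-lt-nz zero h le = count-none {h} _ (λ i t → go (toℕ i) t)
  where go : ∀ x → ¬ T (not (x ≡ᵇ 0) ∧ (x <ᵇ 0))
        go zero ()
        go (suc x) ()
count-lt-nz (suc c) (suc h) (s≤s le) = count-lt c h le

-- Enumerating the levels of the generating tree

record Enumerates {A : Set} (xs : List A) (X : Set) (f : X → A) : Set where
  constructor mkE
  field
    eIso : Fin (length xs) ↔ X
    eLab : ∀ i → f (to eIso i) ≡ lookupL xs i
open Enumerates public

sucFin-↔ : ∀ {m k} → Fin m ↔ Fin k → Fin (suc m) ↔ Fin (suc k)
sucFin-↔ e = mk↔ₛ′ (λ { zero → zero ; (suc i) → suc (to e i) }) (λ { zero → zero ; (suc i) → suc (from e i) })
                   (λ { zero → refl ; (suc i) → cong suc (strictlyInverseˡ e i) }) (λ { zero → refl ; (suc i) → cong suc (strictlyInverseʳ e i) })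

⊎↔ΣFinSuc : ∀ {m} (P : Fin (suc m) → Set) → (P zero ⊎ Σ (Fin m) (P ∘ suc)) ↔ Σ (Fin (suc m)) P
⊎↔ΣFinSuc P = mk↔ₛ′ (λ { (inj₁ p) → zero , p ; (inj₂ (i , p)) → suc i , p })
                (λ { (zero , p) → inj₁ p ; (suc i , p) → inj₂ (i , p) })
                (λ { (zero , p) → refl ; (suc i , p) → refl })
                (λ { (inj₁ p) → refl ; (inj₂ (i , p)) → refl })

split++ : ∀ {A : Set} (xs ys : List A) → Fin (length (xs ++ ys)) → Fin (length xs) ⊎ Fin (length ys)
split++ [] ys i = inj₂ i
split++ (x ∷ xs) ys zero = inj₁ zero
split++ (x ∷ xs) ys (suc i) with split++ xs ys i
... | inj₁ j = inj₁ (suc j)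
... | inj₂ j = inj₂ j

join++ : ∀ {A : Set} (xs ys : List A) → Fin (length xs) ⊎ Fin (length ys) → Fin (length (xs ++ ys))
join++ [] ys (inj₂ j) = j
join++ (x ∷ xs) ys (inj₁ zero) = zero
join++ (x ∷ xs) ys (inj₁ (suc j)) = suc (join++ xs ys (inj₁ j))
join++ (x ∷ xs) ys (inj₂ j) = suc (join++ xs ys (inj₂ j))

split++-join++ : ∀ {A : Set} (xs ys : List A) u → split++ xs ys (join++ xs ys u) ≡ u
split++-join++ [] ys (inj₂ j) = refl
split++-join++ (x ∷ xs) ys (inj₁ zero) = refl
split++-join++ (x ∷ xs) ys (inj₁ (suc j)) rewrite split++-join++ xs ys (inj₁ j) = refl
split++-join++ (x ∷ xs) ys (inj₂ j) rewrite split++-join++ xs ys (inj₂ j) = refl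

join++-split++ : ∀ {A : Set} (xs ys : List A) i → join++ xs ys (split++ xs ys i) ≡ i
join++-split++ [] ys i = refl
join++-split++ (x ∷ xs) ys zero = refl
join++-split++ (x ∷ xs) ys (suc i) with split++ xs ys i | join++-split++ xs ys i
... | inj₁ j | e = cong suc e
... | inj₂ j | e = cong suc e

split++-lookup : ∀ {A : Set} (xs ys : List A) i → lookupL (xs ++ ys) i ≡ either (lookupL xs) (lookupL ys) (split++ xs ys i)
split++-lookup [] ys i = refl
split++-lookup (x ∷ xs) ys zero = refl
split++-lookup (x ∷ xs) ys (suc i) with split++ xs ys i | split++-lookup xs ys i
... | inj₁ j | e = e
... | inj₂ j | e = e

E-++ : ∀ {A X Y : Set} {xs ys : List A} {f : X → A} {g : Y → A} → Enumerates xs X f → Enumerates ys Y g → Enumerates (xs ++ ys) (X ⊎ Y) (either f g)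
E-++ {xs = xs} {ys} {f} {g} (mkE e1 c1) (mkE e2 c2) =
  mkE (↔-trans (mk↔ₛ′ (split++ xs ys) (join++ xs ys) (split++-join++ xs ys) (join++-split++ xs ys)) (e1 ⊎-↔ e2)) (λ i → lem i)
  where
  lem : ∀ i → either f g (to (e1 ⊎-↔ e2) (split++ xs ys i)) ≡ lookupL (xs ++ ys) i
  lem i rewrite split++-lookup xs ys i with split++ xs ys i
  ... | inj₁ j = c1 j
  ... | inj₂ j = c2 j

map↔ : ∀ {A B : Set} (h : A → B) (xs : List A) → Fin (length (map h xs)) ↔ Fin (length xs)
map↔ h [] = mk↔ₛ′ (λ ()) (λ ()) (λ ()) (λ ())
map↔ h (x ∷ xs) = sucFin-↔ (map↔ h xs)

map↔-lookup : ∀ {A B : Set} (h : A → B) (xs : List A) i → lookupL (map h xs) i ≡ h (lookupL xs (to (map↔ h xs) i))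
map↔-lookup h (x ∷ xs) zero = refl
map↔-lookup h (x ∷ xs) (suc i) = map↔-lookup h xs i

E-map : ∀ {A B X : Set} {xs : List A} {f : X → A} (h : A → B) → Enumerates xs X f → Enumerates (map h xs) X (h ∘ f)
E-map {xs = xs} {f} h (mkE e c) = mkE (↔-trans (map↔ h xs) e) (λ i → trans (cong h (c _)) (sym (map↔-lookup h xs i)))

E-single : ∀ {A : Set} (x : A) → Enumerates (x ∷ []) ⊤ (λ _ → x)
E-single x = mkE (mk↔ₛ′ (λ _ → tt) (λ _ → zero) (λ _ → refl) (λ { zero → refl })) (λ { zero → refl })

E-applyUpTo : ∀ {A : Set} (f : ℕ → A) k → Enumerates (applyUpTo f k) (Fin k) (f ∘ toℕ)
E-applyUpTo f zero = mkE (mk↔ₛ′ (λ ()) (λ ()) (λ ()) (λ ())) (λ ())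
E-applyUpTo f (suc k) with E-applyUpTo (f ∘ suc) k
... | mkE e c = mkE (sucFin-↔ e) (λ { zero → refl ; (suc i) → c i })

module _ {A B : Set} (F : A → List B) where
  concatMap↔ : ∀ (xs : List A) → Fin (length (concatMap F xs)) ↔ Σ (Fin (length xs)) (λ i → Fin (length (F (lookupL xs i))))
  concatMap↔ [] = mk↔ₛ′ (λ ()) (λ { (() , _) }) (λ { (() , _) }) (λ ())
  concatMap↔ (x ∷ xs) = ↔-trans (mk↔ₛ′ (split++ (F x) (concatMap F xs)) (join++ (F x) _) (split++-join++ (F x) _) (join++-split++ (F x) _))
                   (↔-trans (↔-refl ⊎-↔ concatMap↔ xs) (⊎↔ΣFinSuc (λ i → Fin (length (F (lookupL (x ∷ xs) i))))))

  concatMap↔-lookup : ∀ (xs : List A) j → lookupL (concatMap F xs) j ≡ lookupL (F (lookupL xs (proj₁ (to (concatMap↔ xs) j)))) (proj₂ (to (concatMap↔ xs) j))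
  concatMap↔-lookup (x ∷ xs) j rewrite split++-lookup (F x) (concatMap F xs) j with split++ (F x) (concatMap F xs) j
  ... | inj₁ k = refl
  ... | inj₂ k = concatMap↔-lookup xs k

E-concatMap : ∀ {A B X : Set} {xs : List A} {f : X → A} (F : A → List B) (C : A → Set) (g : (a : A) → C a → B) →
       (∀ a → Enumerates (F a) (C a) (g a)) → Enumerates xs X f →
       Enumerates (concatMap F xs) (Σ X (C ∘ f)) (λ p → g (f (proj₁ p)) (proj₂ p))
E-concatMap {xs = xs} {f} F C g fam (mkE e c) = mkE (
  ↔-trans (concatMap↔ F xs) (↔-trans (Σ-↔ ↔-refl (λ {i} → eIso (fam (lookupL xs i))))
    (↔-trans (Σ-↔ ↔-refl (λ {i} → tr (c i))) (Σ-↔ e ↔-refl)))) lem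
  where
  tr : ∀ {a a'} → a' ≡ a → C a ↔ C a'
  tr refl = ↔-refl
  gtr : ∀ {a a'} (p : a' ≡ a) (x : C a) → g a' (to (tr p) x) ≡ g a x
  gtr refl x = refl
  lem : ∀ j → _
  lem j = helper (to (concatMap↔ F xs) j) (concatMap↔-lookup F xs j)
    where
    helper : ∀ (p : Σ (Fin (length xs)) (λ i → Fin (length (F (lookupL xs i))))) →
             lookupL (concatMap F xs) j ≡ lookupL (F (lookupL xs (proj₁ p))) (proj₂ p) →
             g (f (to e (proj₁ p))) (to (tr (c (proj₁ p))) (to (eIso (fam (lookupL xs (proj₁ p)))) (proj₂ p))) ≡ lookupL (concatMap F xs) j
    helper (i , k) e' = trans (gtr (c i) _) (trans (eLab (fam (lookupL xs i)) k) (sym e'))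

E-transfer : ∀ {A X Y : Set} {xs : List A} {f : X → A} {g : Y → A} (e : X ↔ Y) → (∀ x → g (to e x) ≡ f x) → Enumerates xs X f → Enumerates xs Y g
E-transfer e c (mkE e0 c0) = mkE (↔-trans e0 e) (λ i → trans (c _) (c0 i))

Child : Label → Set
Child [ h , r , s ] = ⊤ ⊎ (⊤ ⊎ (Fin (h ∸ (r ∸ 1)) ⊎ (Fin (h ∸ (s ∸ 1)) ⊎ (Σ (Fin (h ∸ (r ∸ 1))) (λ _ → Fin (h ∸ (s ∸ 1)))))))

childLabel : (L : Label) → Child L → Label
childLabel [ h , r , s ] (inj₁ _) = [ h , h , s ]
childLabel [ h , r , s ] (inj₂ (inj₁ _)) = [ suc h , r , s ]
childLabel [ h , r , s ] (inj₂ (inj₂ (inj₁ k))) = [ h , (r ∸ 1) + toℕ k , s ]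
childLabel [ h , r , s ] (inj₂ (inj₂ (inj₂ (inj₁ k)))) = [ h , r , (s ∸ 1) + toℕ k ]
childLabel [ h , r , s ] (inj₂ (inj₂ (inj₂ (inj₂ (k , k'))))) = [ h ∸ 1 , (r ∸ 1) + toℕ k , (s ∸ 1) + toℕ k' ]

E-range : ∀ a b → Enumerates (range a b) (Fin (b ∸ a)) (λ k → a + toℕ k)
E-range a b = E-map (a +_) (E-applyUpTo (λ x → x) (b ∸ a))

E-children : ∀ L → Enumerates (children L) (Child L) (childLabel L)
E-children [ h , r , s ] = E-transfer {f = lab'} {g = childLabel [ h , r , s ]} ↔-refl
  (λ { (inj₁ _) → refl ; (inj₂ (inj₁ _)) → refl ; (inj₂ (inj₂ (inj₁ _))) → refl ; (inj₂ (inj₂ (inj₂ (inj₁ _)))) → refl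
     ; (inj₂ (inj₂ (inj₂ (inj₂ _)))) → refl }) big
  where
  lab' : Child [ h , r , s ] → Label
  lab' = either (λ _ → [ h , h , s ]) (either (λ _ → [ suc h , r , s ]) (either (λ k → [ h , (r ∸ 1) + toℕ k , s ])
           (either (λ k → [ h , r , (s ∸ 1) + toℕ k ]) (λ p → [ h ∸ 1 , (r ∸ 1) + toℕ (proj₁ p) , (s ∸ 1) + toℕ (proj₂ p) ]))))
  big : Enumerates (children [ h , r , s ]) (Child [ h , r , s ]) lab'
  big = E-++ (E-single _) (E-++ (E-single _) (E-++ (E-map (λ i → [ h , i , s ]) (E-range (r ∸ 1) h))
    (E-++ (E-map (λ j → [ h , r , j ]) (E-range (s ∸ 1) h))
      (E-concatMap (λ i → map (λ j → [ h ∸ 1 , i , j ]) (range (s ∸ 1) h)) (λ _ → Fin (h ∸ (s ∸ 1)))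
            (λ i k' → [ h ∸ 1 , i , (s ∸ 1) + toℕ k' ])
            (λ i → E-map (λ j → [ h ∸ 1 , i , j ]) (E-range (s ∸ 1) h)) (E-range (r ∸ 1) h)))))

E-level : ∀ n {X : Set} {f : X → Label} → Enumerates (level n) X f → Enumerates (level (suc n)) (Σ X (Child ∘ f)) (λ p → childLabel (f (proj₁ p)) (proj₂ p))
E-level n {X} {f} en = E-concatMap {xs = level n} {f = f} children Child childLabel E-children en

-- Adding and removing the last vertex

-- What happens at a new last vertex: the semi-arcs it closes as the right end-point
-- of an upper and of a lower arc, and whether it opens new upper and lower semi-arcs.
record Act (n : ℕ) : Set where
  constructor act
  field
    closeU closeL : Maybe (Fin n)
    openU openL : Bool
open Act public

closes : ∀ {n} → Maybe (Fin n) → Fin n → Bool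
closes nothing a = false
closes (just c) a = c ==F a

split : ∀ {n} → Fin (suc n) → Maybe (Fin n)
split {zero} zero = nothing
split {suc n} zero = just zero
split {suc n} (suc i) = Data.Maybe.map suc (split i)

split-inj : ∀ {n} (a : Fin n) → split (inject₁ a) ≡ just a
split-inj {suc n} zero = refl
split-inj {suc n} (suc a) rewrite split-inj a = refl

split-last : ∀ n → split (fromℕ n) ≡ nothing
split-last zero = refl
split-last (suc n) rewrite split-last n = refl

liftOut : ∀ {n} → Out n → Out (suc n)
liftOut none = none
liftOut semi = semi
liftOut (arc c) = arc (inject₁ c)

arcOrSemi : ∀ {n} → Maybe (Fin n) → Out n
arcOrSemi (just c) = arc c
arcOrSemi nothing = semi

-- The arc from a vertex to the removed last vertex becomes a semi-arc.
restrictOut : ∀ {n} → Out (suc n) → Out n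
restrictOut none = none
restrictOut semi = semi
restrictOut (arc c) = arcOrSemi (split c)

extendedOut : ∀ {n} → Vec (Out n) n → Maybe (Fin n) → Bool → Maybe (Fin n) → Out (suc n)
extendedOut {n} V c nw (just a) = if closes c a then arc (fromℕ n) else liftOut (lookup V a)
extendedOut V c nw nothing = if nw then semi else none

extendVec : ∀ {n} → Vec (Out n) n → Maybe (Fin n) → Bool → Vec (Out (suc n)) (suc n)
extendVec V c nw = tabulate (λ i → extendedOut V c nw (split i))

extend : ∀ {n} → RawDiagram n → Act n → RawDiagram (suc n)
extend R (act closeU closeL openU openL) = extendVec (proj₁ R) closeU openU , extendVec (proj₂ R) closeL openL

restrictVec : ∀ {n} → Vec (Out (suc n)) (suc n) → Vec (Out n) n
restrictVec V' = tabulate (λ a → restrictOut (lookup V' (inject₁ a)))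

restrict : ∀ {n} → RawDiagram (suc n) → RawDiagram n
restrict R' = restrictVec (proj₁ R') , restrictVec (proj₂ R')

findF : ∀ {n} → (Fin n → Bool) → Maybe (Fin n)
findF {zero} p = nothing
findF {suc n} p = if p zero then just zero else Data.Maybe.map suc (findF (p ∘ suc))

findCloser : ∀ {n} → Vec (Out (suc n)) (suc n) → Maybe (Fin n)
findCloser {n} V' = findF (λ a → isArcTo (lookup V' (inject₁ a)) (fromℕ n))

lastAction : ∀ {n} → RawDiagram (suc n) → Act n
lastAction {n} R' = act (findCloser (proj₁ R')) (findCloser (proj₂ R')) (hasOut (lookup (proj₁ R') (fromℕ n))) (hasOut (lookup (proj₂ R') (fromℕ n)))

vec-ext : ∀ {A : Set} {n} {u v : Vec A n} → (∀ i → lookup u i ≡ lookup v i) → u ≡ v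
vec-ext {u = u} {v} e = trans (sym (tabulate∘lookup u)) (trans (tabulate-cong e) (tabulate∘lookup v))

closes-eq : ∀ {n} (c : Maybe (Fin n)) a → T (closes c a) → c ≡ just a
closes-eq (just c) a t = cong just (==F⇒ t)

closes-self : ∀ {n} (a : Fin n) → closes (just a) a ≡ true
closes-self a = ≡ᵇ-refl (toℕ a)
  where ≡ᵇ-refl : ∀ m → (m ≡ᵇ m) ≡ true
        ≡ᵇ-refl zero = refl
        ≡ᵇ-refl (suc m) = ≡ᵇ-refl m

==F-false : ∀ {n} {a b : Fin n} → toℕ a ≢ toℕ b → (a ==F b) ≡ false
==F-false {a = a} {b} ne with a ==F b in eq
... | true = ⊥-elim (ne (≡ᵇ⇒≡ (toℕ a) (toℕ b) (subst T (sym eq) tt)))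
... | false = refl

isArcO : ∀ {n} → Out n → Bool
isArcO (arc _) = true
isArcO _ = false

ClosesSemi : ∀ {n} → Vec (Out n) n → Maybe (Fin n) → Set
ClosesSemi V c = ∀ a → T (closes c a) → lookup V a ≡ semi

count-uniq≤1 : ∀ {n} (p : Fin n → Bool) → (∀ a b → T (p a) → T (p b) → a ≡ b) → countFin p ≤ 1
count-uniq≤1 {zero} p u = z≤n
count-uniq≤1 {suc n} p u with p zero in eq
... | true rewrite count-none (p ∘ suc) (λ i t → 0≢1+n (cong toℕ (u zero (suc i) (subst T (sym eq) tt) t))) = s≤s z≤n
... | false = count-uniq≤1 (p ∘ suc) (λ a b ta tb → Data.Fin.Properties.suc-injective (u (suc a) (suc b) ta tb))

count-closes≤1 : ∀ {n} (c : Maybe (Fin n)) → countFin (closes c) ≤ 1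
count-closes≤1 c = count-uniq≤1 (closes c) (λ a b ta tb → just-inj (trans (sym (closes-eq c a ta)) (closes-eq c b tb)))
  where just-inj : ∀ {A : Set} {x y : A} → just x ≡ just y → x ≡ y
        just-inj refl = refl

module ExtendedSide {n : ℕ} (V : Vec (Out n) n) (c : Maybe (Fin n)) (nw : Bool) where
  E : Vec (Out (suc n)) (suc n)
  E = extendVec V c nw

  lk-i : ∀ a → lookup E (inject₁ a) ≡ (if closes c a then arc (fromℕ n) else liftOut (lookup V a))
  lk-i a rewrite lookup∘tabulate (λ i → extendedOut V c nw (split i)) (inject₁ a) | split-inj a = refl

  lk-l : lookup E (fromℕ n) ≡ (if nw then semi else none)
  lk-l rewrite lookup∘tabulate (λ i → extendedOut V c nw (split i)) (fromℕ n) | split-last n = refl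

  inj≠last : ∀ (b : Fin n) → (fromℕ n ==F inject₁ b) ≡ false
  inj≠last b = ==F-false (λ e → <-irrefl (sym e) (inject₁<last b))

  inj≠last' : ∀ (b : Fin n) → (inject₁ b ==F fromℕ n) ≡ false
  inj≠last' b = ==F-false (λ e → <-irrefl e (inject₁<last b))

  liftArc : ∀ (x : Out n) b → isArcTo (liftOut x) (inject₁ b) ≡ isArcTo x b
  liftArc none b = refl
  liftArc semi b = refl
  liftArc (arc d) b rewrite toℕ-inject₁ d | toℕ-inject₁ b = refl

  liftArcL : ∀ (x : Out n) → isArcTo (liftOut x) (fromℕ n) ≡ false
  liftArcL none = refl
  liftArcL semi = refl
  liftArcL (arc d) = inj≠last' d

  module _ (ok : ClosesSemi V c) where
    arc-ii : ∀ a b → isArcTo (lookup E (inject₁ a)) (inject₁ b) ≡ isArcTo (lookup V a) b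
    arc-ii a b rewrite lk-i a with closes c a in eq
    ... | true rewrite ok a (subst T (sym eq) tt) = inj≠last b
    ... | false = liftArc (lookup V a) b

    out-i : ∀ a → hasOut (lookup E (inject₁ a)) ≡ hasOut (lookup V a)
    out-i a rewrite lk-i a with closes c a in eq
    ... | true rewrite ok a (subst T (sym eq) tt) = refl
    ... | false with lookup V a
    ... | none = refl
    ... | semi = refl
    ... | arc _ = refl

  arc-il : ∀ a → isArcTo (lookup E (inject₁ a)) (fromℕ n) ≡ closes c a
  arc-il a rewrite lk-i a with closes c a
  ... | true = closes-self (fromℕ n)
  ... | false = liftArcL (lookup V a)

  arc-l : ∀ x → isArcTo (lookup E (fromℕ n)) x ≡ false
  arc-l x rewrite lk-l = ifA nw
    where ifA : ∀ b → isArcTo (if b then semi else none) x ≡ false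
          ifA true = refl
          ifA false = refl

  semi-i : ∀ a → isSemi (lookup E (inject₁ a)) ≡ isSemi (lookup V a) ∧ not (closes c a)
  semi-i a rewrite lk-i a with closes c a
  ... | true = sym (∧-zeroʳ (isSemi (lookup V a)))
  ... | false with lookup V a
  ... | none = refl
  ... | semi = refl
  ... | arc _ = refl

  semi-l : isSemi (lookup E (fromℕ n)) ≡ nw
  semi-l rewrite lk-l = ifS nw
    where ifS : ∀ b → isSemi {suc n} (if b then semi else none) ≡ b
          ifS true = refl
          ifS false = refl

  out-l : hasOut (lookup E (fromℕ n)) ≡ nw
  out-l rewrite lk-l = ifO nw
    where ifO : ∀ b → hasOut {suc n} (if b then semi else none) ≡ b
          ifO true = refl
          ifO false = refl

  isArcO-i : ∀ a → isArcO (lookup E (inject₁ a)) ≡ closes c a ∨ isArcO (lookup V a)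
  isArcO-i a rewrite lk-i a with closes c a
  ... | true = refl
  ... | false with lookup V a
  ... | none = refl
  ... | semi = refl
  ... | arc _ = refl
  isArcO-l : isArcO (lookup E (fromℕ n)) ≡ false
  isArcO-l rewrite lk-l = go nw
    where go : ∀ b → isArcO {suc n} (if b then semi else none) ≡ false
          go true = refl
          go false = refl

  in-i : ClosesSemi V c → ∀ b → exF (λ x → isArcTo (lookup E x) (inject₁ b)) ≡ exF (λ a → isArcTo (lookup V a) b)
  in-i ok b = trans (exF≡ (λ x → isArcTo (lookup E x) (inject₁ b))) (trans (orFin-last (λ x → isArcTo (lookup E x) (inject₁ b)))
              (trans (cong₂ _∨_ (orFin-cong (λ a → arc-ii ok a b)) (arc-l (inject₁ b)))
              (trans (∨-identityʳ _) (sym (exF≡ (λ a → isArcTo (lookup V a) b))))))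

  orFin-closes : ∀ (d : Maybe (Fin n)) → orFin (closes d) ≡ is-just d
  orFin-closes nothing = orFin-false {n}
    where orFin-false : ∀ {m} → orFin {m} (λ _ → false) ≡ false
          orFin-false {zero} = refl
          orFin-false {suc m} = orFin-false {m}
  orFin-closes (just d) = bool-ext (λ _ → tt) (λ _ → orFin-intro (closes (just d)) d (subst T (sym (closes-self d)) tt))

  in-l : exF (λ x → isArcTo (lookup E x) (fromℕ n)) ≡ is-just c
  in-l = trans (exF≡ (λ x → isArcTo (lookup E x) (fromℕ n))) (trans (orFin-last (λ x → isArcTo (lookup E x) (fromℕ n))) (trans (cong₂ _∨_ (orFin-cong arc-il) (arc-l (fromℕ n)))
              (trans (∨-identityʳ _) (orFin-closes c))))

  count-in-inject : ClosesSemi V c → ∀ b → countFin (λ x → isArcTo (lookup E x) (inject₁ b)) ≡ countFin (λ a → isArcTo (lookup V a) b)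
  count-in-inject ok b = trans (countFin-last (λ x → isArcTo (lookup E x) (inject₁ b)))
    (trans (cong₂ _+_ (countFin-cong (λ a → arc-ii ok a b)) (cong b2n (arc-l (inject₁ b)))) (+-identityʳ _))

  count-in-last : countFin (λ x → isArcTo (lookup E x) (fromℕ n)) ≤ 1
  count-in-last = subst (_≤ 1)
    (sym (trans (countFin-last (λ x → isArcTo (lookup E x) (fromℕ n))) (trans (cong₂ _+_ (countFin-cong arc-il) (cong b2n (arc-l (fromℕ n)))) (+-identityʳ _))))
    (count-closes≤1 c)

findF-sound : ∀ {n} (p : Fin n → Bool) a → findF p ≡ just a → T (p a)
findF-sound {suc n} p a e with p zero in eq
findF-sound {suc n} p .zero refl | true = subst T (sym eq) tt
... | false with findF (p ∘ suc) in eq2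
findF-sound {suc n} p .(suc b) refl | false | just b = findF-sound (p ∘ suc) b eq2

findF-none : ∀ {n} (p : Fin n → Bool) → findF p ≡ nothing → ∀ a → ¬ T (p a)
findF-none {suc n} p e a t with p zero in eq
findF-none {suc n} p () a t | true
... | false with findF (p ∘ suc) in eq2
findF-none {suc n} p () a t | false | just b
findF-none {suc n} p e zero t | false | nothing = subst T eq t
findF-none {suc n} p e (suc a) t | false | nothing = findF-none (p ∘ suc) eq2 a t

findF-complete : ∀ {n} (p : Fin n → Bool) a → T (p a) → (∀ b → T (p b) → b ≡ a) → findF p ≡ just a
findF-complete p a t u with findF p in eq
... | just b = cong just (u b (findF-sound p b eq))
... | nothing = ⊥-elim (findF-none p eq a t)

findF-cong : ∀ {n} {p q : Fin n → Bool} → (∀ i → p i ≡ q i) → findF p ≡ findF q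
findF-cong {zero} e = refl
findF-cong {suc n} {p} {q} e rewrite e zero | findF-cong {n} {p ∘ suc} {q ∘ suc} (e ∘ suc) = refl

findF-closes : ∀ {n} (c : Maybe (Fin n)) → findF (closes c) ≡ c
findF-closes {n} nothing = ff n
  where ff : ∀ m → findF {m} (λ _ → false) ≡ nothing
        ff zero = refl
        ff (suc m) rewrite ff m = refl
findF-closes (just c) = findF-complete (closes (just c)) c (subst T (sym (closes-self c)) tt)
                          (λ b t → sym (==F⇒ t))

split-just : ∀ {n} (c : Fin (suc n)) c' → split c ≡ just c' → c ≡ inject₁ c'
split-just {suc n} zero .zero refl = refl
split-just {suc n} (suc c) c' e with split c in eq
split-just {suc n} (suc c) .(suc d) refl | just d = cong suc (split-just c d eq)

split-nothing : ∀ {n} (c : Fin (suc n)) → split c ≡ nothing → c ≡ fromℕ n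
split-nothing {zero} zero e = refl
split-nothing {suc n} (suc c) e with split c in eq
split-nothing {suc n} (suc c) refl | nothing = cong suc (split-nothing c eq)

ActionFits : ∀ {n} → RawDiagram n → Act n → Set
ActionFits R a = ClosesSemi (proj₁ R) (closeU a) × ClosesSemi (proj₂ R) (closeL a)

vertexType : Bool → Bool → Bool → Bool → Bool
vertexType oU oL iU iL =
     (not oU ∧ not oL ∧ not iU ∧ not iL)
  ∨ (oU ∧ oL ∧ not iU ∧ not iL)
  ∨ (iU ∧ iL ∧ not oU ∧ not oL)
  ∨ (iU ∧ oU ∧ not iL ∧ not oL)
  ∨ (iL ∧ oL ∧ not iU ∧ not oU)

actionTypeOK : ∀ {n} → Act n → Bool
actionTypeOK a = vertexType (openU a) (openL a) (is-just (closeU a)) (is-just (closeL a))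

module Extension {n : ℕ} (R : RawDiagram n) (α : Act n) where
  R' : RawDiagram (suc n)
  R' = extend R α
  module SU = ExtendedSide (proj₁ R) (closeU α) (openU α)
  module SL = ExtendedSide (proj₂ R) (closeL α) (openL α)

  module _ (ok : ActionFits R α) where
    fixed-i : ∀ a → fixedR R' (inject₁ a) ≡ fixedR R a
    fixed-i a rewrite SU.out-i (proj₁ ok) a | SL.out-i (proj₂ ok) a | SU.in-i (proj₁ ok) a | SL.in-i (proj₂ ok) a = refl

    vok-i : ∀ a → vertexOK R' (inject₁ a) ≡ vertexOK R a
    vok-i a rewrite SU.out-i (proj₁ ok) a | SL.out-i (proj₂ ok) a | SU.in-i (proj₁ ok) a | SL.in-i (proj₂ ok) a = refl

  fixed-l : fixedR R' (fromℕ n) ≡ not (openU α) ∧ not (openL α) ∧ not (is-just (closeU α)) ∧ not (is-just (closeL α))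
  fixed-l rewrite SU.out-l | SL.out-l | SU.in-l | SL.in-l = refl

  vok-l : vertexOK R' (fromℕ n) ≡ actionTypeOK α
  vok-l rewrite SU.out-l | SL.out-l | SU.in-l | SL.in-l = refl

restrictOut-liftOut : ∀ {n} (x : Out n) → restrictOut (liftOut x) ≡ x
restrictOut-liftOut none = refl
restrictOut-liftOut semi = refl
restrictOut-liftOut (arc c) rewrite split-inj c = refl

restrictVec-extendVec : ∀ {n} (V : Vec (Out n) n) c nw → ClosesSemi V c → restrictVec (extendVec V c nw) ≡ V
restrictVec-extendVec {n} V c nw ok = vec-ext λ a → trans (lookup∘tabulate (λ a → restrictOut (lookup (extendVec V c nw) (inject₁ a))) a) (go a)
  where
  open ExtendedSide V c nw
  go : ∀ a → restrictOut (lookup E (inject₁ a)) ≡ lookup V a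
  go a rewrite lk-i a with closes c a in eq
  ... | true rewrite split-last n = sym (ok a (subst T (sym eq) tt))
  ... | false = restrictOut-liftOut (lookup V a)

restrict-extend : ∀ {n} (R : RawDiagram n) α → ActionFits R α → restrict (extend R α) ≡ R
restrict-extend R α (o1 , o2) = cong₂ _,_ (restrictVec-extendVec (proj₁ R) (closeU α) (openU α) o1) (restrictVec-extendVec (proj₂ R) (closeL α) (openL α) o2)

findCloser-extendVec : ∀ {n} (V : Vec (Out n) n) c nw → findCloser (extendVec V c nw) ≡ c
findCloser-extendVec V c nw = trans (findF-cong (ExtendedSide.arc-il V c nw)) (findF-closes c)

lastAction-extend : ∀ {n} (R : RawDiagram n) α → lastAction (extend R α) ≡ α
lastAction-extend R α rewrite findCloser-extendVec (proj₁ R) (closeU α) (openU α) | findCloser-extendVec (proj₂ R) (closeL α) (openL α)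
  | ExtendedSide.out-l (proj₁ R) (closeU α) (openU α) | ExtendedSide.out-l (proj₂ R) (closeL α) (openL α) = refl

isArcTo-eq : ∀ {n} (x : Out n) b → T (isArcTo x b) → x ≡ arc b
isArcTo-eq (arc c) b t = cong arc (==F⇒ t)

Right : ∀ {n} → Vec (Out n) n → Set
Right V = ∀ a b → T (isArcTo (lookup V a) b) → toℕ a < toℕ b

Uniq : ∀ {n} → Vec (Out n) n → Set
Uniq V = ∀ a a' b → T (isArcTo (lookup V a) b) → T (isArcTo (lookup V a') b) → a ≡ a'

liftOut-restrictOut : ∀ {n} (x : Out (suc n)) → ¬ T (isArcTo x (fromℕ n)) → liftOut (restrictOut x) ≡ x
liftOut-restrictOut none _ = refl
liftOut-restrictOut semi _ = refl
liftOut-restrictOut {n} (arc c) nt with split c in eq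
... | just c' = cong arc (sym (split-just c c' eq))
... | nothing = ⊥-elim (nt (subst (λ z → T (z ==F fromℕ n)) (sym (split-nothing c eq)) (⇒==F (fromℕ n))))

extendVec-restrictVec : ∀ {n} (V' : Vec (Out (suc n)) (suc n)) → Right V' → Uniq V' →
         extendVec (restrictVec V') (findCloser V') (hasOut (lookup V' (fromℕ n))) ≡ V'
extendVec-restrictVec {n} V' rt un = vec-ext go
  where
  open ExtendedSide (restrictVec V') (findCloser V') (hasOut (lookup V' (fromℕ n)))
  p : Fin n → Bool
  p a = isArcTo (lookup V' (inject₁ a)) (fromℕ n)
  lastOK : ∀ (x : Out (suc n)) → x ≡ lookup V' (fromℕ n) → (if hasOut x then semi else none) ≡ x
  lastOK none e = refl
  lastOK semi e = refl
  lastOK (arc c) e = ⊥-elim (<⇒≱ (subst (_< toℕ c) (toℕ-fromℕ n) (rt (fromℕ n) c (subst (λ z → T (isArcTo z c)) e (⇒==F c)))) (≤-pred (toℕ<n c)))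
  go : ∀ i → lookup E i ≡ lookup V' i
  go i with lastView i
  ... | new rewrite lk-l = lastOK (lookup V' (fromℕ n)) refl
  ... | old a rewrite lk-i a | lookup∘tabulate (λ a → restrictOut (lookup V' (inject₁ a))) a with p a in eq
  ... | true rewrite findF-complete p a (subst T (sym eq) tt) (λ b t → inject₁-injective (un (inject₁ b) (inject₁ a) (fromℕ n) t (subst T (sym eq) tt)))
                   | closes-self a = sym (isArcTo-eq (lookup V' (inject₁ a)) (fromℕ n) (subst T (sym eq) tt))
  ... | false with closes (findCloser V') a in eq2
  ... | true = ⊥-elim (subst T eq (findF-sound p a (closes-eq (findCloser V') a (subst T (sym eq2) tt))))
  ... | false = liftOut-restrictOut (lookup V' (inject₁ a)) (λ t → subst T eq t)

count-two : ∀ {n} (p : Fin n → Bool) a a' → ¬ a ≡ a' → T (p a) → T (p a') → 2 ≤ countFin p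
count-two {suc n} p zero zero ne _ _ = ⊥-elim (ne refl)
count-two {suc n} p zero (suc a') ne t t' with p zero
... | true = s≤s (≤-trans (s≤s z≤n) (rank<count (p ∘ suc) a' t'))
count-two {suc n} p (suc a) zero ne t t' with p zero
... | true = s≤s (≤-trans (s≤s z≤n) (rank<count (p ∘ suc) a t))
count-two {suc n} p (suc a) (suc a') ne t t' = ≤-trans (count-two (p ∘ suc) a a' (λ e → ne (cong suc e)) t t') (m≤n+m _ (b2n (p zero)))

T-arcs-l : ∀ x y z → T x → T (not (x ∨ y) ∨ z) → T z
T-arcs-l true y z _ t = t
T-arcs-r : ∀ x y z → T y → T (not (x ∨ y) ∨ z) → T z
T-arcs-r true true z _ t = t
T-arcs-r false true z _ t = t

module Validity {n : ℕ} (R : RawDiagram n) (v : T (validDiagram R)) where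
  vA : T (arcsOK R)
  vA = T∧-l {arcsOK R} v
  vI : T (inOK R)
  vI = T∧-l {inOK R} (T∧-r {arcsOK R} v)
  vV : T (allF (vertexOK R))
  vV = T∧-r {inOK R} (T∧-r {arcsOK R} v)

  rightU : Right (proj₁ R)
  rightU a b t = <F⇒ (T-arcs-l _ _ _ t (allF-elim _ (allF-elim _ vA a) b))
  rightL : Right (proj₂ R)
  rightL a b t = <F⇒ (T-arcs-r _ _ _ t (allF-elim _ (allF-elim _ vA a) b))

  uniqGen : (p : Fin n → Fin n → Bool) → (∀ b → T (length (filterᵇ (λ a → p a b) (allFin n)) ≤ᵇ 1)) →
            ∀ a a' b → T (p a b) → T (p a' b) → a ≡ a'
  uniqGen p h a a' b t t' with a ≟F a'
  ... | yes e = e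
  ... | no ne = ⊥-elim (<⇒≱ (count-two (λ x → p x b) a a' ne t t') (subst (_≤ 1) (count≡ (λ x → p x b)) (≤ᵇ⇒≤ _ 1 (h b))))

  uniqU : Uniq (proj₁ R)
  uniqU = uniqGen (arcUR R) (λ b → T∧-l (allF-elim _ vI b))
  uniqL : Uniq (proj₂ R)
  uniqL = uniqGen (arcLR R) (λ b → T∧-r {length (filterᵇ (λ a → arcUR R a b) (allFin n)) ≤ᵇ 1} (allF-elim _ vI b))

extend-restrict : ∀ {n} (R' : RawDiagram (suc n)) → T (validDiagram R') → extend (restrict R') (lastAction R') ≡ R'
extend-restrict R' v = cong₂ _,_ (extendVec-restrictVec (proj₁ R') rightU uniqU) (extendVec-restrictVec (proj₂ R') rightL uniqL)
  where open Validity R' v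

closesSemi-restrictVec : ∀ {n} (V' : Vec (Out (suc n)) (suc n)) → ClosesSemi (restrictVec V') (findCloser V')
closesSemi-restrictVec {n} V' a t rewrite lookup∘tabulate (λ a → restrictOut (lookup V' (inject₁ a))) a
   | isArcTo-eq (lookup V' (inject₁ a)) (fromℕ n) (findF-sound _ a (closes-eq (findCloser V') a t)) | split-last n = refl

actionFits-restrict : ∀ {n} (R' : RawDiagram (suc n)) → ActionFits (restrict R') (lastAction R')
actionFits-restrict R' = closesSemi-restrictVec (proj₁ R') , closesSemi-restrictVec (proj₂ R')

module ExtensionValidity {n : ℕ} (R : RawDiagram n) (α : Act n) (ok : ActionFits R α) where
  open Extension R α
  o1 : ClosesSemi (proj₁ R) (closeU α)
  o1 = proj₁ ok
  o2 : ClosesSemi (proj₂ R) (closeL α)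
  o2 = proj₂ ok

  Q : ∀ {m} → RawDiagram m → Fin m → Fin m → Bool
  Q R a b = not (arcUR R a b ∨ arcLR R a b) ∨ (a <F b)

  Q-ii : ∀ a b → Q R' (inject₁ a) (inject₁ b) ≡ Q R a b
  Q-ii a b rewrite SU.arc-ii o1 a b | SL.arc-ii o2 a b | toℕ-inject₁ a | toℕ-inject₁ b = refl

  Q-il : ∀ a → T (Q R' (inject₁ a) (fromℕ n))
  Q-il a = T∨-intro₂ {not (arcUR R' (inject₁ a) (fromℕ n) ∨ arcLR R' (inject₁ a) (fromℕ n))} (⇒<F (inject₁<last a))

  Q-l : ∀ b → T (Q R' (fromℕ n) b)
  Q-l b rewrite SU.arc-l b | SL.arc-l b = tt

  arcs→ : T (arcsOK R') → T (arcsOK R)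
  arcs→ t = allF-intro _ (λ a → allF-intro _ (λ b → subst T (Q-ii a b) (allF-elim _ (allF-elim _ t (inject₁ a)) (inject₁ b))))

  arcs← : T (arcsOK R) → T (arcsOK R')
  arcs← t = allF-intro _ (λ i → allF-intro _ (λ j → go i j (lastView i) (lastView j)))
    where
    go : ∀ i j → LastView i → LastView j → T (Q R' i j)
    go .(inject₁ a) .(inject₁ b) (old a) (old b) = subst T (sym (Q-ii a b)) (allF-elim _ (allF-elim _ t a) b)
    go .(inject₁ a) .(fromℕ n) (old a) new = Q-il a
    go .(fromℕ n) j new _ = Q-l j

  cU : ∀ {m} → RawDiagram m → Fin m → ℕ
  cU {m} R b = length (filterᵇ (λ a → arcUR R a b) (allFin m))
  cL : ∀ {m} → RawDiagram m → Fin m → ℕ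
  cL {m} R b = length (filterᵇ (λ a → arcLR R a b) (allFin m))

  cU-i : ∀ b → cU R' (inject₁ b) ≡ cU R b
  cU-i b = trans (count≡ (λ x → arcUR R' x (inject₁ b))) (trans (SU.count-in-inject o1 b) (sym (count≡ (λ a → arcUR R a b))))
  cL-i : ∀ b → cL R' (inject₁ b) ≡ cL R b
  cL-i b = trans (count≡ (λ x → arcLR R' x (inject₁ b))) (trans (SL.count-in-inject o2 b) (sym (count≡ (λ a → arcLR R a b))))
  cU-l : cU R' (fromℕ n) ≤ 1
  cU-l = subst (_≤ 1) (sym (count≡ (λ x → arcUR R' x (fromℕ n)))) SU.count-in-last
  cL-l : cL R' (fromℕ n) ≤ 1
  cL-l = subst (_≤ 1) (sym (count≡ (λ x → arcLR R' x (fromℕ n)))) SL.count-in-last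

  in→ : T (inOK R') → T (inOK R)
  in→ t = allF-intro _ (λ b → subst T (cong₂ (λ x y → (x ≤ᵇ 1) ∧ (y ≤ᵇ 1)) (cU-i b) (cL-i b)) (allF-elim _ t (inject₁ b)))

  in← : T (inOK R) → T (inOK R')
  in← t = allF-intro _ go
    where
    go : ∀ i → T ((cU R' i ≤ᵇ 1) ∧ (cL R' i ≤ᵇ 1))
    go i with lastView i
    ... | old b = subst T (sym (cong₂ (λ x y → (x ≤ᵇ 1) ∧ (y ≤ᵇ 1)) (cU-i b) (cL-i b))) (allF-elim _ t b)
    ... | new = T∧-intro (≤⇒≤ᵇ cU-l) (≤⇒≤ᵇ cL-l)

  vok≡ : allF (vertexOK R') ≡ allF (vertexOK R) ∧ actionTypeOK α
  vok≡ = trans (allF≡ (vertexOK R')) (trans (andFin-last (vertexOK R')) (cong₂ _∧_ (trans (andFin-cong (vok-i ok)) (sym (allF≡ (vertexOK R)))) vok-l))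

  valid→ : T (validDiagram R') → T (validDiagram R) × T (actionTypeOK α)
  valid→ v = T∧-intro (arcs→ vA) (T∧-intro (in→ vI) (T∧-l {allF (vertexOK R)} vV')) , T∧-r {allF (vertexOK R)} vV'
    where
    vA = T∧-l {arcsOK R'} v
    vI = T∧-l {inOK R'} (T∧-r {arcsOK R'} v)
    vV' = subst T vok≡ (T∧-r {inOK R'} (T∧-r {arcsOK R'} v))

  valid← : T (validDiagram R) → T (actionTypeOK α) → T (validDiagram R')
  valid← v ty = T∧-intro (arcs← vA) (T∧-intro (in← vI) (subst T (sym vok≡) (T∧-intro vV ty)))
    where
    vA = T∧-l {arcsOK R} v
    vI = T∧-l {inOK R} (T∧-r {arcsOK R} v)
    vV = T∧-r {inOK R} (T∧-r {arcsOK R} v)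

-- Forbidden configurations

module _ {n : ℕ} where
  Arc : Set
  Arc = Fin n → Fin n → Bool
  Pred : Set
  Pred = Fin n → Bool

  n3 : Arc → Bool
  n3 ar = exF (λ i1 → exF (λ j1 → exF (λ i2 → exF (λ j2 → exF (λ i3 → exF (λ j3 →
        ar i1 j1 ∧ ar i2 j2 ∧ ar i3 j3 ∧
        (i1 <F i2) ∧ (i2 <F i3) ∧ (i3 <F j3) ∧ (j3 <F j2) ∧ (j2 <F j1)))))))

  n2f : Arc → Pred → Bool
  n2f ar fixed = exF (λ i1 → exF (λ j1 → exF (λ i2 → exF (λ j2 → exF (λ f →
        ar i1 j1 ∧ ar i2 j2 ∧ fixed f ∧
        (i1 <F i2) ∧ (i2 <F f) ∧ (f <F j2) ∧ (j2 <F j1))))))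

  fn2 : Arc → Fin n → Bool
  fn2 ar a = exF (λ i1 → exF (λ j1 → exF (λ i2 → exF (λ j2 →
         ar i1 j1 ∧ ar i2 j2 ∧
         (a <F i1) ∧ (i1 <F i2) ∧ (i2 <F j2) ∧ (j2 <F j1)))))

  fnf : Arc → Pred → Fin n → Bool
  fnf ar fixed a = exF (λ i1 → exF (λ j1 → exF (λ f →
         ar i1 j1 ∧ fixed f ∧
         (a <F i1) ∧ (i1 <F f) ∧ (f <F j1))))

  record N3 (ar : Arc) : Set where
    constructor mkN3
    field
      i1 j1 i2 j2 i3 j3 : Fin n
      a1 : T (ar i1 j1)
      a2 : T (ar i2 j2)
      a3 : T (ar i3 j3)
      o1 : toℕ i1 < toℕ i2
      o2 : toℕ i2 < toℕ i3
      o3 : toℕ i3 < toℕ j3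
      o4 : toℕ j3 < toℕ j2
      o5 : toℕ j2 < toℕ j1

  record N2F (ar : Arc) (fixed : Pred) : Set where
    constructor mkN2F
    field
      i1 j1 i2 j2 f : Fin n
      a1 : T (ar i1 j1)
      a2 : T (ar i2 j2)
      fx : T (fixed f)
      o1 : toℕ i1 < toℕ i2
      o2 : toℕ i2 < toℕ f
      o3 : toℕ f < toℕ j2
      o4 : toℕ j2 < toℕ j1

  record FN2 (sm : Pred) (ar : Arc) : Set where
    constructor mkFN2
    field
      a i1 j1 i2 j2 : Fin n
      sa : T (sm a)
      a1 : T (ar i1 j1)
      a2 : T (ar i2 j2)
      o0 : toℕ a < toℕ i1
      o1 : toℕ i1 < toℕ i2
      o2 : toℕ i2 < toℕ j2
      o3 : toℕ j2 < toℕ j1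

  record FNF (sm : Pred) (ar : Arc) (fixed : Pred) : Set where
    constructor mkFNF
    field
      a i1 j1 f : Fin n
      sa : T (sm a)
      a1 : T (ar i1 j1)
      fx : T (fixed f)
      o0 : toℕ a < toℕ i1
      o1 : toℕ i1 < toℕ f
      o2 : toℕ f < toℕ j1

  N3→ : ∀ {ar} → N3 ar → T (n3 ar)
  N3→ {ar} (mkN3 i1 j1 i2 j2 i3 j3 a1 a2 a3 o1 o2 o3 o4 o5) =
    exF-intro _ i1 (exF-intro _ j1 (exF-intro _ i2 (exF-intro _ j2 (exF-intro _ i3 (exF-intro _ j3 (T∧-intro a1 (T∧-intro a2 (T∧-intro a3 (T∧-intro (⇒<F o1) (T∧-intro (⇒<F o2) (T∧-intro (⇒<F o3) (T∧-intro (⇒<F o4) ((⇒<F o5))))))))))))))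

  →N3 : ∀ {ar} → T (n3 ar) → N3 ar
  →N3 {ar} t with exF-elim _ t
  ... | i1 , t1 with exF-elim _ t1
  ... | j1 , t2 with exF-elim _ t2
  ... | i2 , t3 with exF-elim _ t3
  ... | j2 , t4 with exF-elim _ t4
  ... | i3 , t5 with exF-elim _ t5
  ... | j3 , t6 = mkN3 i1 j1 i2 j2 i3 j3 (T∧-l c0) (T∧-l c1) (T∧-l c2) (<F⇒ (T∧-l c3)) (<F⇒ (T∧-l c4)) (<F⇒ (T∧-l c5)) (<F⇒ (T∧-l c6)) (<F⇒ (T∧-r {j3 <F j2} c6))
    where
    c0 = t6
    c1 = T∧-r {ar i1 j1} c0
    c2 = T∧-r {ar i2 j2} c1
    c3 = T∧-r {ar i3 j3} c2
    c4 = T∧-r {i1 <F i2} c3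
    c5 = T∧-r {i2 <F i3} c4
    c6 = T∧-r {i3 <F j3} c5

  N2F→ : ∀ {ar fixed} → N2F ar fixed → T (n2f ar fixed)
  N2F→ (mkN2F i1 j1 i2 j2 f a1 a2 fx o1 o2 o3 o4) =
    exF-intro _ i1 (exF-intro _ j1 (exF-intro _ i2 (exF-intro _ j2 (exF-intro _ f (T∧-intro a1 (T∧-intro a2 (T∧-intro fx (T∧-intro (⇒<F o1) (T∧-intro (⇒<F o2) (T∧-intro (⇒<F o3) ((⇒<F o4))))))))))))

  →N2F : ∀ {ar fixed} → T (n2f ar fixed) → N2F ar fixed
  →N2F {ar} {fixed} t with exF-elim _ t
  ... | i1 , t1 with exF-elim _ t1
  ... | j1 , t2 with exF-elim _ t2
  ... | i2 , t3 with exF-elim _ t3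
  ... | j2 , t4 with exF-elim _ t4
  ... | f , t5 = mkN2F i1 j1 i2 j2 f (T∧-l c0) (T∧-l c1) (T∧-l c2) (<F⇒ (T∧-l c3)) (<F⇒ (T∧-l c4)) (<F⇒ (T∧-l c5)) (<F⇒ (T∧-r {f <F j2} c5))
    where
    c0 = t5
    c1 = T∧-r {ar i1 j1} c0
    c2 = T∧-r {ar i2 j2} c1
    c3 = T∧-r {fixed f} c2
    c4 = T∧-r {i1 <F i2} c3
    c5 = T∧-r {i2 <F f} c4

  FN2→ : ∀ {sm ar} → (w : FN2 sm ar) → T (fn2 ar (FN2.a w))
  FN2→ (mkFN2 a i1 j1 i2 j2 sa a1 a2 o0 o1 o2 o3) =
    exF-intro _ i1 (exF-intro _ j1 (exF-intro _ i2 (exF-intro _ j2 (T∧-intro a1 (T∧-intro a2 (T∧-intro (⇒<F o0) (T∧-intro (⇒<F o1) (T∧-intro (⇒<F o2) ((⇒<F o3))))))))))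

  FNF→ : ∀ {sm ar fixed} → (w : FNF sm ar fixed) → T (fnf ar fixed (FNF.a w))
  FNF→ (mkFNF a i1 j1 f sa a1 fx o0 o1 o2) =
    exF-intro _ i1 (exF-intro _ j1 (exF-intro _ f (T∧-intro a1 (T∧-intro fx (T∧-intro (⇒<F o0) (T∧-intro (⇒<F o1) ((⇒<F o2))))))))

  →FN2 : ∀ {sm ar} a → T (sm a) → T (fn2 ar a) → FN2 sm ar
  →FN2 {sm} {ar} a sa t with exF-elim _ t
  ... | i1 , t1 with exF-elim _ t1
  ... | j1 , t2 with exF-elim _ t2
  ... | i2 , t3 with exF-elim _ t3
  ... | j2 , t4 = mkFN2 a i1 j1 i2 j2 sa (T∧-l c0) (T∧-l c1) (<F⇒ (T∧-l c2)) (<F⇒ (T∧-l c3)) (<F⇒ (T∧-l c4)) (<F⇒ (T∧-r {i2 <F j2} c4))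
    where
    c0 = t4
    c1 = T∧-r {ar i1 j1} c0
    c2 = T∧-r {ar i2 j2} c1
    c3 = T∧-r {a <F i1} c2
    c4 = T∧-r {i1 <F i2} c3

  →FNF : ∀ {sm ar fixed} a → T (sm a) → T (fnf ar fixed a) → FNF sm ar fixed
  →FNF {sm} {ar} {fixed} a sa t with exF-elim _ t
  ... | i1 , t1 with exF-elim _ t1
  ... | j1 , t2 with exF-elim _ t2
  ... | f , t3 = mkFNF a i1 j1 f sa (T∧-l c0) (T∧-l c1) (<F⇒ (T∧-l c2)) (<F⇒ (T∧-l c3)) (<F⇒ (T∧-r {i1 <F f} c3))
    where
    c0 = t3
    c1 = T∧-r {ar i1 j1} c0
    c2 = T∧-r {fixed f} c1
    c3 = T∧-r {a <F i1} c2

module Nestings {n : ℕ} (D : ArcData n) where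
  open ArcData D

  Forbidden : Set
  Forbidden = N3 arcU ⊎ (N2F arcU fixed ⊎ (FN2 semiU arcU ⊎ (FNF semiU arcU fixed ⊎ (N3 arcL ⊎ FN2 semiL arcL))))

  nonnesting-elim : T (nonnesting3 D) → Forbidden → ⊥
  nonnesting-elim t b = Tnot-elim t (go b)
    where
    go : Forbidden → T (upperEnh3 D ∨ futureUpperEnh3 D ∨ lower3 D ∨ futureLower3 D)
    go (inj₁ w) = T∨-intro₁ (T∨-intro₁ (N3→ w))
    go (inj₂ (inj₁ w)) = T∨-intro₁ (T∨-intro₂ {n3 arcU} (N2F→ w))
    go (inj₂ (inj₂ (inj₁ w))) = T∨-intro₂ {upperEnh3 D} (T∨-intro₁ (exF-intro _ (FN2.a w) (T∧-intro (FN2.sa w) (T∨-intro₁ (FN2→ w)))))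
    go (inj₂ (inj₂ (inj₂ (inj₁ w)))) = T∨-intro₂ {upperEnh3 D} (T∨-intro₁ (exF-intro _ (FNF.a w) (T∧-intro (FNF.sa w) (T∨-intro₂ {fn2 arcU (FNF.a w)} (FNF→ w)))))
    go (inj₂ (inj₂ (inj₂ (inj₂ (inj₁ w))))) = T∨-intro₂ {upperEnh3 D} (T∨-intro₂ {futureUpperEnh3 D} (T∨-intro₁ (N3→ w)))
    go (inj₂ (inj₂ (inj₂ (inj₂ (inj₂ w))))) = T∨-intro₂ {upperEnh3 D} (T∨-intro₂ {futureUpperEnh3 D} (T∨-intro₂ {lower3 D} (exF-intro _ (FN2.a w) (T∧-intro (FN2.sa w) (FN2→ w)))))

  nonnesting-intro : (Forbidden → ⊥) → T (nonnesting3 D)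
  nonnesting-intro f = Tnot-intro (λ t → f (go t))
    where
    go : T (upperEnh3 D ∨ futureUpperEnh3 D ∨ lower3 D ∨ futureLower3 D) → Forbidden
    go t with T∨-elim {upperEnh3 D} t
    ... | inj₁ u with T∨-elim {n3 arcU} u
    ... | inj₁ x = inj₁ (→N3 x)
    ... | inj₂ x = inj₂ (inj₁ (→N2F x))
    go t | inj₂ u with T∨-elim {futureUpperEnh3 D} u
    ... | inj₁ x with exF-elim _ x
    ... | a , y with T∨-elim {fn2 arcU a} (T∧-r {semiU a} y)
    ... | inj₁ z = inj₂ (inj₂ (inj₁ (→FN2 a (T∧-l y) z)))
    ... | inj₂ z = inj₂ (inj₂ (inj₂ (inj₁ (→FNF a (T∧-l y) z))))
    go t | inj₂ u | inj₂ v with T∨-elim {lower3 D} v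
    ... | inj₁ x = inj₂ (inj₂ (inj₂ (inj₂ (inj₁ (→N3 x)))))
    ... | inj₂ x with exF-elim _ x
    ... | a , y = inj₂ (inj₂ (inj₂ (inj₂ (inj₂ (→FN2 a (T∧-l y) (T∧-r {semiL a} y))))))

-- Nonnesting and the last vertex

BlockedU : ∀ {n} → RawDiagram n → Fin n → Set
BlockedU {n} R a = (Σ (Fin n) λ i → Σ (Fin n) λ j → T (arcUR R i j) × toℕ a < toℕ i × toℕ i < toℕ j) ⊎ (Σ (Fin n) λ f → T (fixedR R f) × toℕ a < toℕ f)

BlockedL : ∀ {n} → RawDiagram n → Fin n → Set
BlockedL {n} R a = Σ (Fin n) λ i → Σ (Fin n) λ j → T (arcLR R i j) × toℕ a < toℕ i × toℕ i < toℕ j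

SemiBefore : ∀ {n} → Vec (Out n) n → Fin n → Set
SemiBefore {n} V a = Σ (Fin n) λ b → T (isSemi (lookup V b)) × toℕ b < toℕ a

SafeCloseU : ∀ {n} → RawDiagram n → Maybe (Fin n) → Set
SafeCloseU R c = ∀ a → c ≡ just a → BlockedU R a → SemiBefore (proj₁ R) a → ⊥

SafeCloseL : ∀ {n} → RawDiagram n → Maybe (Fin n) → Set
SafeCloseL R c = ∀ a → c ≡ just a → BlockedL R a → SemiBefore (proj₂ R) a → ⊥

_⟫_ : ∀ {a b c} → a < b → b < c → a < c
_⟫_ = <-trans
infixr 5 _⟫_

↓ : ∀ {n} {a b : Fin n} → toℕ (inject₁ a) < toℕ (inject₁ b) → toℕ a < toℕ b
↓ {a = a} {b} p rewrite toℕ-inject₁ a | toℕ-inject₁ b = p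

↑ : ∀ {n} {a b : Fin n} → toℕ a < toℕ b → toℕ (inject₁ a) < toℕ (inject₁ b)
↑ {a = a} {b} p rewrite toℕ-inject₁ a | toℕ-inject₁ b = p

below : ∀ {n} (x y : Fin (suc n)) → toℕ x < toℕ y → Σ (Fin n) (λ a → x ≡ inject₁ a)
below {n} x y p with lastView x
... | old a = a , refl
... | new = ⊥-elim (<⇒≱ (subst (_< toℕ y) (toℕ-fromℕ n) p) (≤-pred (toℕ<n y)))

module ExtensionNesting {n : ℕ} (R : RawDiagram n) (α : Act n) (ok : ActionFits R α) where
  open Extension R α
  D D' : ArcData _
  D = rawArcData R
  D' = rawArcData R'
  U L : Vec (Out n) n
  U = proj₁ R
  L = proj₂ R

  aU-ii : ∀ a b → arcUR R' (inject₁ a) (inject₁ b) ≡ arcUR R a b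
  aU-ii = SU.arc-ii (proj₁ ok)
  aL-ii : ∀ a b → arcLR R' (inject₁ a) (inject₁ b) ≡ arcLR R a b
  aL-ii = SL.arc-ii (proj₂ ok)
  aU-il : ∀ a → arcUR R' (inject₁ a) (fromℕ n) ≡ closes (closeU α) a
  aU-il = SU.arc-il
  aL-il : ∀ a → arcLR R' (inject₁ a) (fromℕ n) ≡ closes (closeL α) a
  aL-il = SL.arc-il
  fx-i : ∀ a → fixedR R' (inject₁ a) ≡ fixedR R a
  fx-i = fixed-i ok

  semiU-cl : ∀ a → T (closes (closeU α) a) → T (isSemi (lookup U a))
  semiU-cl a t rewrite proj₁ ok a t = tt
  semiL-cl : ∀ a → T (closes (closeL α) a) → T (isSemi (lookup L a))
  semiL-cl a t rewrite proj₂ ok a t = tt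

  sU-i : ∀ a → isSemi (lookup (proj₁ R') (inject₁ a)) ≡ isSemi (lookup U a) ∧ not (closes (closeU α) a)
  sU-i = SU.semi-i
  sL-i : ∀ a → isSemi (lookup (proj₂ R') (inject₁ a)) ≡ isSemi (lookup L a) ∧ not (closes (closeL α) a)
  sL-i = SL.semi-i

  AU : ∀ {a b} → T (arcUR R a b) → T (arcUR R' (inject₁ a) (inject₁ b))
  AU {a} {b} = subst T (sym (aU-ii a b))
  AL : ∀ {a b} → T (arcLR R a b) → T (arcLR R' (inject₁ a) (inject₁ b))
  AL {a} {b} = subst T (sym (aL-ii a b))
  AU⁻ : ∀ {a b} → T (arcUR R' (inject₁ a) (inject₁ b)) → T (arcUR R a b)
  AU⁻ {a} {b} = subst T (aU-ii a b)
  AL⁻ : ∀ {a b} → T (arcLR R' (inject₁ a) (inject₁ b)) → T (arcLR R a b)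
  AL⁻ {a} {b} = subst T (aL-ii a b)
  FX : ∀ {f} → T (fixedR R f) → T (fixedR R' (inject₁ f))
  FX {f} = subst T (sym (fx-i f))
  FX⁻ : ∀ {f} → T (fixedR R' (inject₁ f)) → T (fixedR R f)
  FX⁻ {f} = subst T (fx-i f)
  AUc : ∀ {a} → T (closes (closeU α) a) → T (arcUR R' (inject₁ a) (fromℕ n))
  AUc {a} = subst T (sym (aU-il a))
  ALc : ∀ {a} → T (closes (closeL α) a) → T (arcLR R' (inject₁ a) (fromℕ n))
  ALc {a} = subst T (sym (aL-il a))
  AUc⁻ : ∀ {a} → T (arcUR R' (inject₁ a) (fromℕ n)) → T (closes (closeU α) a)
  AUc⁻ {a} = subst T (aU-il a)
  ALc⁻ : ∀ {a} → T (arcLR R' (inject₁ a) (fromℕ n)) → T (closes (closeL α) a)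
  ALc⁻ {a} = subst T (aL-il a)
  SU : ∀ {a} → T (isSemi (lookup U a)) → ¬ T (closes (closeU α) a) → T (isSemi (lookup (proj₁ R') (inject₁ a)))
  SU {a} s nc = subst T (sym (sU-i a)) (T∧-intro s (Tnot-intro nc))
  SL : ∀ {a} → T (isSemi (lookup L a)) → ¬ T (closes (closeL α) a) → T (isSemi (lookup (proj₂ R') (inject₁ a)))
  SL {a} s nc = subst T (sym (sL-i a)) (T∧-intro s (Tnot-intro nc))
  SU⁻ : ∀ {a} → T (isSemi (lookup (proj₁ R') (inject₁ a))) → T (isSemi (lookup U a)) × ¬ T (closes (closeU α) a)
  SU⁻ {a} t = let t' = subst T (sU-i a) t in T∧-l t' , Tnot-elim (T∧-r {isSemi (lookup U a)} t')
  SL⁻ : ∀ {a} → T (isSemi (lookup (proj₂ R') (inject₁ a))) → T (isSemi (lookup L a)) × ¬ T (closes (closeL α) a)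
  SL⁻ {a} t = let t' = subst T (sL-i a) t in T∧-l t' , Tnot-elim (T∧-r {isSemi (lookup L a)} t')

  -- A future nesting whose semi-arc the new vertex closes becomes a 3-nesting.
  lift : Nestings.Forbidden D → Nestings.Forbidden D'
  lift (inj₁ (mkN3 i1 j1 i2 j2 i3 j3 a1 a2 a3 o1 o2 o3 o4 o5)) =
    inj₁ (mkN3 _ _ _ _ _ _ (AU a1) (AU a2) (AU a3) (↑ o1) (↑ o2) (↑ o3) (↑ o4) (↑ o5))
  lift (inj₂ (inj₁ (mkN2F i1 j1 i2 j2 f a1 a2 fx o1 o2 o3 o4))) =
    inj₂ (inj₁ (mkN2F _ _ _ _ _ (AU a1) (AU a2) (FX fx) (↑ o1) (↑ o2) (↑ o3) (↑ o4)))
  lift (inj₂ (inj₂ (inj₁ (mkFN2 a i1 j1 i2 j2 sa a1 a2 o0 o1 o2 o3)))) with T? (closes (closeU α) a)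
  ... | yes c = inj₁ (mkN3 (inject₁ a) (fromℕ n) _ _ _ _ (AUc c) (AU a1) (AU a2) (↑ o0) (↑ o1) (↑ o2) (↑ o3) (inject₁<last j1))
  ... | no c = inj₂ (inj₂ (inj₁ (mkFN2 _ _ _ _ _ (SU sa c) (AU a1) (AU a2) (↑ o0) (↑ o1) (↑ o2) (↑ o3))))
  lift (inj₂ (inj₂ (inj₂ (inj₁ (mkFNF a i1 j1 f sa a1 fx o0 o1 o2))))) with T? (closes (closeU α) a)
  ... | yes c = inj₂ (inj₁ (mkN2F (inject₁ a) (fromℕ n) _ _ _ (AUc c) (AU a1) (FX fx) (↑ o0) (↑ o1) (↑ o2) (inject₁<last j1)))
  ... | no c = inj₂ (inj₂ (inj₂ (inj₁ (mkFNF _ _ _ _ (SU sa c) (AU a1) (FX fx) (↑ o0) (↑ o1) (↑ o2)))))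
  lift (inj₂ (inj₂ (inj₂ (inj₂ (inj₁ (mkN3 i1 j1 i2 j2 i3 j3 a1 a2 a3 o1 o2 o3 o4 o5)))))) =
    inj₂ (inj₂ (inj₂ (inj₂ (inj₁ (mkN3 _ _ _ _ _ _ (AL a1) (AL a2) (AL a3) (↑ o1) (↑ o2) (↑ o3) (↑ o4) (↑ o5))))))
  lift (inj₂ (inj₂ (inj₂ (inj₂ (inj₂ (mkFN2 a i1 j1 i2 j2 sa a1 a2 o0 o1 o2 o3)))))) with T? (closes (closeL α) a)
  ... | yes c = inj₂ (inj₂ (inj₂ (inj₂ (inj₁ (mkN3 (inject₁ a) (fromℕ n) _ _ _ _ (ALc c) (AL a1) (AL a2) (↑ o0) (↑ o1) (↑ o2) (↑ o3) (inject₁<last j1))))))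
  ... | no c = inj₂ (inj₂ (inj₂ (inj₂ (inj₂ (mkFN2 _ _ _ _ _ (SL sa c) (AL a1) (AL a2) (↑ o0) (↑ o1) (↑ o2) (↑ o3))))))

  nonnesting-restrict : T (nonnesting3 D') → T (nonnesting3 D)
  nonnesting-restrict t = Nestings.nonnesting-intro D (λ b → Nestings.nonnesting-elim D' t (lift b))

  closes-just : ∀ {a} → closeU α ≡ just a → T (closes (closeU α) a)
  closes-just {a} e rewrite e = subst T (sym (closes-self a)) tt
  closesL-just : ∀ {a} → closeL α ≡ just a → T (closes (closeL α) a)
  closesL-just {a} e rewrite e = subst T (sym (closes-self a)) tt

  notclose< : ∀ {a b} (c : Maybe (Fin n)) → c ≡ just a → toℕ b < toℕ a → ¬ T (closes c b)
  notclose< c e lt t rewrite e = <-irrefl (sym (cong toℕ (==F⇒ t))) lt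

  nonnesting⇒safeCloseU : T (nonnesting3 D') → SafeCloseU R (closeU α)
  nonnesting⇒safeCloseU t a e (inj₁ (i , j , aij , ai , ij)) (b , sb , ba) =
    Nestings.nonnesting-elim D' t (inj₂ (inj₂ (inj₁ (mkFN2 (inject₁ b) (inject₁ a) (fromℕ n) (inject₁ i) (inject₁ j)
       (SU sb (notclose< (closeU α) e ba)) (AUc (closes-just e)) (AU aij) (↑ ba) (↑ ai) (↑ ij) (inject₁<last j)))))
  nonnesting⇒safeCloseU t a e (inj₂ (f , ff , af)) (b , sb , ba) =
    Nestings.nonnesting-elim D' t (inj₂ (inj₂ (inj₂ (inj₁ (mkFNF (inject₁ b) (inject₁ a) (fromℕ n) (inject₁ f)
       (SU sb (notclose< (closeU α) e ba)) (AUc (closes-just e)) (FX ff) (↑ ba) (↑ af) (inject₁<last f))))))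

  nonnesting⇒safeCloseL : T (nonnesting3 D') → SafeCloseL R (closeL α)
  nonnesting⇒safeCloseL t a e (i , j , aij , ai , ij) (b , sb , ba) =
    Nestings.nonnesting-elim D' t (inj₂ (inj₂ (inj₂ (inj₂ (inj₂ (mkFN2 (inject₁ b) (inject₁ a) (fromℕ n) (inject₁ i) (inject₁ j)
       (SL sb (notclose< (closeL α) e ba)) (ALc (closesL-just e)) (AL aij) (↑ ba) (↑ ai) (↑ ij) (inject₁<last j)))))))

  module _ (t : T (nonnesting3 D)) (cU : SafeCloseU R (closeU α)) (cL : SafeCloseL R (closeL α)) where
    -- A forbidden configuration of the extension either avoids the new vertex or ends
    -- its outer arc there; then it comes from a future nesting, or from closing a
    -- blocked semi-arc with another semi-arc to its left.
    down : Nestings.Forbidden D' → ⊥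
    down (inj₁ (mkN3 i1 j1 i2 j2 i3 j3 a1 a2 a3 o1 o2 o3 o4 o5))
      with below i1 j1 (o1 ⟫ o2 ⟫ o3 ⟫ o4 ⟫ o5) | below i2 j1 (o2 ⟫ o3 ⟫ o4 ⟫ o5) | below i3 j1 (o3 ⟫ o4 ⟫ o5)
         | below j3 j1 (o4 ⟫ o5) | below j2 j1 o5
    ... | x1 , refl | x2 , refl | x3 , refl | y3 , refl | y2 , refl with lastView j1
    ... | old y1 = Nestings.nonnesting-elim D t (inj₁ (mkN3 x1 y1 x2 y2 x3 y3 (AU⁻ a1) (AU⁻ a2) (AU⁻ a3) (↓ o1) (↓ o2) (↓ o3) (↓ o4) (↓ o5)))
    ... | new = Nestings.nonnesting-elim D t (inj₂ (inj₂ (inj₁ (mkFN2 x1 x2 y2 x3 y3 (semiU-cl x1 (AUc⁻ a1)) (AU⁻ a2) (AU⁻ a3) (↓ o1) (↓ o2) (↓ o3) (↓ o4)))))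
    down (inj₂ (inj₁ (mkN2F i1 j1 i2 j2 f a1 a2 fx o1 o2 o3 o4)))
      with below i1 j1 (o1 ⟫ o2 ⟫ o3 ⟫ o4) | below i2 j1 (o2 ⟫ o3 ⟫ o4) | below f j1 (o3 ⟫ o4) | below j2 j1 o4
    ... | x1 , refl | x2 , refl | xf , refl | y2 , refl with lastView j1
    ... | old y1 = Nestings.nonnesting-elim D t (inj₂ (inj₁ (mkN2F x1 y1 x2 y2 xf (AU⁻ a1) (AU⁻ a2) (FX⁻ fx) (↓ o1) (↓ o2) (↓ o3) (↓ o4))))
    ... | new = Nestings.nonnesting-elim D t (inj₂ (inj₂ (inj₂ (inj₁ (mkFNF x1 x2 y2 xf (semiU-cl x1 (AUc⁻ a1)) (AU⁻ a2) (FX⁻ fx) (↓ o1) (↓ o2) (↓ o3))))))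
    down (inj₂ (inj₂ (inj₁ (mkFN2 a i1 j1 i2 j2 sa a1 a2 o0 o1 o2 o3))))
      with below a j1 (o0 ⟫ o1 ⟫ o2 ⟫ o3) | below i1 j1 (o1 ⟫ o2 ⟫ o3) | below i2 j1 (o2 ⟫ o3) | below j2 j1 o3
    ... | xa , refl | x1 , refl | x2 , refl | y2 , refl with lastView j1
    ... | old y1 = Nestings.nonnesting-elim D t (inj₂ (inj₂ (inj₁ (mkFN2 xa x1 y1 x2 y2 (proj₁ (SU⁻ sa)) (AU⁻ a1) (AU⁻ a2) (↓ o0) (↓ o1) (↓ o2) (↓ o3)))))
    ... | new = cU x1 (closes-eq (closeU α) x1 (AUc⁻ a1)) (inj₁ (x2 , y2 , AU⁻ a2 , ↓ o1 , ↓ o2)) (xa , proj₁ (SU⁻ sa) , ↓ o0)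
    down (inj₂ (inj₂ (inj₂ (inj₁ (mkFNF a i1 j1 f sa a1 fx o0 o1 o2)))))
      with below a j1 (o0 ⟫ o1 ⟫ o2) | below i1 j1 (o1 ⟫ o2) | below f j1 o2
    ... | xa , refl | x1 , refl | xf , refl with lastView j1
    ... | old y1 = Nestings.nonnesting-elim D t (inj₂ (inj₂ (inj₂ (inj₁ (mkFNF xa x1 y1 xf (proj₁ (SU⁻ sa)) (AU⁻ a1) (FX⁻ fx) (↓ o0) (↓ o1) (↓ o2))))))
    ... | new = cU x1 (closes-eq (closeU α) x1 (AUc⁻ a1)) (inj₂ (xf , FX⁻ fx , ↓ o1)) (xa , proj₁ (SU⁻ sa) , ↓ o0)
    down (inj₂ (inj₂ (inj₂ (inj₂ (inj₁ (mkN3 i1 j1 i2 j2 i3 j3 a1 a2 a3 o1 o2 o3 o4 o5))))))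
      with below i1 j1 (o1 ⟫ o2 ⟫ o3 ⟫ o4 ⟫ o5) | below i2 j1 (o2 ⟫ o3 ⟫ o4 ⟫ o5) | below i3 j1 (o3 ⟫ o4 ⟫ o5)
         | below j3 j1 (o4 ⟫ o5) | below j2 j1 o5
    ... | x1 , refl | x2 , refl | x3 , refl | y3 , refl | y2 , refl with lastView j1
    ... | old y1 = Nestings.nonnesting-elim D t (inj₂ (inj₂ (inj₂ (inj₂ (inj₁ (mkN3 x1 y1 x2 y2 x3 y3 (AL⁻ a1) (AL⁻ a2) (AL⁻ a3) (↓ o1) (↓ o2) (↓ o3) (↓ o4) (↓ o5)))))))
    ... | new = Nestings.nonnesting-elim D t (inj₂ (inj₂ (inj₂ (inj₂ (inj₂ (mkFN2 x1 x2 y2 x3 y3 (semiL-cl x1 (ALc⁻ a1)) (AL⁻ a2) (AL⁻ a3) (↓ o1) (↓ o2) (↓ o3) (↓ o4)))))))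
    down (inj₂ (inj₂ (inj₂ (inj₂ (inj₂ (mkFN2 a i1 j1 i2 j2 sa a1 a2 o0 o1 o2 o3))))))
      with below a j1 (o0 ⟫ o1 ⟫ o2 ⟫ o3) | below i1 j1 (o1 ⟫ o2 ⟫ o3) | below i2 j1 (o2 ⟫ o3) | below j2 j1 o3
    ... | xa , refl | x1 , refl | x2 , refl | y2 , refl with lastView j1
    ... | old y1 = Nestings.nonnesting-elim D t (inj₂ (inj₂ (inj₂ (inj₂ (inj₂ (mkFN2 xa x1 y1 x2 y2 (proj₁ (SL⁻ sa)) (AL⁻ a1) (AL⁻ a2) (↓ o0) (↓ o1) (↓ o2) (↓ o3)))))))
    ... | new = cL x1 (closes-eq (closeL α) x1 (ALc⁻ a1)) (x2 , y2 , AL⁻ a2 , ↓ o1 , ↓ o2) (xa , proj₁ (SL⁻ sa) , ↓ o0)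

    nonnesting-extend : T (nonnesting3 D')
    nonnesting-extend = Nestings.nonnesting-intro D' down

-- Labels

semU semL : ∀ {n} → RawDiagram n → Fin n → Bool
semU R a = isSemi (lookup (proj₁ R) a)
semL R a = isSemi (lookup (proj₂ R) a)

-- The semi-arc at a lies in a future enhanced upper 2-nesting iff an upper arc or a
-- fixed point starts to its right (and similarly below), so rU and sL are r and s.
isBlockedU isBlockedL : ∀ {n} → RawDiagram n → Fin n → Bool
isBlockedU R a = exF (λ i → isArcO (lookup (proj₁ R) i) ∧ (a <F i)) ∨ exF (λ f → fixedR R f ∧ (a <F f))
isBlockedL R a = exF (λ i → isArcO (lookup (proj₂ R) i) ∧ (a <F i))

hU hL rU sL : ∀ {n} → RawDiagram n → ℕ
hU R = countFin (semU R)
hL R = countFin (semL R)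
rU R = countFin (λ a → semU R a ∧ isBlockedU R a)
sL R = countFin (λ a → semL R a ∧ isBlockedL R a)

label : ∀ {n} → RawDiagram n → Label
label R = [ hU R , rU R , sL R ]

after : ∀ {n} → Maybe (Fin n) → Fin n → Bool
after nothing b = false
after (just a) b = b <F a

isArcO-sem : ∀ {n} (x : Out n) → T (isArcO x) → Σ (Fin n) (λ j → T (isArcTo x j))
isArcO-sem (arc j) _ = j , ⇒==F j

isArcO-sem⁻ : ∀ {n} (x : Out n) j → T (isArcTo x j) → T (isArcO x)
isArcO-sem⁻ (arc c) j _ = tt

isBlockedU⇒ : ∀ {n} (R : RawDiagram n) → Right (proj₁ R) → ∀ a → T (isBlockedU R a) → BlockedU R a
isBlockedU⇒ R rt a t with T∨-elim {exF (λ i → isArcO (lookup (proj₁ R) i) ∧ (a <F i))} t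
... | inj₁ x with exF-elim _ x
... | i , y with isArcO-sem (lookup (proj₁ R) i) (T∧-l y)
... | j , z = inj₁ (i , j , z , <F⇒ (T∧-r {isArcO (lookup (proj₁ R) i)} y) , rt i j z)
isBlockedU⇒ R rt a t | inj₂ x with exF-elim _ x
... | f , y = inj₂ (f , T∧-l y , <F⇒ (T∧-r {fixedR R f} y))

⇒isBlockedU : ∀ {n} (R : RawDiagram n) a → BlockedU R a → T (isBlockedU R a)
⇒isBlockedU R a (inj₁ (i , j , z , ai , ij)) = T∨-intro₁ (exF-intro _ i (T∧-intro (isArcO-sem⁻ (lookup (proj₁ R) i) j z) (⇒<F ai)))
⇒isBlockedU R a (inj₂ (f , z , af)) = T∨-intro₂ {exF (λ i → isArcO (lookup (proj₁ R) i) ∧ (a <F i))} (exF-intro _ f (T∧-intro z (⇒<F af)))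

isBlockedL⇒ : ∀ {n} (R : RawDiagram n) → Right (proj₂ R) → ∀ a → T (isBlockedL R a) → BlockedL R a
isBlockedL⇒ R rt a x with exF-elim _ x
... | i , y with isArcO-sem (lookup (proj₂ R) i) (T∧-l y)
... | j , z = i , j , z , <F⇒ (T∧-r {isArcO (lookup (proj₂ R) i)} y) , rt i j z

⇒isBlockedL : ∀ {n} (R : RawDiagram n) a → BlockedL R a → T (isBlockedL R a)
⇒isBlockedL R a (i , j , z , ai , ij) = exF-intro _ i (T∧-intro (isArcO-sem⁻ (lookup (proj₂ R) i) j z) (⇒<F ai))

isBlockedU-downward : ∀ {n} (R : RawDiagram n) a b → toℕ a ≤ toℕ b → T (isBlockedU R b) → T (isBlockedU R a)
isBlockedU-downward R a b le t with T∨-elim {exF (λ i → isArcO (lookup (proj₁ R) i) ∧ (b <F i))} t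
... | inj₁ x with exF-elim _ x
... | i , y = T∨-intro₁ (exF-intro _ i (T∧-intro {isArcO (lookup (proj₁ R) i)} {a <F i} (T∧-l y) (⇒<F {a = a} {b = i} (≤-<-trans le (<F⇒ {a = b} {b = i} (T∧-r {isArcO (lookup (proj₁ R) i)} y))))))
isBlockedU-downward R a b le t | inj₂ x with exF-elim _ x
... | f , y = T∨-intro₂ {exF (λ i → isArcO (lookup (proj₁ R) i) ∧ (a <F i))} (exF-intro _ f (T∧-intro {fixedR R f} {a <F f} (T∧-l y) (⇒<F {a = a} {b = f} (≤-<-trans le (<F⇒ {a = b} {b = f} (T∧-r {fixedR R f} y))))))

isBlockedL-downward : ∀ {n} (R : RawDiagram n) a b → toℕ a ≤ toℕ b → T (isBlockedL R b) → T (isBlockedL R a)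
isBlockedL-downward R a b le x with exF-elim _ x
... | i , y = exF-intro _ i (T∧-intro {isArcO (lookup (proj₂ R) i)} {a <F i} (T∧-l y) (⇒<F {a = a} {b = i} (≤-<-trans le (<F⇒ {a = b} {b = i} (T∧-r {isArcO (lookup (proj₂ R) i)} y)))))

after-sem : ∀ {n} (c : Maybe (Fin n)) b i → T (closes c i) → toℕ b < toℕ i → T (after c b)
after-sem (just a) b i t lt = ⇒<F (subst (λ z → toℕ b < toℕ z) (sym (==F⇒ {a = a} {b = i} t)) lt)

after-sem⁻ : ∀ {n} (c : Maybe (Fin n)) b → T (after c b) → Σ (Fin n) λ i → T (closes c i) × toℕ b < toℕ i
after-sem⁻ (just a) b t = a , subst T (sym (closes-self a)) tt , <F⇒ t

last-not< : ∀ {n} (i : Fin (suc n)) → ¬ T (fromℕ n <F i)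
last-not< {n} i t = <⇒≱ (subst (_< toℕ i) (toℕ-fromℕ n) (<F⇒ t)) (≤-pred (toℕ<n i))

<F-inject₁⁻ : ∀ {n} (a b : Fin n) → T (inject₁ a <F inject₁ b) → T (a <F b)
<F-inject₁⁻ a b t = ⇒<F {a = a} {b = b} (↓ {a = a} {b = b} (<F⇒ {a = (inject₁ a)} {b = (inject₁ b)} t))
<F-inject₁ : ∀ {n} (a b : Fin n) → T (a <F b) → T (inject₁ a <F inject₁ b)
<F-inject₁ a b t = ⇒<F {a = (inject₁ a)} {b = (inject₁ b)} (↑ {a = a} {b = b} (<F⇒ {a = a} {b = b} t))

module ExtensionLabel {n : ℕ} (R : RawDiagram n) (α : Act n) where
  open Extension R α

  FL : Bool
  FL = fixedR R' (fromℕ n)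

  isBlockedU-last : isBlockedU R' (fromℕ n) ≡ false
  isBlockedU-last = bool-ext (λ t → ⊥-elim (go t)) (λ ())
    where
    go : T (isBlockedU R' (fromℕ n)) → ⊥
    go t with T∨-elim {exF (λ i → isArcO (lookup (proj₁ R') i) ∧ (fromℕ n <F i))} t
    ... | inj₁ x with exF-elim (λ i → isArcO (lookup (proj₁ R') i) ∧ (fromℕ n <F i)) x
    ... | i , y = last-not< i (T∧-r {isArcO (lookup (proj₁ R') i)} y)
    go t | inj₂ x with exF-elim (λ i → fixedR R' i ∧ (fromℕ n <F i)) x
    ... | i , y = last-not< i (T∧-r {fixedR R' i} y)

  isBlockedL-last : isBlockedL R' (fromℕ n) ≡ false
  isBlockedL-last = bool-ext (λ t → ⊥-elim (go t)) (λ ())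
    where
    go : T (isBlockedL R' (fromℕ n)) → ⊥
    go x with exF-elim (λ i → isArcO (lookup (proj₂ R') i) ∧ (fromℕ n <F i)) x
    ... | i , y = last-not< i (T∧-r {isArcO (lookup (proj₂ R') i)} y)

  module _ (ok : ActionFits R α) where
    isBlockedU-inject : ∀ b → isBlockedU R' (inject₁ b) ≡ (isBlockedU R b ∨ after (closeU α) b ∨ FL)
    isBlockedU-inject b = bool-ext tO fr
      where
      A' = λ i → isArcO (lookup (proj₁ R') i) ∧ (inject₁ b <F i)
      F' = λ i → fixedR R' i ∧ (inject₁ b <F i)
      A = λ i → isArcO (lookup (proj₁ R) i) ∧ (b <F i)
      F = λ i → fixedR R i ∧ (b <F i)
      tO : T (isBlockedU R' (inject₁ b)) → T (isBlockedU R b ∨ after (closeU α) b ∨ FL)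
      tO t with T∨-elim {exF A'} t
      ... | inj₁ x with exF-elim A' x
      ... | i , y with lastView i
      ... | new = ⊥-elim (subst T SU.isArcO-l (T∧-l y))
      ... | old i' with T∨-elim {closes (closeU α) i'} (subst T (SU.isArcO-i i') (T∧-l y))
      ... | inj₁ z = T∨-intro₂ {isBlockedU R b} (T∨-intro₁ {after (closeU α) b} {FL} (after-sem (closeU α) b i' z (<F⇒ {a = b} {b = i'} (<F-inject₁⁻ b i' (T∧-r {isArcO (lookup (proj₁ R') (inject₁ i'))} y)))))
      ... | inj₂ z = T∨-intro₁ {isBlockedU R b} (T∨-intro₁ {exF A} {exF F} (exF-intro A i' (T∧-intro {isArcO (lookup (proj₁ R) i')} {b <F i'} z (<F-inject₁⁻ b i' (T∧-r {isArcO (lookup (proj₁ R') (inject₁ i'))} y)))))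
      tO t | inj₂ x with exF-elim F' x
      ... | f , y with lastView f
      ... | new = T∨-intro₂ {isBlockedU R b} (T∨-intro₂ {after (closeU α) b} {FL} (T∧-l y))
      ... | old f' = T∨-intro₁ {isBlockedU R b} (T∨-intro₂ {exF A} {exF F}
                       (exF-intro F f' (T∧-intro {fixedR R f'} {b <F f'} (subst T (fixed-i ok f') (T∧-l y)) (<F-inject₁⁻ b f' (T∧-r {fixedR R' (inject₁ f')} y)))))
      fr : T (isBlockedU R b ∨ after (closeU α) b ∨ FL) → T (isBlockedU R' (inject₁ b))
      fr t with T∨-elim {isBlockedU R b} t
      ... | inj₁ u with T∨-elim {exF A} u
      ... | inj₁ x with exF-elim A x
      ... | i , y = T∨-intro₁ {exF A'} {exF F'} (exF-intro A' (inject₁ i) (T∧-intro {isArcO (lookup (proj₁ R') (inject₁ i))} {inject₁ b <F inject₁ i}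
                        (subst T (sym (SU.isArcO-i i)) (T∨-intro₂ {closes (closeU α) i} (T∧-l y))) (<F-inject₁ b i (T∧-r {isArcO (lookup (proj₁ R) i)} y))))
      fr t | inj₁ u | inj₂ x with exF-elim F x
      ... | f , y = T∨-intro₂ {exF A'} {exF F'}
                       (exF-intro F' (inject₁ f) (T∧-intro {fixedR R' (inject₁ f)} {inject₁ b <F inject₁ f} (subst T (sym (fixed-i ok f)) (T∧-l y)) (<F-inject₁ b f (T∧-r {fixedR R f} y))))
      fr t | inj₂ u with T∨-elim {after (closeU α) b} u
      ... | inj₁ z with after-sem⁻ (closeU α) b z
      ... | i , ci , bi = T∨-intro₁ {exF A'} {exF F'} (exF-intro A' (inject₁ i) (T∧-intro {isArcO (lookup (proj₁ R') (inject₁ i))} {inject₁ b <F inject₁ i}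
                        (subst T (sym (SU.isArcO-i i)) (T∨-intro₁ {closes (closeU α) i} ci)) (<F-inject₁ b i (⇒<F {a = b} {b = i} bi))))
      fr t | inj₂ u | inj₂ z = T∨-intro₂ {exF A'} {exF F'}
                       (exF-intro F' (fromℕ n) (T∧-intro {FL} {inject₁ b <F fromℕ n} z (⇒<F {a = (inject₁ b)} {b = (fromℕ n)} (inject₁<last b))))

    isBlockedL-inject : ∀ b → isBlockedL R' (inject₁ b) ≡ (isBlockedL R b ∨ after (closeL α) b)
    isBlockedL-inject b = bool-ext tO fr
      where
      A' = λ i → isArcO (lookup (proj₂ R') i) ∧ (inject₁ b <F i)
      A = λ i → isArcO (lookup (proj₂ R) i) ∧ (b <F i)
      tO : T (isBlockedL R' (inject₁ b)) → T (isBlockedL R b ∨ after (closeL α) b)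
      tO x with exF-elim A' x
      ... | i , y with lastView i
      ... | new = ⊥-elim (subst T SL.isArcO-l (T∧-l y))
      ... | old i' with T∨-elim {closes (closeL α) i'} (subst T (SL.isArcO-i i') (T∧-l y))
      ... | inj₁ z = T∨-intro₂ {isBlockedL R b} (after-sem (closeL α) b i' z (<F⇒ {a = b} {b = i'} (<F-inject₁⁻ b i' (T∧-r {isArcO (lookup (proj₂ R') (inject₁ i'))} y))))
      ... | inj₂ z = T∨-intro₁ {isBlockedL R b} (exF-intro A i' (T∧-intro {isArcO (lookup (proj₂ R) i')} {b <F i'} z (<F-inject₁⁻ b i' (T∧-r {isArcO (lookup (proj₂ R') (inject₁ i'))} y))))
      fr : T (isBlockedL R b ∨ after (closeL α) b) → T (isBlockedL R' (inject₁ b))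
      fr t with T∨-elim {isBlockedL R b} t
      ... | inj₁ x with exF-elim A x
      ... | i , y = exF-intro A' (inject₁ i) (T∧-intro {isArcO (lookup (proj₂ R') (inject₁ i))} {inject₁ b <F inject₁ i}
                        (subst T (sym (SL.isArcO-i i)) (T∨-intro₂ {closes (closeL α) i} (T∧-l y))) (<F-inject₁ b i (T∧-r {isArcO (lookup (proj₂ R) i)} y)))
      fr t | inj₂ z with after-sem⁻ (closeL α) b z
      ... | i , ci , bi = exF-intro A' (inject₁ i) (T∧-intro {isArcO (lookup (proj₂ R') (inject₁ i))} {inject₁ b <F inject₁ i}
                        (subst T (sym (SL.isArcO-i i)) (T∨-intro₁ {closes (closeL α) i} ci)) (<F-inject₁ b i (⇒<F {a = b} {b = i} bi)))

    hU-ext : hU R' ≡ countFin (λ b → semU R b ∧ not (closes (closeU α) b)) + b2n (openU α)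
    hU-ext = trans (countFin-last (semU R')) (cong₂ _+_ (countFin-cong SU.semi-i) (cong b2n SU.semi-l))

    hL-ext : hL R' ≡ countFin (λ b → semL R b ∧ not (closes (closeL α) b)) + b2n (openL α)
    hL-ext = trans (countFin-last (semL R')) (cong₂ _+_ (countFin-cong SL.semi-i) (cong b2n SL.semi-l))

    rU-ext : rU R' ≡ countFin (λ b → (semU R b ∧ not (closes (closeU α) b)) ∧ (isBlockedU R b ∨ after (closeU α) b ∨ FL))
    rU-ext = trans (countFin-last (λ a → semU R' a ∧ isBlockedU R' a))
      (trans (cong₂ _+_ (countFin-cong (λ b → cong₂ _∧_ (SU.semi-i b) (isBlockedU-inject b))) (trans (cong (λ z → b2n (semU R' (fromℕ n) ∧ z)) isBlockedU-last) (cong b2n (∧-zeroʳ _))))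
        (+-identityʳ _))

    sL-ext : sL R' ≡ countFin (λ b → (semL R b ∧ not (closes (closeL α) b)) ∧ (isBlockedL R b ∨ after (closeL α) b))
    sL-ext = trans (countFin-last (λ a → semL R' a ∧ isBlockedL R' a))
      (trans (cong₂ _+_ (countFin-cong (λ b → cong₂ _∧_ (SL.semi-i b) (isBlockedL-inject b))) (trans (cong (λ z → b2n (semL R' (fromℕ n) ∧ z)) isBlockedL-last) (cong b2n (∧-zeroʳ _))))
        (+-identityʳ _))

-- Allowed closers

count-all : ∀ m → countFin {m} (λ _ → true) ≡ m
count-all zero = refl
count-all (suc m) = cong suc (count-all m)

count-neq : ∀ i h → i < h → countFin {h} (λ j → not (toℕ j ≡ᵇ i)) ≡ h ∸ 1
count-neq zero (suc h) lt = count-all h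
count-neq (suc i) (suc (suc h)) (s≤s lt) = cong suc (count-neq i (suc h) lt)

Σ≡ : ∀ {A : Set} {P : A → Bool} {a b : A} {p : T (P a)} {q : T (P b)} → a ≡ b → _≡_ {A = Σ A (T ∘ P)} (a , p) (b , q)
Σ≡ {P = P} {a} {.a} {p} {q} refl = cong (a ,_) (T-irrelevant p q)

-- pickN r enumerates the ranks 0, r, r+1, ... (all ranks when r ≤ 1).
pickN : ℕ → ℕ → ℕ
pickN r zero = 0
pickN r (suc m) = (r ∸ 1) + suc m

unpick : ℕ → ℕ → ℕ
unpick r zero = 0
unpick r (suc i) = suc i ∸ (r ∸ 1)

-- For a predicate b that is inherited leftwards, the p-elements satisfying b are those of
-- rank below r, and the allowed ones are those of rank 0 or at least r.
module AllowedClosers {n : ℕ} (p b : Fin n → Bool) (dc : ∀ x y → toℕ x ≤ toℕ y → T (b y) → T (b x)) where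
  h r : ℕ
  h = countFin p
  r = countFin (λ a → p a ∧ b a)

  r≤h : r ≤ h
  r≤h = count-∧≤ p b

  semiBefore : Fin n → Bool
  semiBefore a = exF (λ c → p c ∧ (c <F a))

  allowed : Fin n → Bool
  allowed a = p a ∧ not (b a ∧ semiBefore a)

  q : Fin h → Bool
  q = b ∘ sel p

  qdc : DownClosed q
  qdc j k le t = dc (sel p j) (sel p k) (≮⇒≥ (λ lt → <⇒≱ (subst₂ _<_ (rank-sel p k) (rank-sel p j) (rank-mono p (sel p j) (sel p k) (sel-ok p k) lt)) le)) t

  count-q : countFin q ≡ r
  count-q = sym (count-sel p b)

  kOf : ∀ a → T (p a) → Fin h
  kOf a t = fromℕ< (rank<count p a t)

  sel-kOf : ∀ a (t : T (p a)) → sel p (kOf a t) ≡ a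
  sel-kOf a t = sel-rank p a t (kOf a t) (toℕ-fromℕ< _)

  blk→ : ∀ a → T (p a) → T (b a) → rank p a < r
  blk→ a t tb = subst₂ _<_ (toℕ-fromℕ< _) count-q (down-lt q qdc (kOf a t) (subst (T ∘ b) (sym (sel-kOf a t)) tb))

  →blk : ∀ a → T (p a) → rank p a < r → T (b a)
  →blk a t lt = subst (T ∘ b) (sel-kOf a t) (down-gt q qdc (kOf a t) (subst₂ _<_ (sym (toℕ-fromℕ< _)) (sym count-q) lt))

  sb→ : ∀ a → T (semiBefore a) → 0 < rank p a
  sb→ a t with exF-elim _ t
  ... | c , y = ≤-<-trans z≤n (rank-mono p a c (T∧-l y) (<F⇒ (T∧-r {p c} y)))

  →sb : ∀ a → T (p a) → 0 < rank p a → T (semiBefore a)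
  →sb a t lt = exF-intro _ c (T∧-intro (sel-ok p k0) (⇒<F (rank-refl< p a c t (sel-ok p k0) (subst (_< rank p a) (sym (trans (rank-sel p k0) (toℕ-fromℕ< _))) lt))))
    where
    k0 : Fin h
    k0 = fromℕ< {0} (≤-<-trans z≤n (rank<count p a t))
    c = sel p k0

  allow→ : ∀ a → T (allowed a) → (rank p a ≡ 0) ⊎ (r ≤ rank p a)
  allow→ a t with rank p a in eq
  ... | zero = inj₁ refl
  ... | suc i with <-cmp (suc i) r
  ... | tri< lt _ _ = ⊥-elim (Tnot-elim (T∧-r {p a} t) (T∧-intro (→blk a (T∧-l t) (subst (_< r) (sym eq) lt)) (→sb a (T∧-l t) (subst (0 <_) (sym eq) (s≤s z≤n)))))
  ... | tri≈ _ e _ = inj₂ (≤-reflexive (sym e))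
  ... | tri> _ _ gt = inj₂ (<⇒≤ gt)

  →allow : ∀ a → T (p a) → (rank p a ≡ 0) ⊎ (r ≤ rank p a) → T (allowed a)
  →allow a t (inj₁ e) = T∧-intro t (Tnot-intro (λ x → <-irrefl (sym e) (sb→ a (T∧-r {b a} x))))
  →allow a t (inj₂ le) = T∧-intro t (Tnot-intro (λ x → <⇒≱ (blk→ a t (T∧-l x)) le))

  Index : Set
  Index = Fin (h ∸ (r ∸ 1))

  pick-bound : ∀ m → m < h ∸ (r ∸ 1) → pickN r m < h
  pick-bound zero lt = ≤-<-trans z≤n (<-≤-trans lt (m∸n≤m h (r ∸ 1)))
  pick-bound (suc m) lt = <-≤-trans (+-monoʳ-< (r ∸ 1) lt) (≤-reflexive (m+[n∸m]≡n (≤-trans (m∸n≤m r 1) r≤h)))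

  r∸1<h : 0 < h → r ∸ 1 < h
  r∸1<h lt with r | r≤h
  ... | zero | _ = lt
  ... | suc r' | le = le

  unpick-bound : ∀ i → i < h → (i ≡ 0) ⊎ (r ≤ i) → unpick r i < h ∸ (r ∸ 1)
  unpick-bound zero lt _ = m<n⇒0<n∸m (r∸1<h lt)
  unpick-bound (suc i) lt (inj₁ ())
  unpick-bound (suc i) lt (inj₂ le) = ∸-monoˡ-< lt (≤-trans (m∸n≤m r 1) le)

  pick-suc : ∀ m → r ≤ pickN r (suc m)
  pick-suc m = ≤-trans (lem r) (≤-reflexive (sym (+-suc (r ∸ 1) m)))
    where lem : ∀ x → x ≤ suc ((x ∸ 1) + m)
          lem zero = z≤n
          lem (suc x) = s≤s (m≤m+n x m)

  pick-ok : ∀ m → (pickN r m ≡ 0) ⊎ (r ≤ pickN r m)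
  pick-ok zero = inj₁ refl
  pick-ok (suc m) = inj₂ (pick-suc m)

  unpick-pick : ∀ m → unpick r (pickN r m) ≡ m
  unpick-pick zero = refl
  unpick-pick (suc m) rewrite +-suc (r ∸ 1) m = trans (cong (_∸ (r ∸ 1)) (sym (+-suc (r ∸ 1) m))) (m+n∸m≡n (r ∸ 1) (suc m))

  r∸1≤ : ∀ i → r ≤ suc i → r ∸ 1 ≤ i
  r∸1≤ i le = lem r i le
    where lem : ∀ x i → x ≤ suc i → x ∸ 1 ≤ i
          lem zero i _ = z≤n
          lem (suc x) i l = ≤-pred l

  pick-unpick : ∀ i → (i ≡ 0) ⊎ (r ≤ i) → pickN r (unpick r i) ≡ i
  pick-unpick zero _ = refl
  pick-unpick (suc i) (inj₂ le) rewrite +-∸-assoc 1 (r∸1≤ i le) | +-suc (r ∸ 1) (i ∸ (r ∸ 1)) = cong suc (m+[n∸m]≡n (r∸1≤ i le))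

  Allowed : Set
  Allowed = Σ (Fin n) (T ∘ allowed)

  semiIndex : Index → Fin h
  semiIndex k = fromℕ< (pick-bound (toℕ k) (toℕ<n k))

  rank-semiIndex : ∀ k → rank p (sel p (semiIndex k)) ≡ pickN r (toℕ k)
  rank-semiIndex k = trans (rank-sel p (semiIndex k)) (toℕ-fromℕ< _)

  allowedAt : Index → Allowed
  allowedAt k = sel p (semiIndex k) , →allow (sel p (semiIndex k)) (sel-ok p (semiIndex k)) (subst (λ z → (z ≡ 0) ⊎ (r ≤ z)) (sym (rank-semiIndex k)) (pick-ok (toℕ k)))

  indexOf : Allowed → Index
  indexOf (a , t) = fromℕ< (unpick-bound (rank p a) (rank<count p a (T∧-l t)) (allow→ a t))

  Index↔Allowed : Index ↔ Allowed
  Index↔Allowed = mk↔ₛ′ allowedAt indexOf to∘from from∘to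
    where
    to∘from : ∀ x → allowedAt (indexOf x) ≡ x
    to∘from (a , t) = Σ≡ {P = allowed} (sel-rank p a (T∧-l t) _ (trans (toℕ-fromℕ< _) (trans (cong (pickN r) (toℕ-fromℕ< (unpick-bound (rank p a) (rank<count p a (T∧-l t)) (allow→ a t)))) (pick-unpick (rank p a) (allow→ a t)))))
    from∘to : ∀ k → indexOf (allowedAt k) ≡ k
    from∘to k = toℕ-injective (trans (toℕ-fromℕ< _) (trans (cong (unpick r) (rank-semiIndex k)) (unpick-pick (toℕ k))))

  ==F-sel : ∀ a → T (p a) → ∀ j → (a ==F sel p j) ≡ (toℕ j ≡ᵇ rank p a)
  ==F-sel a t j = bool-ext f g
    where
    f : T (a ==F sel p j) → T (toℕ j ≡ᵇ rank p a)
    f x = ≡⇒≡ᵇ (toℕ j) (rank p a) (trans (sym (rank-sel p j)) (cong (rank p) (sym (==F⇒ x))))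
    g : T (toℕ j ≡ᵇ rank p a) → T (a ==F sel p j)
    g x = subst (λ z → T (a ==F z)) (sym (rank-inj p a (sel p j) t (sel-ok p j) (trans (rank-sel p j) (≡ᵇ⇒≡ _ _ x)))) (⇒==F a)

  b-sel : ∀ j → b (sel p j) ≡ (toℕ j <ᵇ r)
  b-sel j = bool-ext (λ x → <⇒<ᵇ (subst (_< r) (rank-sel p j) (blk→ (sel p j) (sel-ok p j) x)))
                     (λ x → →blk (sel p j) (sel-ok p j) (subst (_< r) (sym (rank-sel p j)) (<ᵇ⇒< _ _ x)))

  lt-sel : ∀ a → T (p a) → ∀ j → (sel p j <F a) ≡ (toℕ j <ᵇ rank p a)
  lt-sel a t j = bool-ext (λ x → <⇒<ᵇ (subst (_< rank p a) (rank-sel p j) (rank-mono p a (sel p j) (sel-ok p j) (<F⇒ x))))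
                          (λ x → ⇒<F (rank-refl< p a (sel p j) t (sel-ok p j) (subst (_< rank p a) (sym (rank-sel p j)) (<ᵇ⇒< _ _ x))))

  hcount : ∀ a → T (p a) → countFin (λ c → p c ∧ not (a ==F c)) ≡ h ∸ 1
  hcount a t = trans (count-sel p (λ c → not (a ==F c))) (trans (countFin-cong (λ j → cong not (==F-sel a t j))) (count-neq (rank p a) h (rank<count p a t)))

  g-eq : ∀ i m → r ≤ i → (not (m ≡ᵇ i) ∧ ((m <ᵇ r) ∨ (m <ᵇ i))) ≡ (m <ᵇ i)
  g-eq i m le = bool-ext f g
    where
    f : _ → _
    f x with T∨-elim {m <ᵇ r} (T∧-r {not (m ≡ᵇ i)} x)
    ... | inj₁ y = <⇒<ᵇ (<-≤-trans (<ᵇ⇒< m r y) le)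
    ... | inj₂ y = y
    g : _ → _
    g x = T∧-intro (Tnot-intro (λ e → <-irrefl (≡ᵇ⇒≡ m i e) (<ᵇ⇒< m i x))) (T∨-intro₂ {m <ᵇ r} x)

  rcount : ∀ k → countFin (λ c → (p c ∧ not (proj₁ (allowedAt k) ==F c)) ∧ (b c ∨ (c <F proj₁ (allowedAt k)))) ≡ (r ∸ 1) + toℕ k
  rcount k = trans (countFin-cong (λ c → ∧-assoc (p c) _ _))
             (trans (count-sel p (λ c → not (a ==F c) ∧ (b c ∨ (c <F a))))
             (trans (countFin-cong {h} (λ j → cong₂ (λ x y → not x ∧ y) (==F-sel a ta j) (cong₂ _∨_ (b-sel j) (lt-sel a ta j))))
             (subst (λ i → countFin {h} (λ j → not (toℕ j ≡ᵇ i) ∧ ((toℕ j <ᵇ r) ∨ (toℕ j <ᵇ i))) ≡ (r ∸ 1) + toℕ k) (sym (rank-semiIndex k)) (semiBalance-step (toℕ k) (toℕ<n k)))))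
    where
    a = proj₁ (allowedAt k)
    ta = sel-ok p (semiIndex k)
    semiBalance-step : ∀ m → m < h ∸ (r ∸ 1) → countFin {h} (λ j → not (toℕ j ≡ᵇ pickN r m) ∧ ((toℕ j <ᵇ r) ∨ (toℕ j <ᵇ pickN r m))) ≡ (r ∸ 1) + m
    semiBalance-step zero lt = trans (countFin-cong {h} (λ j → cong (not (toℕ j ≡ᵇ 0) ∧_) (∨-identityʳ (toℕ j <ᵇ r)))) (trans (count-lt-nz r h r≤h) (sym (+-identityʳ _)))
    semiBalance-step (suc m) lt = trans (countFin-cong {h} (λ j → g-eq (pickN r (suc m)) (toℕ j) (pick-suc m))) (count-lt _ h (<⇒≤ (pick-bound (suc m) lt)))

module AllowedU {n : ℕ} (R : RawDiagram n) = AllowedClosers (semU R) (isBlockedU R) (isBlockedU-downward R)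
module AllowedL {n : ℕ} (R : RawDiagram n) = AllowedClosers (semL R) (isBlockedL R) (isBlockedL-downward R)

-- Children correspond to extensions

closableU : ∀ {n} → RawDiagram n → Maybe (Fin n) → Bool
closableU R nothing = true
closableU R (just a) = AllowedU.allowed R a

closableL : ∀ {n} → RawDiagram n → Maybe (Fin n) → Bool
closableL R nothing = true
closableL R (just a) = AllowedL.allowed R a

isGoodAction : ∀ {n} → RawDiagram n → Act n → Bool
isGoodAction R α = actionTypeOK α ∧ (closableU R (closeU α) ∧ closableL R (closeL α))

GoodAction : ∀ {n} → RawDiagram n → Set
GoodAction R = Σ (Act _) (λ α → T (isGoodAction R α))

isSemi-eq : ∀ {n} (x : Out n) → T (isSemi x) → x ≡ semi
isSemi-eq semi _ = refl

okc-of : ∀ {n} (V : Vec (Out n) n) (c : Maybe (Fin n)) → (∀ a → c ≡ just a → T (isSemi (lookup V a))) → ClosesSemi V c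
okc-of V c f a t = isSemi-eq _ (f a (closes-eq c a t))

closableU⇒closesSemi : ∀ {n} (R : RawDiagram n) c → T (closableU R c) → ClosesSemi (proj₁ R) c
closableU⇒closesSemi R c g = okc-of (proj₁ R) c (λ { a refl → T∧-l g })
closableL⇒closesSemi : ∀ {n} (R : RawDiagram n) c → T (closableL R c) → ClosesSemi (proj₂ R) c
closableL⇒closesSemi R c g = okc-of (proj₂ R) c (λ { a refl → T∧-l g })

SemiBefore⇒ : ∀ {n} (V : Vec (Out n) n) a → SemiBefore V a → T (exF (λ c → isSemi (lookup V c) ∧ (c <F a)))
SemiBefore⇒ V a (b , s , lt) = exF-intro _ b (T∧-intro s (⇒<F lt))

closableU⇒safe : ∀ {n} (R : RawDiagram n) c → T (closableU R c) → SafeCloseU R c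
closableU⇒safe R .(just a) g a refl bl sbf = Tnot-elim (T∧-r {semU R a} g) (T∧-intro (⇒isBlockedU R a bl) (SemiBefore⇒ (proj₁ R) a sbf))
closableL⇒safe : ∀ {n} (R : RawDiagram n) c → T (closableL R c) → SafeCloseL R c
closableL⇒safe R .(just a) g a refl bl sbf = Tnot-elim (T∧-r {semL R a} g) (T∧-intro (⇒isBlockedL R a bl) (SemiBefore⇒ (proj₂ R) a sbf))

semi-closes : ∀ {n} (V : Vec (Out n) n) c a → ClosesSemi V c → c ≡ just a → T (isSemi (lookup V a))
semi-closes V c a ok e rewrite ok a (subst (λ z → T (closes z a)) (sym e) (subst T (sym (closes-self a)) tt)) = tt

⇒SemiBefore : ∀ {n} (V : Vec (Out n) n) a → T (exF (λ c → isSemi (lookup V c) ∧ (c <F a))) → SemiBefore V a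
⇒SemiBefore V a t with exF-elim _ t
... | b , y = b , T∧-l y , <F⇒ (T∧-r {isSemi (lookup V b)} y)

safe⇒closableU : ∀ {n} (R : RawDiagram n) c → Right (proj₁ R) → ClosesSemi (proj₁ R) c → SafeCloseU R c → T (closableU R c)
safe⇒closableU R nothing rt ok cnd = tt
safe⇒closableU R (just a) rt ok cnd = T∧-intro (semi-closes (proj₁ R) (just a) a ok refl)
  (Tnot-intro (λ x → cnd a refl (isBlockedU⇒ R rt a (T∧-l x)) (⇒SemiBefore (proj₁ R) a (T∧-r {isBlockedU R a} x))))

safe⇒closableL : ∀ {n} (R : RawDiagram n) c → Right (proj₂ R) → ClosesSemi (proj₂ R) c → SafeCloseL R c → T (closableL R c)
safe⇒closableL R nothing rt ok cnd = tt
safe⇒closableL R (just a) rt ok cnd = T∧-intro (semi-closes (proj₂ R) (just a) a ok refl)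
  (Tnot-intro (λ x → cnd a refl (isBlockedL⇒ R rt a (T∧-l x)) (⇒SemiBefore (proj₂ R) a (T∧-r {isBlockedL R a} x))))

Nonnesting : ∀ {n} → RawDiagram n → Set
Nonnesting R = T (nonnesting3 (rawArcData R))

Sigma2-≡ : ∀ {n} {R1 R2 : RawDiagram n} → R1 ≡ R2 → {v1 : T (validDiagram R1)} {v2 : T (validDiagram R2)} {w1 : Nonnesting R1} {w2 : Nonnesting R2} →
     _≡_ {A = Sigma2 n} ((R1 , v1) , w1) ((R2 , v2) , w2)
Sigma2-≡ {R1 = R1} refl {v1} {v2} {w1} {w2} rewrite T-irrelevant v1 v2 | T-irrelevant w1 w2 = refl

DiagramWithAction : ℕ → Set
DiagramWithAction n = Σ (Sigma2 n) (λ d → GoodAction (proj₁ (proj₁ d)))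

DiagramWithAction-≡ : ∀ {n} {R1 R2 : RawDiagram n} → R1 ≡ R2 → {v1 : T (validDiagram R1)} {v2 : T (validDiagram R2)} {w1 : Nonnesting R1} {w2 : Nonnesting R2} →
     ∀ {α1 α2} → α1 ≡ α2 → {g1 : T (isGoodAction R1 α1)} {g2 : T (isGoodAction R2 α2)} →
     _≡_ {A = DiagramWithAction n} (((R1 , v1) , w1) , (α1 , g1)) (((R2 , v2) , w2) , (α2 , g2))
DiagramWithAction-≡ refl {v1} {v2} {w1} {w2} refl {g1} {g2} rewrite T-irrelevant v1 v2 | T-irrelevant w1 w2 | T-irrelevant g1 g2 = refl

module LastVertex (n : ℕ) where
  extendWith : DiagramWithAction n → Sigma2 (suc n)
  extendWith (((R , v) , w) , (α , g)) = (extend R α , ExtensionValidity.valid← R α ok v ty) , ExtensionNesting.nonnesting-extend R α ok w (closableU⇒safe R (closeU α) gu) (closableL⇒safe R (closeL α) gl)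
    where
    ty = T∧-l g
    gu = T∧-l (T∧-r {actionTypeOK α} g)
    gl = T∧-r {closableU R (closeU α)} (T∧-r {actionTypeOK α} g)
    ok = closableU⇒closesSemi R (closeU α) gu , closableL⇒closesSemi R (closeL α) gl

  splitLast : Sigma2 (suc n) → DiagramWithAction n
  splitLast ((R' , v') , w') = ((R , proj₁ vv) , ExtensionNesting.nonnesting-restrict R α ok w'') , (α , T∧-intro (proj₂ vv) (T∧-intro gu gl))
    where
    R = restrict R'
    α = lastAction R'
    e = extend-restrict R' v'
    ok = actionFits-restrict R'
    v'' : T (validDiagram (extend R α))
    v'' = subst (λ z → T (validDiagram z)) (sym e) v'
    w'' : Nonnesting (extend R α)
    w'' = subst Nonnesting (sym e) w'
    vv = ExtensionValidity.valid→ R α ok v''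
    gu = safe⇒closableU R (closeU α) (Validity.rightU R (proj₁ vv)) (proj₁ ok) (ExtensionNesting.nonnesting⇒safeCloseU R α ok w'')
    gl = safe⇒closableL R (closeL α) (Validity.rightL R (proj₁ vv)) (proj₂ ok) (ExtensionNesting.nonnesting⇒safeCloseL R α ok w'')

  lastVertex↔ : DiagramWithAction n ↔ Sigma2 (suc n)
  lastVertex↔ = mk↔ₛ′ extendWith splitLast to∘from from∘to
    where
    to∘from : ∀ x → extendWith (splitLast x) ≡ x
    to∘from ((R' , v') , w') = Sigma2-≡ (extend-restrict R' v')
    from∘to : ∀ y → splitLast (extendWith y) ≡ y
    from∘to (((R , v) , w) , (α , g)) = DiagramWithAction-≡ (restrict-extend R α (closableU⇒closesSemi R (closeU α) gu , closableL⇒closesSemi R (closeL α) gl)) (lastAction-extend R α)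
      where
      gu = T∧-l (T∧-r {actionTypeOK α} g)
      gl = T∧-r {closableU R (closeU α)} (T∧-r {actionTypeOK α} g)

Shape : ∀ {n} → RawDiagram n → Set
Shape R = ⊤ ⊎ (⊤ ⊎ (AllowedU.Allowed R ⊎ (AllowedL.Allowed R ⊎ (AllowedU.Allowed R × AllowedL.Allowed R))))

shapeAction : ∀ {n} (R : RawDiagram n) → Shape R → GoodAction R
shapeAction R (inj₁ _) = act nothing nothing false false , tt
shapeAction R (inj₂ (inj₁ _)) = act nothing nothing true true , tt
shapeAction R (inj₂ (inj₂ (inj₁ (a , t)))) = act (just a) nothing true false , T∧-intro t tt
shapeAction R (inj₂ (inj₂ (inj₂ (inj₁ (b , t))))) = act nothing (just b) false true , t
shapeAction R (inj₂ (inj₂ (inj₂ (inj₂ ((a , t) , (b , t')))))) = act (just a) (just b) false false , T∧-intro t t'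

actionShape : ∀ {n} (R : RawDiagram n) → GoodAction R → Shape R
actionShape R (act nothing nothing false false , g) = inj₁ tt
actionShape R (act nothing nothing true true , g) = inj₂ (inj₁ tt)
actionShape R (act (just a) nothing true false , g) = inj₂ (inj₂ (inj₁ (a , T∧-l g)))
actionShape R (act nothing (just b) false true , g) = inj₂ (inj₂ (inj₂ (inj₁ (b , g))))
actionShape R (act (just a) (just b) false false , g) = inj₂ (inj₂ (inj₂ (inj₂ ((a , T∧-l g) , (b , T∧-r {AllowedU.allowed R a} g)))))
actionShape R (act nothing nothing false true , ())
actionShape R (act nothing nothing true false , ())
actionShape R (act nothing (just b) false false , ())
actionShape R (act nothing (just b) true false , ())
actionShape R (act nothing (just b) true true , ())
actionShape R (act (just a) nothing false false , ())
actionShape R (act (just a) nothing false true , ())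
actionShape R (act (just a) nothing true true , ())
actionShape R (act (just a) (just b) false true , ())
actionShape R (act (just a) (just b) true false , ())
actionShape R (act (just a) (just b) true true , ())

GoodAction-≡ : ∀ {n} {R : RawDiagram n} {α : Act n} {g g' : T (isGoodAction R α)} → _≡_ {A = GoodAction R} (α , g) (α , g')
GoodAction-≡ {g = g} {g'} = cong (_ ,_) (T-irrelevant g g')

shape↔goodAction : ∀ {n} (R : RawDiagram n) → Shape R ↔ GoodAction R
shape↔goodAction R = mk↔ₛ′ (shapeAction R) (actionShape R) to∘from from∘to
  where
  to∘from : ∀ x → shapeAction R (actionShape R x) ≡ x
  to∘from (act nothing nothing false false , g) = GoodAction-≡
  to∘from (act nothing nothing true true , g) = GoodAction-≡
  to∘from (act (just a) nothing true false , g) = GoodAction-≡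
  to∘from (act nothing (just b) false true , g) = GoodAction-≡
  to∘from (act (just a) (just b) false false , g) = GoodAction-≡
  to∘from (act nothing nothing false true , ())
  to∘from (act nothing nothing true false , ())
  to∘from (act nothing (just b) false false , ())
  to∘from (act nothing (just b) true false , ())
  to∘from (act nothing (just b) true true , ())
  to∘from (act (just a) nothing false false , ())
  to∘from (act (just a) nothing false true , ())
  to∘from (act (just a) nothing true true , ())
  to∘from (act (just a) (just b) false true , ())
  to∘from (act (just a) (just b) true false , ())
  to∘from (act (just a) (just b) true true , ())
  from∘to : ∀ y → actionShape R (shapeAction R y) ≡ y
  from∘to (inj₁ _) = refl
  from∘to (inj₂ (inj₁ _)) = refl
  from∘to (inj₂ (inj₂ (inj₁ (a , t)))) = cong (λ z → inj₂ (inj₂ (inj₁ (a , z)))) (T-irrelevant _ t)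
  from∘to (inj₂ (inj₂ (inj₂ (inj₁ (b , t))))) = refl
  from∘to (inj₂ (inj₂ (inj₂ (inj₂ ((a , t) , (b , t')))))) = cong₂ (λ z z' → inj₂ (inj₂ (inj₂ (inj₂ ((a , z) , (b , z')))))) (T-irrelevant _ t) (T-irrelevant _ t')

castIso : ∀ {m m'} → m ≡ m' → Fin m ↔ Fin m'
castIso refl = ↔-refl

castIso-toℕ : ∀ {m m'} (e : m ≡ m') k → toℕ (to (castIso e) k) ≡ toℕ k
castIso-toℕ refl k = refl

module ChildActions {n : ℕ} (R : RawDiagram n) (balanced : hL R ≡ hU R) where
  eL : Fin (hU R ∸ (sL R ∸ 1)) ↔ Fin (hL R ∸ (sL R ∸ 1))
  eL = castIso (cong (_∸ (sL R ∸ 1)) (sym balanced))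
  KL : Fin (hU R ∸ (sL R ∸ 1)) ↔ AllowedL.Allowed R
  KL = ↔-trans eL (AllowedL.Index↔Allowed R)

  child↔shape : Child (label R) ↔ Shape R
  child↔shape = ↔-refl ⊎-↔ ↔-refl ⊎-↔ AllowedU.Index↔Allowed R ⊎-↔ KL ⊎-↔ (AllowedU.Index↔Allowed R ×-↔ KL)

  child↔goodAction : Child (label R) ↔ GoodAction R
  child↔goodAction = ↔-trans child↔shape (shape↔goodAction R)

-- Labels of the extensions

label≡ : ∀ {n} (R' : RawDiagram n) {x y z} → hU R' ≡ x → rU R' ≡ y → sL R' ≡ z → label R' ≡ [ x , y , z ]
label≡ R' refl refl refl = refl

semi∧blocked-fixedPoint : ∀ x y z → z ≡ true → (x ∧ true) ∧ (y ∨ false ∨ z) ≡ x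
semi∧blocked-fixedPoint x y .true refl = trans (cong₂ _∧_ (∧-identityʳ x) (∨-zeroʳ y)) (∧-identityʳ x)

semi∧blocked-unchanged : ∀ x y z → z ≡ false → (x ∧ true) ∧ (y ∨ false ∨ z) ≡ x ∧ y
semi∧blocked-unchanged x y .false refl = cong₂ _∧_ (∧-identityʳ x) (∨-identityʳ y)

semi∧blockedL-unchanged : ∀ x y → (x ∧ true) ∧ (y ∨ false) ≡ x ∧ y
semi∧blockedL-unchanged x y = cong₂ _∧_ (∧-identityʳ x) (∨-identityʳ y)

semi∧blocked-closing : ∀ x y w v z → z ≡ false → (x ∧ v) ∧ (y ∨ w ∨ z) ≡ (x ∧ v) ∧ (y ∨ w)
semi∧blocked-closing x y w v .false refl = cong (λ u → (x ∧ v) ∧ (y ∨ u)) (∨-identityʳ w)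

h-1+1 : ∀ h → 0 < h → (h ∸ 1) + 1 ≡ h
h-1+1 (suc h) _ = +-comm h 1

module ChildLabels {n : ℕ} (R : RawDiagram n) (balanced : hL R ≡ hU R) where
  open ChildActions R balanced
  open ExtensionLabel using (hU-ext; rU-ext; sL-ext)

  closerU : Fin (hU R ∸ (rU R ∸ 1)) → Fin n
  closerU k = proj₁ (AllowedU.allowedAt R k)

  closerL : Fin (hU R ∸ (sL R ∸ 1)) → Fin n
  closerL k' = proj₁ (to KL k')

  hU-unclosed : ∀ cl ou ol (ok : ActionFits R (act nothing cl ou ol)) → hU (extend R (act nothing cl ou ol)) ≡ hU R + b2n ou
  hU-unclosed cl ou ol ok = trans (hU-ext R (act nothing cl ou ol) ok) (cong (_+ _) (countFin-cong (λ b → ∧-identityʳ (semU R b))))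

  hU-closing : ∀ k cl ou ol (ok : ActionFits R (act (just (closerU k)) cl ou ol)) →
               hU (extend R (act (just (closerU k)) cl ou ol)) ≡ (hU R ∸ 1) + b2n ou
  hU-closing k cl ou ol ok = trans (hU-ext R (act (just (closerU k)) cl ou ol) ok) (cong (_+ _) (AllowedU.hcount R (closerU k) (T∧-l (proj₂ (AllowedU.allowedAt R k)))))

  rU-fixedPoint : (ok : ActionFits R (act nothing nothing false false)) → rU (extend R (act nothing nothing false false)) ≡ hU R
  rU-fixedPoint ok = trans (rU-ext R α ok) (countFin-cong (λ b → semi∧blocked-fixedPoint (semU R b) (isBlockedU R b) _ (Extension.fixed-l R α)))
    where α = act nothing nothing false false

  rU-unclosed : ∀ cl ou ol (ok : ActionFits R (act nothing cl ou ol)) → fixedR (extend R (act nothing cl ou ol)) (fromℕ n) ≡ false →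
                rU (extend R (act nothing cl ou ol)) ≡ rU R
  rU-unclosed cl ou ol ok notFixed = trans (rU-ext R (act nothing cl ou ol) ok) (countFin-cong (λ b → semi∧blocked-unchanged (semU R b) (isBlockedU R b) _ notFixed))

  rU-closing : ∀ k cl ou ol (ok : ActionFits R (act (just (closerU k)) cl ou ol)) → fixedR (extend R (act (just (closerU k)) cl ou ol)) (fromℕ n) ≡ false →
               rU (extend R (act (just (closerU k)) cl ou ol)) ≡ (rU R ∸ 1) + toℕ k
  rU-closing k cl ou ol ok notFixed = trans (rU-ext R (act (just (closerU k)) cl ou ol) ok)
    (trans (countFin-cong (λ b → semi∧blocked-closing (semU R b) (isBlockedU R b) (b <F closerU k) (not (closerU k ==F b)) _ notFixed))
           (AllowedU.rcount R k))

  sL-unclosed : ∀ cu ou ol (ok : ActionFits R (act cu nothing ou ol)) → sL (extend R (act cu nothing ou ol)) ≡ sL R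
  sL-unclosed cu ou ol ok = trans (sL-ext R (act cu nothing ou ol) ok) (countFin-cong (λ b → semi∧blockedL-unchanged (semL R b) (isBlockedL R b)))

  sL-closing : ∀ k' cu ou ol (ok : ActionFits R (act cu (just (closerL k')) ou ol)) → sL (extend R (act cu (just (closerL k')) ou ol)) ≡ (sL R ∸ 1) + toℕ k'
  sL-closing k' cu ou ol ok = trans (sL-ext R (act cu (just (closerL k')) ou ol) ok)
    (trans (AllowedL.rcount R (to eL k')) (cong ((sL R ∸ 1) +_) (castIso-toℕ (cong (_∸ (sL R ∸ 1)) (sym balanced)) k')))

  label-child : ∀ x → label (extend R (proj₁ (to child↔goodAction x))) ≡ childLabel (label R) x
  label-child (inj₁ _) =
    label≡ (extend R α) (trans (hU-unclosed nothing false false ok) (+-identityʳ _)) (rU-fixedPoint ok) (sL-unclosed nothing false false ok)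
    where α = act nothing nothing false false
          ok : ActionFits R α
          ok = closableU⇒closesSemi R nothing tt , closableL⇒closesSemi R nothing tt
  label-child (inj₂ (inj₁ _)) =
    label≡ (extend R α) (trans (hU-unclosed nothing true true ok) (+-comm _ 1))
      (rU-unclosed nothing true true ok (Extension.fixed-l R α)) (sL-unclosed nothing true true ok)
    where α = act nothing nothing true true
          ok : ActionFits R α
          ok = closableU⇒closesSemi R nothing tt , closableL⇒closesSemi R nothing tt
  label-child (inj₂ (inj₂ (inj₁ k))) =
    label≡ (extend R α) (trans (hU-closing k nothing true false ok) (h-1+1 (hU R) (≤-<-trans z≤n (rank<count (semU R) (closerU k) (T∧-l t)))))
      (rU-closing k nothing true false ok (Extension.fixed-l R α)) (sL-unclosed (just (closerU k)) true false ok)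
    where t = proj₂ (AllowedU.allowedAt R k)
          α = act (just (closerU k)) nothing true false
          ok : ActionFits R α
          ok = closableU⇒closesSemi R (just (closerU k)) t , closableL⇒closesSemi R nothing tt
  label-child (inj₂ (inj₂ (inj₂ (inj₁ k')))) =
    label≡ (extend R α) (trans (hU-unclosed (just (closerL k')) false true ok) (+-identityʳ _))
      (rU-unclosed (just (closerL k')) false true ok (Extension.fixed-l R α)) (sL-closing k' nothing false true ok)
    where α = act nothing (just (closerL k')) false true
          ok : ActionFits R α
          ok = closableU⇒closesSemi R nothing tt , closableL⇒closesSemi R (just (closerL k')) (proj₂ (to KL k'))
  label-child (inj₂ (inj₂ (inj₂ (inj₂ (k , k'))))) =
    label≡ (extend R α) (trans (hU-closing k (just (closerL k')) false false ok) (+-identityʳ _))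
      (rU-closing k (just (closerL k')) false false ok (Extension.fixed-l R α)) (sL-closing k' (just (closerU k)) false false ok)
    where α = act (just (closerU k)) (just (closerL k')) false false
          ok : ActionFits R α
          ok = closableU⇒closesSemi R (just (closerU k)) (proj₂ (AllowedU.allowedAt R k)) ,
               closableL⇒closesSemi R (just (closerL k')) (proj₂ (to KL k'))

-- The generating tree enumerates Σ⁽²⁾

count-semis-closing : ∀ {n} (V : Vec (Out n) n) (c : Maybe (Fin n)) → ClosesSemi V c →
           countFin (λ b → isSemi (lookup V b) ∧ not (closes c b)) ≡ countFin (λ b → isSemi (lookup V b)) ∸ b2n (is-just c)
count-semis-closing {n} V nothing ok = countFin-cong {n} (λ b → ∧-identityʳ (isSemi (lookup V b)))
count-semis-closing V (just a) ok = AllowedClosers.hcount (λ b → isSemi (lookup V b)) (λ _ → false) (λ _ _ _ t → t) a (semi-closes V (just a) a ok refl)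

closed≤semis : ∀ {n} (V : Vec (Out n) n) (c : Maybe (Fin n)) → ClosesSemi V c → b2n (is-just c) ≤ countFin (λ b → isSemi (lookup V b))
closed≤semis V nothing ok = z≤n
closed≤semis V (just a) ok = ≤-trans (s≤s z≤n) (rank<count _ a (semi-closes V (just a) a ok refl))

-- Each vertex type changes the numbers of upper and of lower semi-arcs equally.
semiBalance-step : ∀ closeU closeL openU openL x y → T (vertexType openU openL closeU closeL) → x ≡ y → b2n closeU ≤ y → b2n closeL ≤ x →
        (x ∸ b2n closeL) + b2n openL ≡ (y ∸ b2n closeU) + b2n openU
semiBalance-step false false false false x .x _ refl _ _ = refl
semiBalance-step false false true true x .x _ refl _ _ = refl
semiBalance-step true false true false (suc x) .(suc x) _ refl _ _ = trans (cong suc (+-identityʳ x)) (sym (+-comm x 1))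
semiBalance-step false true false true (suc x) .(suc x) _ refl _ _ = trans (+-comm x 1) (cong suc (sym (+-identityʳ x)))
semiBalance-step true true false false x .x _ refl _ _ = refl
semiBalance-step false false false true x y () e p q
semiBalance-step false false true false x y () e p q
semiBalance-step false true false false x y () e p q
semiBalance-step false true true false x y () e p q
semiBalance-step false true true true x y () e p q
semiBalance-step true false false false x y () e p q
semiBalance-step true false false true x y () e p q
semiBalance-step true false true true x y () e p q
semiBalance-step true true false true x y () e p q
semiBalance-step true true true false x y () e p q
semiBalance-step true true true true x y () e p q

hL≡hU : ∀ n (R : RawDiagram n) → T (validDiagram R) → hL R ≡ hU R
hL≡hU zero R v = refl
hL≡hU (suc n) R' v' = subst (λ z → hL z ≡ hU z) e goal
  where
  R = restrict R'
  α = lastAction R'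
  e = extend-restrict R' v'
  ok = actionFits-restrict R'
  v'' : T (validDiagram (extend R α))
  v'' = subst (λ z → T (validDiagram z)) (sym e) v'
  vv = ExtensionValidity.valid→ R α ok v''
  ih = hL≡hU n R (proj₁ vv)
  goal : hL (extend R α) ≡ hU (extend R α)
  goal = trans (ExtensionLabel.hL-ext R α ok) (trans (cong (_+ b2n (openL α)) (count-semis-closing (proj₂ R) (closeL α) (proj₂ ok)))
         (trans (semiBalance-step (is-just (closeU α)) (is-just (closeL α)) (openU α) (openL α) (hL R) (hU R) (proj₂ vv) ih
                   (closed≤semis (proj₁ R) (closeU α) (proj₁ ok)) (closed≤semis (proj₂ R) (closeL α) (proj₂ ok)))
         (sym (trans (ExtensionLabel.hU-ext R α ok) (cong (_+ b2n (openU α)) (count-semis-closing (proj₁ R) (closeU α) (proj₁ ok)))))))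

labelOf : ∀ {n} → Sigma2 n → Label
labelOf d = label (proj₁ (proj₁ d))

emptyDiagram : Sigma2 0
emptyDiagram = (([] , []) , tt) , tt

levelEnumeration : ∀ n → Enumerates (level n) (Sigma2 n) labelOf
levelEnumeration zero = mkE (mk↔ₛ′ (λ _ → emptyDiagram) (λ _ → zero) to∘from from∘to) (λ { zero → refl })
  where
  to∘from : ∀ d → emptyDiagram ≡ d
  to∘from (((([] , []) , v) , w)) = Sigma2-≡ refl
  from∘to : ∀ i → zero ≡ i
  from∘to zero = refl
levelEnumeration (suc n) = E-transfer e compat (E-level n (levelEnumeration n))
  where
  e : Σ (Sigma2 n) (Child ∘ labelOf) ↔ Sigma2 (suc n)
  e = ↔-trans (Σ-↔ ↔-refl (λ {d} → ChildActions.child↔goodAction (proj₁ (proj₁ d)) (hL≡hU n (proj₁ (proj₁ d)) (proj₂ (proj₁ d))))) (LastVertex.lastVertex↔ n)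
  compat : ∀ x → labelOf (to e x) ≡ childLabel (labelOf (proj₁ x)) (proj₂ x)
  compat (d , c) = ChildLabels.label-child (proj₁ (proj₁ d)) (hL≡hU n (proj₁ (proj₁ d)) (proj₂ (proj₁ d))) c

-- Permutations

<F-true : ∀ {n} {a b : Fin n} → toℕ a < toℕ b → (a <F b) ≡ true
<F-true {a = a} {b} p with a <F b in e
... | true = refl
... | false = ⊥-elim (subst T e (⇒<F p))

<F-false : ∀ {n} {a b : Fin n} → ¬ (toℕ a < toℕ b) → (a <F b) ≡ false
<F-false {a = a} {b} p with a <F b in e
... | true = ⊥-elim (p (<F⇒ (subst T (sym e) tt)))
... | false = refl

==F-true : ∀ {n} {a b : Fin n} → a ≡ b → (a ==F b) ≡ true
==F-true {a = a} refl with a ==F a in e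
... | true = refl
... | false = ⊥-elim (subst T e (⇒==F a))

==F-false' : ∀ {n} {a b : Fin n} → ¬ (a ≡ b) → (a ==F b) ≡ false
==F-false' {a = a} {b} p with a ==F b in e
... | true = ⊥-elim (p (==F⇒ (subst T (sym e) tt)))
... | false = refl

module PermutationDiagram {n : ℕ} (σv : Vec (Fin n) n) (inj : T (injectiveᵇ σv)) where
  σ : Fin n → Fin n
  σ = lookup σv

  σ-inj : ∀ i j → σ i ≡ σ j → i ≡ j
  σ-inj i j e with T∨-elim {i ==F j} (allF-elim _ (allF-elim _ inj i) j)
  ... | inj₁ x = ==F⇒ x
  ... | inj₂ x = ⊥-elim (Tnot-elim x (subst (λ z → T (σ i ==F z)) e (⇒==F (σ i))))

  surj : ∀ a → Σ (Fin n) (λ i → σ i ≡ a)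
  surj a with findF (λ i → σ i ==F a) in e
  ... | just i = i , ==F⇒ (findF-sound _ i e)
  ... | nothing = ⊥-elim (go n a σ σ-inj (λ i x → findF-none _ e i (subst (λ z → T (σ i ==F z)) x (⇒==F (σ i)))))
    where
    go : ∀ m (a : Fin m) (f : Fin m → Fin m) → (∀ i j → f i ≡ f j → i ≡ j) → (∀ i → ¬ f i ≡ a) → ⊥
    go (suc m) a f fi na = <-irrefl refl (injective⇒≤ {f = g} (λ {x} {y} e' → fi x y (punchOut-injective {i = a} (λ e'' → na x (sym e'')) (λ e'' → na y (sym e'')) e')))
      where g : Fin (suc m) → Fin m
            g i = punchOut {i = a} {j = f i} (λ e' → na i (sym e'))

  τ : Fin n → Fin n
  τ a = proj₁ (surj a)
  τ-ok : ∀ a → σ (τ a) ≡ a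
  τ-ok a = proj₂ (surj a)
  τ-uniq : ∀ a b → σ b ≡ a → b ≡ τ a
  τ-uniq a b e = σ-inj b (τ a) (trans e (sym (τ-ok a)))

  Ue : Fin n → Out n
  Ue a = if a <F σ a then arc (σ a) else none

  preL : Fin n → Maybe (Fin n)
  preL a = findF (λ b → (a <F b) ∧ (σ b ==F a))

  Le : Fin n → Out n
  Le a = resOm' (preL a)
    where resOm' : Maybe (Fin n) → Out n
          resOm' (just b) = arc b
          resOm' nothing = none

  D : RawDiagram n
  D = tabulate Ue , tabulate Le

  lkU : ∀ a → lookup (proj₁ D) a ≡ Ue a
  lkU = lookup∘tabulate Ue
  lkL : ∀ a → lookup (proj₂ D) a ≡ Le a
  lkL = lookup∘tabulate Le

  preL-spec : ∀ a → preL a ≡ (if a <F τ a then just (τ a) else nothing)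
  preL-spec a with a <F τ a in e
  ... | true = findF-complete _ (τ a) (T∧-intro (subst T (sym e) tt) (subst (λ z → T (z ==F a)) (sym (τ-ok a)) (⇒==F a)))
                 (λ b t → τ-uniq a b (==F⇒ (T∧-r {a <F b} t)))
  ... | false with findF (λ b → (a <F b) ∧ (σ b ==F a)) in e2
  ... | nothing = refl
  ... | just b = ⊥-elim (subst T e (subst (λ z → T (a <F z)) (τ-uniq a b (==F⇒ (T∧-r {a <F b} t))) (T∧-l t)))
    where t = findF-sound _ b e2

  Ue-spec : ∀ a → (lookup (proj₁ D) a ≡ arc (σ a) × toℕ a < toℕ (σ a)) ⊎ (lookup (proj₁ D) a ≡ none × ¬ (toℕ a < toℕ (σ a)))
  Ue-spec a rewrite lkU a with a <F σ a in e
  ... | true = inj₁ (refl , <F⇒ (subst T (sym e) tt))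
  ... | false = inj₂ (refl , λ p → subst T e (⇒<F p))

  Le-spec : ∀ a → (lookup (proj₂ D) a ≡ arc (τ a) × toℕ a < toℕ (τ a)) ⊎ (lookup (proj₂ D) a ≡ none × ¬ (toℕ a < toℕ (τ a)))
  Le-spec a rewrite lkL a with a <F τ a in e
  ... | true rewrite preL-spec a | e = inj₁ (refl , <F⇒ (subst T (sym e) tt))
  ... | false rewrite preL-spec a | e = inj₂ (refl , λ p → subst T e (⇒<F p))

  outU≡ : ∀ a → hasOut (lookup (proj₁ D) a) ≡ (a <F σ a)
  outU≡ a with Ue-spec a
  ... | inj₁ (e , p) rewrite e = sym (<F-true p)
  ... | inj₂ (e , p) rewrite e = sym (<F-false p)

  outL≡ : ∀ a → hasOut (lookup (proj₂ D) a) ≡ (a <F τ a)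
  outL≡ a with Le-spec a
  ... | inj₁ (e , p) rewrite e = sym (<F-true p)
  ... | inj₂ (e , p) rewrite e = sym (<F-false p)

  semU≡ : ∀ a → isSemi (lookup (proj₁ D) a) ≡ false
  semU≡ a with Ue-spec a
  ... | inj₁ (e , p) rewrite e = refl
  ... | inj₂ (e , p) rewrite e = refl

  semL≡ : ∀ a → isSemi (lookup (proj₂ D) a) ≡ false
  semL≡ a with Le-spec a
  ... | inj₁ (e , p) rewrite e = refl
  ... | inj₂ (e , p) rewrite e = refl

  arcU≡ : ∀ a b → isArcTo (lookup (proj₁ D) a) b ≡ (a <F b) ∧ (σ a ==F b)
  arcU≡ a b with Ue-spec a
  ... | inj₁ (e , p) rewrite e = bool-ext (λ t → T∧-intro (subst (λ z → T (a <F z)) (==F⇒ {a = σ a} {b = b} t) (⇒<F p)) t) (T∧-r {a <F b})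
  ... | inj₂ (e , p) rewrite e = bool-ext (λ ()) (λ t → p (subst (λ z → toℕ a < toℕ z) (sym (==F⇒ (T∧-r {a <F b} t))) (<F⇒ (T∧-l t))))

  arcL≡ : ∀ a b → isArcTo (lookup (proj₂ D) a) b ≡ (a <F b) ∧ (σ b ==F a)
  arcL≡ a b with Le-spec a
  ... | inj₁ (e , p) rewrite e = bool-ext
          (λ t → let eb = ==F⇒ {a = τ a} {b = b} t in T∧-intro (subst (λ z → T (a <F z)) eb (⇒<F p)) (subst (λ z → T (σ z ==F a)) eb (subst (λ z → T (z ==F a)) (sym (τ-ok a)) (⇒==F a))))
          (λ t → subst (λ z → T (τ a ==F z)) (sym (τ-uniq a b (==F⇒ (T∧-r {a <F b} t)))) (⇒==F (τ a)))
  ... | inj₂ (e , p) rewrite e = bool-ext (λ ()) (λ t → p (subst (λ z → toℕ a < toℕ z) (τ-uniq a b (==F⇒ (T∧-r {a <F b} t))) (<F⇒ (T∧-l t))))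

  inU≡ : ∀ a → exF (λ c → isArcTo (lookup (proj₁ D) c) a) ≡ (τ a <F a)
  inU≡ a = bool-ext f g
    where
    f : _ → _
    f t with exF-elim _ t
    ... | c , y = let y' = subst T (arcU≡ c a) y in subst (λ z → T (z <F a)) (τ-uniq a c (==F⇒ (T∧-r {c <F a} y'))) (T∧-l y')
    g : _ → _
    g t = exF-intro _ (τ a) (subst T (sym (arcU≡ (τ a) a)) (T∧-intro t (subst (λ z → T (z ==F a)) (sym (τ-ok a)) (⇒==F a))))

  inL≡ : ∀ a → exF (λ c → isArcTo (lookup (proj₂ D) c) a) ≡ (σ a <F a)
  inL≡ a = bool-ext f g
    where
    f : _ → _
    f t with exF-elim _ t
    ... | c , y = let y' = subst T (arcL≡ c a) y in subst (λ z → T (z <F a)) (sym (==F⇒ (T∧-r {c <F a} y'))) (T∧-l y')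
    g : _ → _
    g t = exF-intro _ (σ a) (subst T (sym (arcL≡ (σ a) a)) (T∧-intro t (⇒==F (σ a))))

  fixed≡ : ∀ a → fixedR D a ≡ (σ a ==F a)
  fixed≡ a rewrite outU≡ a | outL≡ a | inU≡ a | inL≡ a with <-cmpᶠ a (σ a)
  ... | tri≈ _ e _ rewrite sym e | sym (τ-uniq a a (sym e)) | <F-false (<-irrefl (refl {x = toℕ a})) | ==F-true (refl {x = a}) = refl
  ... | tri< p _ _ rewrite <F-true p | ==F-false' {a = σ a} {b = a} (λ e → <-irrefl (cong toℕ (sym e)) p) = refl
  ... | tri> _ _ p rewrite <F-false (<⇒≱ p ∘ <⇒≤) | <F-true p | ==F-false' {a = σ a} {b = a} (λ e → <-irrefl (cong toℕ e) p) with a <F τ a | τ a <F a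
  ... | true | _ = refl
  ... | false | true = refl
  ... | false | false = refl

  vok : ∀ a → T (vertexOK D a)
  vok a rewrite outU≡ a | outL≡ a | inU≡ a | inL≡ a with <-cmpᶠ a (σ a)
  ... | tri≈ _ e _ rewrite sym e | sym (τ-uniq a a (sym e)) | <F-false (<-irrefl (refl {x = toℕ a})) = tt
  ... | tri< p _ _ rewrite <F-true p | <F-false (<⇒≱ p ∘ <⇒≤) with <-cmpᶠ a (τ a)
  ...   | tri< q _ _ rewrite <F-true q | <F-false (<⇒≱ q ∘ <⇒≤) = tt
  ...   | tri> _ _ q rewrite <F-true q | <F-false (<⇒≱ q ∘ <⇒≤) = tt
  ...   | tri≈ _ q _ = ⊥-elim (<-irrefl (cong toℕ (sym (trans (cong σ q) (τ-ok a)))) p)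
  vok a | tri> _ _ p rewrite <F-true p | <F-false (<⇒≱ p ∘ <⇒≤) with <-cmpᶠ a (τ a)
  ...   | tri< q _ _ rewrite <F-true q | <F-false (<⇒≱ q ∘ <⇒≤) = tt
  ...   | tri> _ _ q rewrite <F-true q | <F-false (<⇒≱ q ∘ <⇒≤) = tt
  ...   | tri≈ _ q _ = ⊥-elim (<-irrefl (cong toℕ (trans (cong σ q) (τ-ok a))) p)

  arcsD : T (arcsOK D)
  arcsD = allF-intro _ (λ a → allF-intro _ (λ b → go a b))
    where
    go : ∀ a b → T (not (arcUR D a b ∨ arcLR D a b) ∨ (a <F b))
    go a b with a <F b in e
    ... | true = T∨-intro₂ {not (arcUR D a b ∨ arcLR D a b)} tt
    ... | false rewrite arcU≡ a b | arcL≡ a b | e = tt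

  inD : T (inOK D)
  inD = allF-intro _ (λ b → T∧-intro (≤⇒≤ᵇ (subst (_≤ 1) (sym (count≡ (λ a → arcUR D a b))) (count-uniq≤1 _ (uU b))))
                                       (≤⇒≤ᵇ (subst (_≤ 1) (sym (count≡ (λ a → arcLR D a b))) (count-uniq≤1 _ (uL b)))))
    where
    uU : ∀ b a a' → T (arcUR D a b) → T (arcUR D a' b) → a ≡ a'
    uU b a a' t t' = σ-inj a a' (trans (==F⇒ (T∧-r {a <F b} (subst T (arcU≡ a b) t))) (sym (==F⇒ (T∧-r {a' <F b} (subst T (arcU≡ a' b) t')))))
    uL : ∀ b a a' → T (arcLR D a b) → T (arcLR D a' b) → a ≡ a'
    uL b a a' t t' = trans (sym (==F⇒ {a = σ b} {b = a} (T∧-r {a <F b} (subst T (arcL≡ a b) t)))) (==F⇒ {a = σ b} {b = a'} (T∧-r {a' <F b} (subst T (arcL≡ a' b) t')))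

  validD : T (validDiagram D)
  validD = T∧-intro arcsD (T∧-intro inD (allF-intro _ vok))

record SameArcs {n : ℕ} (D1 D2 : ArcData n) : Set where
  field
    eU : ∀ a b → ArcData.arcU D1 a b ≡ ArcData.arcU D2 a b
    eSU : ∀ a → ArcData.semiU D1 a ≡ ArcData.semiU D2 a
    eL : ∀ a b → ArcData.arcL D1 a b ≡ ArcData.arcL D2 a b
    eSL : ∀ a → ArcData.semiL D1 a ≡ ArcData.semiL D2 a
    eF : ∀ a → ArcData.fixed D1 a ≡ ArcData.fixed D2 a

module _ {n : ℕ} {D1 D2 : ArcData n} (E : SameArcs D1 D2) where
  open SameArcs E
  private
    tU = λ {a} {b} → subst T (eU a b)
    tL = λ {a} {b} → subst T (eL a b)
    tS = λ {a} → subst T (eSU a)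
    tSL = λ {a} → subst T (eSL a)
    tF = λ {a} → subst T (eF a)
  forbidden-transport : Nestings.Forbidden D1 → Nestings.Forbidden D2
  forbidden-transport (inj₁ (mkN3 i1 j1 i2 j2 i3 j3 a1 a2 a3 o1 o2 o3 o4 o5)) = inj₁ (mkN3 i1 j1 i2 j2 i3 j3 (tU a1) (tU a2) (tU a3) o1 o2 o3 o4 o5)
  forbidden-transport (inj₂ (inj₁ (mkN2F i1 j1 i2 j2 f a1 a2 fx o1 o2 o3 o4))) = inj₂ (inj₁ (mkN2F i1 j1 i2 j2 f (tU a1) (tU a2) (tF fx) o1 o2 o3 o4))
  forbidden-transport (inj₂ (inj₂ (inj₁ (mkFN2 a i1 j1 i2 j2 sa a1 a2 o0 o1 o2 o3)))) = inj₂ (inj₂ (inj₁ (mkFN2 a i1 j1 i2 j2 (tS sa) (tU a1) (tU a2) o0 o1 o2 o3)))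
  forbidden-transport (inj₂ (inj₂ (inj₂ (inj₁ (mkFNF a i1 j1 f sa a1 fx o0 o1 o2))))) = inj₂ (inj₂ (inj₂ (inj₁ (mkFNF a i1 j1 f (tS sa) (tU a1) (tF fx) o0 o1 o2))))
  forbidden-transport (inj₂ (inj₂ (inj₂ (inj₂ (inj₁ (mkN3 i1 j1 i2 j2 i3 j3 a1 a2 a3 o1 o2 o3 o4 o5)))))) = inj₂ (inj₂ (inj₂ (inj₂ (inj₁ (mkN3 i1 j1 i2 j2 i3 j3 (tL a1) (tL a2) (tL a3) o1 o2 o3 o4 o5)))))
  forbidden-transport (inj₂ (inj₂ (inj₂ (inj₂ (inj₂ (mkFN2 a i1 j1 i2 j2 sa a1 a2 o0 o1 o2 o3)))))) = inj₂ (inj₂ (inj₂ (inj₂ (inj₂ (mkFN2 a i1 j1 i2 j2 (tSL sa) (tL a1) (tL a2) o0 o1 o2 o3)))))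

SameArcs-sym : ∀ {n} {D1 D2 : ArcData n} → SameArcs D1 D2 → SameArcs D2 D1
SameArcs-sym E = record { eU = λ a b → sym (eU a b) ; eSU = λ a → sym (eSU a) ; eL = λ a b → sym (eL a b) ; eSL = λ a → sym (eSL a) ; eF = λ a → sym (eF a) }
  where open SameArcs E

nonnesting3-cong : ∀ {n} {D1 D2 : ArcData n} → SameArcs D1 D2 → nonnesting3 D1 ≡ nonnesting3 D2
nonnesting3-cong {D1 = D1} {D2} E = bool-ext (λ t → Nestings.nonnesting-intro D2 (λ b → Nestings.nonnesting-elim D1 t (forbidden-transport (SameArcs-sym E) b)))
                                    (λ t → Nestings.nonnesting-intro D1 (λ b → Nestings.nonnesting-elim D2 t (forbidden-transport E b)))

permutationDiagram-sameArcs : ∀ {n} (σv : Vec (Fin n) n) (inj : T (injectiveᵇ σv)) → SameArcs (rawArcData (PermutationDiagram.D σv inj)) (permArcData σv)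
permutationDiagram-sameArcs σv inj = record { eU = arcU≡ ; eSU = semU≡ ; eL = arcL≡ ; eSL = semL≡ ; eF = fixed≡ }
  where open PermutationDiagram σv inj

¬inL∧outU : ∀ oU oL iU iL → T (vertexType oU oL iU iL) → T iL → T oU → ⊥
¬inL∧outU true true true true () _ _
¬inL∧outU true true false true () _ _
¬inL∧outU true false true true () _ _
¬inL∧outU true false false true () _ _

¬outL∧inU : ∀ oU oL iU iL → T (vertexType oU oL iU iL) → T oL → T iU → ⊥
¬outL∧inU true true true true () _ _
¬outL∧inU true true true false () _ _
¬outL∧inU false true true true () _ _
¬outL∧inU false true true false () _ _

fixed-if-¬outU∧¬inL : ∀ oU oL iU iL → T (vertexType oU oL iU iL) → ¬ T oU → ¬ T iL → ¬ T iU × ¬ T oL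
fixed-if-¬outU∧¬inL false false false false t _ _ = (λ ()) , (λ ())
fixed-if-¬outU∧¬inL true oL iU iL t ¬oU _ = ⊥-elim (¬oU tt)
fixed-if-¬outU∧¬inL false oL iU true t _ ni = ⊥-elim (ni tt)
fixed-if-¬outU∧¬inL false true true false () _ _
fixed-if-¬outU∧¬inL false true false false () _ _
fixed-if-¬outU∧¬inL false false true false () _ _

-- A valid diagram without semi-arcs is the diagram of σ, where σ a is the end of the
-- upper arc from a, else the start of the lower arc ending at a, else a itself.
module DiagramPermutation {n : ℕ} (R : RawDiagram n) (v : T (validDiagram R))
          (nsU : ∀ a → ¬ T (isSemi (lookup (proj₁ R) a))) (nsL : ∀ a → ¬ T (isSemi (lookup (proj₂ R) a))) where
  U L : Vec (Out n) n
  U = proj₁ R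
  L = proj₂ R
  open Validity R v

  vt : ∀ a → T (vertexType (outU R a) (outL R a) (inU R a) (inL R a))
  vt a = allF-elim _ vV a

  srcL : Fin n → Maybe (Fin n)
  srcL a = findF (λ c → isArcTo (lookup L c) a)
  srcU : Fin n → Maybe (Fin n)
  srcU a = findF (λ c → isArcTo (lookup U c) a)

  sgM : Out n → Maybe (Fin n) → Fin n → Fin n
  sgM (arc b) m a = b
  sgM none (just c) a = c
  sgM none nothing a = a
  sgM semi m a = a

  sg : Fin n → Fin n
  sg a = sgM (lookup U a) (srcL a) a

  τM : Maybe (Fin n) → Out n → Fin n → Fin n
  τM (just c) o a = c
  τM nothing (arc b) a = b
  τM nothing none a = a
  τM nothing semi a = a

  τR : Fin n → Fin n
  τR a = τM (srcU a) (lookup L a) a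

  srcU-just : ∀ a c → T (isArcTo (lookup U c) a) → srcU a ≡ just c
  srcU-just a c t = findF-complete _ c t (λ c' t' → uniqU c' c a t' t)
  srcL-just : ∀ a c → T (isArcTo (lookup L c) a) → srcL a ≡ just c
  srcL-just a c t = findF-complete _ c t (λ c' t' → uniqL c' c a t' t)
  srcU-none : ∀ a → ¬ T (inU R a) → srcU a ≡ nothing
  srcU-none a ni with srcU a in e
  ... | nothing = refl
  ... | just c = ⊥-elim (ni (exF-intro _ c (findF-sound _ c e)))
  srcL-none : ∀ a → ¬ T (inL R a) → srcL a ≡ nothing
  srcL-none a ni with srcL a in e
  ... | nothing = refl
  ... | just c = ⊥-elim (ni (exF-intro _ c (findF-sound _ c e)))
  srcL-sound : ∀ a c → srcL a ≡ just c → T (isArcTo (lookup L c) a)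
  srcL-sound a c e = findF-sound _ c e

  arcT : ∀ b → T (isArcTo (arc {n} b) b)
  arcT b = ⇒==F b

  τ-sg : ∀ a → τR (sg a) ≡ a
  τ-sg a with lookup U a in eU
  ... | semi = ⊥-elim (nsU a (subst (T ∘ isSemi) (sym eU) tt))
  ... | arc b rewrite srcU-just b a (subst (λ z → T (isArcTo z b)) (sym eU) (arcT b)) = refl
  ... | none with srcL a in eL
  ... | just c = goal
    where
    tc : T (isArcTo (lookup L c) a)
    tc = srcL-sound a c eL
    outLc : T (outL R c)
    outLc = subst (T ∘ hasOut) (sym (isArcTo-eq _ a tc)) tt
    goal : τM (srcU c) (lookup L c) c ≡ a
    goal = trans (cong (λ m → τM m (lookup L c) c) (srcU-none c (λ iu → ¬outL∧inU (outU R c) (outL R c) (inU R c) (inL R c) (vt c) outLc iu))) (hp (lookup L c) (isArcTo-eq _ a tc))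
      where hp : ∀ o → o ≡ arc a → τM nothing o c ≡ a
            hp .(arc a) refl = refl
  ... | nothing = goal
    where
    nU : ¬ T (outU R a)
    nU t = subst (T ∘ hasOut) eU t
    nL : ¬ T (inL R a)
    nL t with exF-elim _ t
    ... | c , y with () ← trans (sym (srcL-just a c y)) eL
    ff = fixed-if-¬outU∧¬inL (outU R a) (outL R a) (inU R a) (inL R a) (vt a) nU nL
    goal : τM (srcU a) (lookup L a) a ≡ a
    goal rewrite srcU-none a (proj₁ ff) with lookup L a in eL2
    ... | none = refl
    ... | semi = refl
    ... | arc b = ⊥-elim (proj₂ ff (subst (T ∘ hasOut) (sym eL2) tt))

  sg-inj : ∀ i j → sg i ≡ sg j → i ≡ j
  sg-inj i j e = trans (sym (τ-sg i)) (trans (cong τR e) (τ-sg j))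

  σv : Vec (Fin n) n
  σv = tabulate sg

  lkσ : ∀ a → lookup σv a ≡ sg a
  lkσ = lookup∘tabulate sg

  injσ : T (injectiveᵇ σv)
  injσ = allF-intro _ (λ i → allF-intro _ (λ j → go i j))
    where
    go : ∀ i j → T ((i ==F j) ∨ not (lookup σv i ==F lookup σv j))
    go i j with i ==F j in e
    ... | true = tt
    ... | false = Tnot-intro (λ t → subst T e (subst (λ z → T (i ==F z)) (sg-inj i j (trans (sym (lkσ i)) (trans (==F⇒ t) (lkσ j)))) (⇒==F i)))

  module Q = PermutationDiagram σv injσ

  σ≡ : ∀ a → Q.σ a ≡ sg a
  σ≡ = lkσ

  rtU : ∀ a → lookup (proj₁ Q.D) a ≡ lookup U a
  rtU a with lookup U a in eU | Q.Ue-spec a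
  ... | semi | _ = ⊥-elim (nsU a (subst (T ∘ isSemi) (sym eU) tt))
  ... | arc b | inj₁ (e , p) = trans e (cong arc (trans (σ≡ a) (cong (λ o → sgM o (srcL a) a) eU)))
  ... | arc b | inj₂ (e , p) = ⊥-elim (p (subst (λ z → toℕ a < toℕ z) (sym (trans (σ≡ a) (cong (λ o → sgM o (srcL a) a) eU))) (rightU a b (subst (λ z → T (isArcTo z b)) (sym eU) (arcT b)))))
  ... | none | inj₂ (e , p) = e
  ... | none | inj₁ (e , p) = ⊥-elim (noLt (subst (λ z → toℕ a < toℕ z) (σ≡ a) p))
    where
    noLt : ¬ (toℕ a < toℕ (sg a))
    noLt with srcL a in eL
    ... | nothing rewrite eU = <-irrefl refl
    ... | just c rewrite eU = λ q → <-asym q (rightL c a (srcL-sound a c eL))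

  rtL : ∀ a → lookup (proj₂ Q.D) a ≡ lookup L a
  rtL a with lookup L a in eL | Q.Le-spec a
  ... | semi | _ = ⊥-elim (nsL a (subst (T ∘ isSemi) (sym eL) tt))
  ... | arc b | inj₁ (e , p) = trans e (cong arc (sym tb))
    where
    tl : T (isArcTo (lookup L a) b)
    tl = subst (λ z → T (isArcTo z b)) (sym eL) (arcT b)
    inLb : T (inL R b)
    inLb = exF-intro _ a tl
    sgb : sg b ≡ a
    sgb with lookup U b in eUb
    ... | arc x = ⊥-elim (¬inL∧outU (outU R b) (outL R b) (inU R b) (inL R b) (vt b) inLb (subst (T ∘ hasOut) (sym eUb) tt))
    ... | semi = ⊥-elim (nsU b (subst (T ∘ isSemi) (sym eUb) tt))
    ... | none rewrite srcL-just b a tl = refl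
    tb : b ≡ Q.τ a
    tb = Q.τ-uniq a b (trans (σ≡ b) sgb)
  ... | arc b | inj₂ (e , p) = ⊥-elim (p (subst (λ z → toℕ a < toℕ z) tb (rightL a b tl)))
    where
    tl : T (isArcTo (lookup L a) b)
    tl = subst (λ z → T (isArcTo z b)) (sym eL) (arcT b)
    inLb : T (inL R b)
    inLb = exF-intro _ a tl
    sgb : sg b ≡ a
    sgb with lookup U b in eUb
    ... | arc x = ⊥-elim (¬inL∧outU (outU R b) (outL R b) (inU R b) (inL R b) (vt b) inLb (subst (T ∘ hasOut) (sym eUb) tt))
    ... | semi = ⊥-elim (nsU b (subst (T ∘ isSemi) (sym eUb) tt))
    ... | none rewrite srcL-just b a tl = refl
    tb : b ≡ Q.τ a
    tb = Q.τ-uniq a b (trans (σ≡ b) sgb)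
  ... | none | inj₂ (e , p) = e
  ... | none | inj₁ (e , p) = ⊥-elim (contra (Q.τ a) (trans (sym (σ≡ (Q.τ a))) (Q.τ-ok a)) p)
    where
    contra : ∀ b → sg b ≡ a → toℕ a < toℕ b → ⊥
    contra b sgb ab with lookup U b in eUb
    ... | semi = nsU b (subst (T ∘ isSemi) (sym eUb) tt)
    ... | arc x = <-asym ab (subst (λ z → toℕ b < toℕ z) sgb (rightU b x (subst (λ z → T (isArcTo z x)) (sym eUb) (arcT x))))
    ... | none with srcL b in eS
    ... | nothing = <-irrefl (cong toℕ (sym sgb)) ab
    ... | just c = jn' (trans (sym eL) (trans (cong (lookup L) (sym sgb)) (isArcTo-eq _ b (srcL-sound b c eS))))
      where jn' : ¬ (none ≡ arc b)
            jn' ()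

  diagram-of-σ : Q.D ≡ R
  diagram-of-σ = cong₂ _,_ (vec-ext rtU) (vec-ext rtL)

module PermutationRoundTrip {n : ℕ} (σv' : Vec (Fin n) n) (inj' : T (injectiveᵇ σv')) where
  open PermutationDiagram σv' inj'
  nsU : ∀ a → ¬ T (isSemi (lookup (proj₁ D) a))
  nsU a t = subst T (semU≡ a) t
  nsL : ∀ a → ¬ T (isSemi (lookup (proj₂ D) a))
  nsL a t = subst T (semL≡ a) t
  module W = DiagramPermutation D validD nsU nsL

  goal : ∀ a → W.sg a ≡ σ a
  goal a with Ue-spec a
  ... | inj₁ (e , p) rewrite e = refl
  ... | inj₂ (e , p) rewrite e with <-cmpᶠ (σ a) a
  ... | tri< q _ _ rewrite W.srcL-just a (σ a) (subst T (sym (arcL≡ (σ a) a)) (T∧-intro (⇒<F q) (⇒==F (σ a)))) = refl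
  ... | tri≈ _ e' _ rewrite W.srcL-none a (λ t → subst T (<F-false (<-irrefl (cong toℕ e'))) (subst T (inL≡ a) t)) = sym e'
  ... | tri> _ _ q = ⊥-elim (p q)

  σ-of-diagram : W.σv ≡ σv'
  σ-of-diagram = vec-ext (λ a → trans (W.lkσ a) (goal a))

-- Root labels

Fin-b2n+↔⊎ : ∀ b m → Fin (b2n b + m) ↔ (T b ⊎ Fin m)
Fin-b2n+↔⊎ true m = mk↔ₛ′ (λ { zero → inj₁ tt ; (suc i) → inj₂ i }) (λ { (inj₁ _) → zero ; (inj₂ i) → suc i })
                  (λ { (inj₁ _) → refl ; (inj₂ i) → refl }) (λ { zero → refl ; (suc i) → refl })
Fin-b2n+↔⊎ false m = mk↔ₛ′ inj₂ (λ { (inj₂ i) → i ; (inj₁ ()) }) (λ { (inj₂ i) → refl ; (inj₁ ()) }) (λ _ → refl)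

filter↔ : ∀ {A : Set} (p : A → Bool) (xs : List A) → Fin (length (filterᵇ p xs)) ↔ Σ (Fin (length xs)) (λ i → T (p (lookupL xs i)))
filter↔ p [] = mk↔ₛ′ (λ ()) (λ { (() , _) }) (λ { (() , _) }) (λ ())
filter↔ p (x ∷ xs) = ↔-trans (castIso (length-filter-∷ p x xs)) (↔-trans (Fin-b2n+↔⊎ (p x) _) (↔-trans (↔-refl ⊎-↔ filter↔ p xs)
                       (⊎↔ΣFinSuc (λ i → T (p (lookupL (x ∷ xs) i))))))

T-↔ : ∀ {a b} → a ≡ b → T a ↔ T b
T-↔ refl = ↔-refl

RootDiagram : ℕ → Set
RootDiagram n = Σ (Sigma2 n) (λ d → T (isRoot (labelOf d)))

rootLabelled↔rootDiagrams : ∀ n → Fin (rootLabelledAtLevel n) ↔ RootDiagram n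
rootLabelled↔rootDiagrams n = ↔-trans (filter↔ isRoot (level n)) (↔-trans (Σ-↔ ↔-refl (λ {i} → T-↔ (cong isRoot (sym (eLab (levelEnumeration n) i)))))
               (Σ-↔ (eIso (levelEnumeration n)) ↔-refl))

root⇒hU≡0 : ∀ {n} (R : RawDiagram n) → T (isRoot (label R)) → hU R ≡ 0
root⇒hU≡0 R t = ≡ᵇ⇒≡ (hU R) 0 (T∧-l t)

module RootPermutation {n : ℕ} (R : RawDiagram n) (v : T (validDiagram R)) (t : T (isRoot (label R))) where
  hU≡0 : hU R ≡ 0
  hU≡0 = root⇒hU≡0 R t

  module W = DiagramPermutation R v (count≡0⇒none (semU R) hU≡0) (count≡0⇒none (semL R) (trans (hL≡hU n R v) hU≡0))

label-permutationDiagram : ∀ {n} (σv : Vec (Fin n) n) (inj : T (injectiveᵇ σv)) → label (PermutationDiagram.D σv inj) ≡ [ 0 , 0 , 0 ]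
label-permutationDiagram σv inj = label≡ (PermutationDiagram.D σv inj) (count-none _ (λ a x → subst T (PermutationDiagram.semU≡ σv inj a) x))
                                  (count-none _ (λ a x → subst T (PermutationDiagram.semU≡ σv inj a) (T∧-l x)))
                                  (count-none _ (λ a x → subst T (PermutationDiagram.semL≡ σv inj a) (T∧-l x)))

RootDiagram-≡ : ∀ {n} {R1 R2 : RawDiagram n} → R1 ≡ R2 → ∀ {v1 w1 t1 v2 w2 t2} → _≡_ {A = RootDiagram n} ((((R1 , v1) , w1)) , t1) (((R2 , v2) , w2) , t2)
RootDiagram-≡ refl {v1} {w1} {t1} {v2} {w2} {t2} rewrite T-irrelevant v1 v2 | T-irrelevant w1 w2 | T-irrelevant t1 t2 = refl

NonnestingPerm3-≡ : ∀ {n} {σ1 σ2 : Vec (Fin n) n} → σ1 ≡ σ2 → ∀ {i1 w1 i2 w2} → _≡_ {A = NonnestingPerm3 n} ((σ1 , i1) , w1) ((σ2 , i2) , w2)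
NonnestingPerm3-≡ refl {i1} {w1} {i2} {w2} rewrite T-irrelevant i1 i2 | T-irrelevant w1 w2 = refl

rootDiagrams↔permutations : ∀ n → RootDiagram n ↔ NonnestingPerm3 n
rootDiagrams↔permutations n = mk↔ₛ′ toPermutation fromPermutation to∘from from∘to
  where
  toPermutation : RootDiagram n → NonnestingPerm3 n
  toPermutation (((R , v) , w) , t) = (W.σv , W.injσ) , subst T (nonnesting3-cong (permutationDiagram-sameArcs W.σv W.injσ)) (subst Nonnesting (sym W.diagram-of-σ) w)
    where open RootPermutation R v t
  fromPermutation : NonnestingPerm3 n → RootDiagram n
  fromPermutation ((σv , inj) , w) = ((PermutationDiagram.D σv inj , PermutationDiagram.validD σv inj) , subst T (sym (nonnesting3-cong (permutationDiagram-sameArcs σv inj))) w) , subst (T ∘ isRoot) (sym (label-permutationDiagram σv inj)) tt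
  to∘from : ∀ x → toPermutation (fromPermutation x) ≡ x
  to∘from ((σv , inj) , w) = NonnestingPerm3-≡ (PermutationRoundTrip.σ-of-diagram σv inj)
  from∘to : ∀ y → fromPermutation (toPermutation y) ≡ y
  from∘to (((R , v) , w) , t) = RootDiagram-≡ (RootPermutation.W.diagram-of-σ R v t)

theorem10 : (n : ℕ) →
    (Fin (nodesAtLevel n) ↔ Sigma2 n) × (Fin (rootLabelledAtLevel n) ↔ NonnestingPerm3 n)
theorem10 n = eIso (levelEnumeration n) , ↔-trans (rootLabelled↔rootDiagrams n) (rootDiagrams↔permutations n)
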